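{- For all positive integers $d$ and $m$, \[ E_{d^m} = \sum_{\tau} H^+_{m\tau} \qquad\text{and}\qquad H_{d^m} = \sum_{\tau} E^+_{m\tau}, \] where both sums are over all stack partitions $\tau$ of $d$ whose stacks have multiplicities that are powers of $2$ and pairwise distinct.
   Context: $\mathsf{P\Lambda}$ denotes the $\mathbb{Q}$-algebra of polysymmetric functions: formal power series of bounded degree in variables $x_{i,j}$ ($i,j\ge1$), $x_{i,j}$ of degree $i$, invariant under every permutation of $x_{i,1},x_{i,2},\dots$ for each fixed $i$. A stack is a pair of positive integers $d^m$ (degree $d$, multiplicity $m$); a stack partition $\tau\Vdash n$ is a finite weakly decreasing sequence of stacks $(d_1^{m_1},\dots,d_s^{m_s})$ with $\sum d_im_i=n$; an ordinary partition $\alpha\vdash n$ has all multiplicities $1$; $\ell(\tau)=s$, $\operatorname{area}(\tau)=\sum m_i$. $M_\tau=\sum_\alpha x_{d_1,\alpha_1}^{m_1}\cdots x_{d_s,\alpha_s}^{m_s}$ over sequences $\alpha$ of positive integers with $\alpha_i\ne\alpha_j$ whenever $d_i=d_j$, $i\ne j$. Define $H_d=\sum_{\alpha\Vdash d}M_\alpha$, $E^+_d=\sum_{\alpha\vdash d}M_\alpha$, $E_d=\sum_{\alpha\vdash d}(-1)^{\ell(\alpha)}M_\alpha$, $H^+_d=\sum_{\alpha\Vdash d}(-1)^{\operatorname{area}(\alpha)}M_\alpha$. For each such $F$, $F_{d^m}$ is $F_d$ with each $x_{i,j}$ replaced by $x_{i,j}^m$, and $F_\tau=\prod_i F_{d_i^{m_i}}$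 for $\tau=(d_1^{m_1},\dots,d_s^{m_s})$. For a positive integer $m$, $m\tau$ is the stack partition obtained from $\tau$ by multiplying every multiplicity by $m$. -}

module Defs where

open import Data.Bool using (Bool; true; false; _∧_; not; if_then_else_)
open import Data.Nat using (ℕ; zero; suc; _∸_; _⊔_; _≡ᵇ_; _≤ᵇ_) renaming (_+_ to _+ℕ_; _*_ to _*ℕ_; _^_ to _^ℕ_)
open import Data.Integer using (ℤ; 0ℤ; 1ℤ; -1ℤ; _+_; _*_; _^_)
open import Data.List using (List; []; _∷_; map; foldr; length; upTo; concatMap)
open import Data.Bool.ListAction using (all; any)
open import Data.Product using (_×_; _,_; proj₁; proj₂)
open import Relation.Binary.PropositionalEquality using (_≡_)

range1 : ℕ → List ℕ
range1 n = map suc (upTo n)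

at : {A : Set} → A → List A → ℕ → A
at z []       _       = z
at z (x ∷ xs) zero    = x
at z (x ∷ xs) (suc n) = at z xs n

tuples : {A : Set} → ℕ → List A → List (List A)
tuples zero    vs = [] ∷ []
tuples (suc k) vs = concatMap (λ v → map (v ∷_) (tuples k vs)) vs

listsUpTo : {A : Set} → ℕ → List A → List (List A)
listsUpTo n vs = concatMap (λ k → tuples k vs) (upTo (suc n))

filterᵇ : {A : Set} → (A → Bool) → List A → List A
filterᵇ p []       = []
filterᵇ p (x ∷ xs) = if p x then x ∷ filterᵇ p xs else filterᵇ p xs

sumℕ : List ℕ → ℕ
sumℕ = foldr _+ℕ_ 0

sumℤ : List ℤ → ℤ
sumℤ = foldr _+_ 0ℤ

-- A monomial is a list of rows; entry (i-1) of the list is the row of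
-- degree i, and entry (j-1) of that row is the exponent of x_{i,j}.
-- Missing entries are exponent 0 (so trailing zeros are irrelevant).

Mono : Set
Mono = List (List ℕ)

expo : Mono → ℕ → ℕ → ℕ
expo μ i j = at 0 (at [] μ (i ∸ 1)) (j ∸ 1)

rowBound : Mono → ℕ
rowBound = foldr (λ r b → length r ⊔ b) 0

-- exact (list) equality of monomial representations, as a Boolean
eqRow : List ℕ → List ℕ → Bool
eqRow []       []       = true
eqRow (x ∷ xs) (y ∷ ys) = (x ≡ᵇ y) ∧ eqRow xs ys
eqRow _        _        = false

eqMono : Mono → Mono → Bool
eqMono []       []       = true
eqMono (x ∷ xs) (y ∷ ys) = eqRow x y ∧ eqMono xs ys
eqMono _        _        = false

-- all factorisations μ = μ₁ · μ₂ (μ₁ , μ₂ written with the same shape as μ)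
splitsRow : List ℕ → List (List ℕ × List ℕ)
splitsRow []       = ([] , []) ∷ []
splitsRow (e ∷ es) =
  concatMap (λ a → map (λ p → (a ∷ proj₁ p) , ((e ∸ a) ∷ proj₂ p)) (splitsRow es))
            (upTo (suc e))

splits : Mono → List (Mono × Mono)
splits []       = ([] , []) ∷ []
splits (r ∷ rs) =
  concatMap (λ p → map (λ q → (proj₁ p ∷ proj₁ q) , (proj₂ p ∷ proj₂ q)) (splits rs))
            (splitsRow r)

-- Formal power series in the x_{i,j} with integer coefficients,
-- represented by their coefficient function.  (All series in the
-- statement have integer coefficients; ℤ ⊆ ℚ.)

Series : Set
Series = Mono → ℤ

_≋_ : Series → Series → Set
f ≋ g = (μ : Mono) → f μ ≡ g μ

infix 4 _≋_

oneS : Series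
oneS μ = if all (all (_≡ᵇ 0)) μ then 1ℤ else 0ℤ

_⊛_ : Series → Series → Series
(f ⊛ g) μ = sumℤ (map (λ p → f (proj₁ p) * g (proj₂ p)) (splits μ))

infixl 7 _⊛_

ΣS : List Series → Series
ΣS fs μ = sumℤ (map (λ f → f μ) fs)

_·S_ : ℤ → Series → Series
(c ·S f) μ = c * f μ

-- substitution x_{i,j} ↦ x_{i,j}^m : the coefficient of μ is the
-- coefficient of ν in f if μ = ν^m, and 0 if μ is not an m-th power.
powMono : ℕ → Mono → Mono
powMono m = map (map (m *ℕ_))

subst^ : ℕ → Series → Series
subst^ m f μ = sumℤ (map (λ p → if eqMono (powMono m (proj₁ p)) μ then f (proj₁ p) else 0ℤ)
                         (splits μ))

Stack : Set
Stack = ℕ × ℕ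

deg : Stack → ℕ
deg = proj₁

mult : Stack → ℕ
mult = proj₂

StackPartition : Set
StackPartition = List Stack

_≤ˢ_ : Stack → Stack → Bool
(d , m) ≤ˢ (d' , m') = if d ≡ᵇ d' then m ≤ᵇ m' else d ≤ᵇ d'

weaklyDecreasing : StackPartition → Bool
weaklyDecreasing []           = true
weaklyDecreasing (s ∷ [])     = true
weaklyDecreasing (s ∷ t ∷ τ)  = (t ≤ˢ s) ∧ weaklyDecreasing (t ∷ τ)

size : StackPartition → ℕ
size τ = sumℕ (map (λ s → deg s *ℕ mult s) τ)

ℓ : StackPartition → ℕ
ℓ = length

area : StackPartition → ℕ
area τ = sumℕ (map mult τ)

isStackPartitionOf : ℕ → StackPartition → Bool
isStackPartitionOf n τ =
  all (λ s → (1 ≤ᵇ deg s) ∧ (1 ≤ᵇ mult s)) τ ∧ (size τ ≡ᵇ n) ∧ weaklyDecreasing τ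

stacksUpTo : ℕ → List Stack
stacksUpTo n = concatMap (λ d → map (λ m → d , m) (range1 n)) (range1 n)

stackPartitions : ℕ → List StackPartition
stackPartitions n = filterᵇ (λ τ → isStackPartitionOf n τ) (listsUpTo n (stacksUpTo n))

isOrdinary : StackPartition → Bool
isOrdinary = all (λ s → mult s ≡ᵇ 1)

partitions : ℕ → List StackPartition
partitions n = filterᵇ isOrdinary (stackPartitions n)

_·τ_ : ℕ → StackPartition → StackPartition
m ·τ τ = map (λ s → deg s , m *ℕ mult s) τ

-- Monomial polysymmetric functions
-- M_τ = Σ_α x_{d_1,α_1}^{m_1} ⋯ x_{d_s,α_s}^{m_s}, α_i ≥ 1, α_i ≠ α_j when
-- d_i = d_j (i ≠ j); each resulting monomial is counted once (the usual
-- monomial-basis convention), i.e. the coefficient of x^μ is 1 if μ arises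
-- from some admissible α and 0 otherwise.

admissible : StackPartition → List ℕ → Bool
admissible (s ∷ τ) (a ∷ α) =
  all (λ p → not ((deg s ≡ᵇ deg (proj₁ p)) ∧ (a ≡ᵇ proj₂ p))) (zipP τ α) ∧ admissible τ α
  where
    zipP : StackPartition → List ℕ → List (Stack × ℕ)
    zipP (t ∷ ts) (b ∷ bs) = (t , b) ∷ zipP ts bs
    zipP _        _        = []
admissible _       _       = true

stackExpo : StackPartition → List ℕ → ℕ → ℕ → ℕ
stackExpo (s ∷ τ) (a ∷ α) i j =
  (if (deg s ≡ᵇ i) ∧ (a ≡ᵇ j) then mult s else 0) +ℕ stackExpo τ α i j
stackExpo _       _       i j = 0

maxDeg : StackPartition → ℕ
maxDeg = foldr (λ s b → deg s ⊔ b) 0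

produces : StackPartition → List ℕ → Mono → Bool
produces τ α μ =
  all (λ i → all (λ j → expo μ i j ≡ᵇ stackExpo τ α i j) (range1 (rowBound μ)))
      (range1 (length μ ⊔ maxDeg τ))

M : StackPartition → Series
M τ μ = if any (λ α → admissible τ α ∧ produces τ α μ)
               (tuples (length τ) (range1 (rowBound μ)))
        then 1ℤ else 0ℤ

H : ℕ → Series
H d = ΣS (map M (stackPartitions d))

E⁺ : ℕ → Series
E⁺ d = ΣS (map M (partitions d))

E : ℕ → Series
E d = ΣS (map (λ α → (-1ℤ ^ ℓ α) ·S M α) (partitions d))

H⁺ : ℕ → Series
H⁺ d = ΣS (map (λ α → (-1ℤ ^ area α) ·S M α) (stackPartitions d))

_at-stack_ : (ℕ → Series) → Stack → Series
F at-stack s = subst^ (mult s) (F (deg s))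

_at-part_ : (ℕ → Series) → StackPartition → Series
F at-part τ = foldr (λ s acc → (F at-stack s) ⊛ acc) oneS τ

isPowerOf2 : ℕ → Bool
isPowerOf2 k = any (λ e → (2 ^ℕ e) ≡ᵇ k) (upTo (suc k))

distinctMults : StackPartition → Bool
distinctMults []      = true
distinctMults (s ∷ τ) = all (λ t → not (mult s ≡ᵇ mult t)) τ ∧ distinctMults τ

goodIndex : StackPartition → Bool
goodIndex τ = all (λ s → isPowerOf2 (mult s)) τ ∧ distinctMults τ

goodStackPartitions : ℕ → List StackPartition
goodStackPartitions d = filterᵇ goodIndex (stackPartitions d)

-- Each of H, E, E⁺, H⁺ in degree d is the degree-d part of a product, over all variables x_{i,j},
-- of one power series in that variable: 1/(1-x), 1-x, 1+x and 1/(1+x) respectively, because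
-- among the stack partitions of d only the shape of a monomial has M_τ nonzero there. The
-- substitution x ↦ x^m preserves this form. On the right-hand sides, a stack partition with
-- distinct multiplicities m 2^k selects for each k the degree contributed by the factor in
-- x^(m 2^k), so the sums are degree-dm parts of ∏_{k<d} f(x^(m 2^k)) per variable. For
-- f = 1/(1+x) this telescopes by (1-y²)/(1+y) = 1-y to (1-x^m)/(1-x^(m 2^d)), and for f = 1+x by
-- (1+y)/(1-y²) = 1/(1-y) to (1-x^(m 2^d))/(1-x^m); below degree m 2^d these are 1-x^m and 1/(1-x^m).
module Submission where

open import Defs
open import Algebra.Bundles using (CommutativeMonoid)
open import Algebra.Structures using (IsCommutativeMonoid)
open import Data.Bool using (Bool; true; false; _∧_; not; if_then_else_)
import Data.Bool.Properties as Bool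
open import Data.Bool.ListAction using (all; any)
open import Data.Empty using (⊥; ⊥-elim)
open import Data.Integer using (ℤ; 0ℤ; 1ℤ; -1ℤ; _+_; _-_; _*_; -_; _^_)
import Data.Integer.Properties as ℤ
open import Data.Integer.Solver using (module +-*-Solver)
open import Data.List using (List; []; _∷_; map; foldr; length; upTo; concatMap; _++_)
import Data.List.Properties as List
open import Data.List.Membership.Propositional using (_∈_; find; lose)
import Data.List.Membership.Propositional.Properties as ∈
open import Data.List.Membership.Propositional.Properties.WithK using (unique∧set⇒bag)
open import Data.List.Relation.Binary.BagAndSetEquality using (∼bag⇒↭)
open import Data.List.Relation.Binary.Permutation.Propositional as ↭ using (_↭_; ↭-sym; ↭-trans; ↭⇒↭ₛ; ↭⇒↭ₛ′)
import Data.List.Relation.Binary.Permutation.Propositional.Properties as ↭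
import Data.List.Relation.Binary.Permutation.Setoid.Properties as ↭ₛ
open import Data.List.Relation.Binary.Pointwise using (Pointwise-≡⇒≡)
open import Data.List.Relation.Unary.All as All using (All; []; _∷_)
open import Data.List.Relation.Unary.All.Properties using () renaming (map⁺ to All-map⁺; map⁻ to All-map⁻)
open import Data.List.Relation.Unary.AllPairs as AllPairs using (AllPairs; []; _∷_)
open import Data.List.Relation.Unary.AllPairs.Properties using () renaming (map⁻ to AllPairs-map⁻)
open import Data.List.Relation.Unary.Any using (here; there)
open import Data.List.Relation.Unary.Linked using (Linked; []; [-]; _∷_)
open import Data.List.Relation.Unary.Linked.Properties using (Linked⇒AllPairs)
import Data.List.Relation.Unary.Sorted.TotalOrder.Properties as Sorted
open import Data.List.Relation.Unary.Unique.Propositional using (Unique)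
import Data.List.Relation.Unary.Unique.Propositional.Properties as Unique
import Data.List.Sort
open import Data.Nat using (ℕ; zero; suc; _≤_; _<_; z≤n; s≤s; _≡ᵇ_; _≤ᵇ_; _∸_; _⊔_; NonZero; >-nonZero)
  renaming (_+_ to _+ℕ_; _*_ to _*ℕ_; _^_ to _^ℕ_)
open import Data.Nat.Divisibility
  using (_∣_; _∣?_; divides; divides-refl; _∣0; ∣-refl; ∣m∣n⇒∣m+n; ∣m+n∣m⇒∣n; ∣n⇒∣m*n; ∣⇒≤)
open import Data.Nat.Induction using (<-rec)
import Data.Nat.Properties as ℕ
open import Data.Nat.Solver using () renaming (module +-*-Solver to ℕ-Solver)
open import Data.Product using (∃-syntax; _×_; _,_; proj₁; proj₂; map₁; swap) renaming (map to ×-map)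
open import Data.Product.Properties using (≡-dec)
open import Data.Sum using (_⊎_; inj₁; inj₂) renaming (map to ⊎-map)
open import Function using (_∘_; id; mk⇔; Equivalence)
open import Level using (0ℓ)
open import Relation.Binary.Bundles using (Setoid; DecTotalOrder)
import Relation.Binary.Construct.Flip.EqAndOrd as Flip
open import Relation.Binary.Definitions using (DecidableEquality; tri<; tri≈; tri>)
open import Relation.Binary.PropositionalEquality
  using (_≡_; _≢_; refl; sym; trans; cong; cong₂; subst; setoid; isEquivalence; resp₂; module ≡-Reasoning)
import Relation.Binary.Reasoning.Setoid as SetoidReasoning
open import Relation.Binary.Structures using (IsEquivalence)
open import Relation.Nullary using (¬_; Dec; yes; no)

private
  variable
    A B : Set

𝟙 : Bool → ℤ
𝟙 true  = 1ℤ
𝟙 false = 0ℤ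

𝟙-∧ : (a b : Bool) → 𝟙 (a ∧ b) ≡ 𝟙 a * 𝟙 b
𝟙-∧ true  b = sym (ℤ.*-identityˡ _)
𝟙-∧ false b = refl

if-then-0 : (b : Bool) (x : ℤ) → (if b then x else 0ℤ) ≡ 𝟙 b * x
if-then-0 true  x = sym (ℤ.*-identityˡ x)
if-then-0 false x = refl

∧-true : (a b : Bool) → a ∧ b ≡ true → (a ≡ true) × (b ≡ true)
∧-true true true _ = refl , refl

false≢true : false ≢ true
false≢true ()

Bool-ext : (a b : Bool) → (a ≡ true → b ≡ true) → (b ≡ true → a ≡ true) → a ≡ b
Bool-ext true  b     f g = sym (f refl)
Bool-ext false true  f g = g refl
Bool-ext false false f g = refl

≡ᵇ⇒≡ : (m n : ℕ) → (m ≡ᵇ n) ≡ true → m ≡ n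
≡ᵇ⇒≡ m n = ℕ.≡ᵇ⇒≡ m n ∘ Equivalence.from Bool.T-≡

≡⇒≡ᵇ : {m n : ℕ} → m ≡ n → (m ≡ᵇ n) ≡ true
≡⇒≡ᵇ {m} {n} = Equivalence.to Bool.T-≡ ∘ ℕ.≡⇒≡ᵇ m n

≢⇒≡ᵇ-false : {m n : ℕ} → m ≢ n → (m ≡ᵇ n) ≡ false
≢⇒≡ᵇ-false {m} {n} m≢n with m ≡ᵇ n in eq
... | true  = ⊥-elim (m≢n (≡ᵇ⇒≡ m n eq))
... | false = refl

≤ᵇ⇒≤ : (m n : ℕ) → (m ≤ᵇ n) ≡ true → m ≤ n
≤ᵇ⇒≤ m n = ℕ.≤ᵇ⇒≤ m n ∘ Equivalence.from Bool.T-≡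

≤⇒≤ᵇ : {m n : ℕ} → m ≤ n → (m ≤ᵇ n) ≡ true
≤⇒≤ᵇ = Equivalence.to Bool.T-≡ ∘ ℕ.≤⇒≤ᵇ

all-sound : (p : A → Bool) (xs : List A) → all p xs ≡ true → All (λ x → p x ≡ true) xs
all-sound p []       _ = []
all-sound p (x ∷ xs) h = proj₁ (∧-true _ _ h) ∷ all-sound p xs (proj₂ (∧-true _ _ h))

all-complete : (p : A → Bool) (xs : List A) → All (λ x → p x ≡ true) xs → all p xs ≡ true
all-complete p []       []         = refl
all-complete p (x ∷ xs) (px ∷ pxs) = cong₂ _∧_ px (all-complete p xs pxs)

any-sound : (p : A → Bool) (xs : List A) → any p xs ≡ true → ∃[ x ] (x ∈ xs × p x ≡ true)
any-sound p (x ∷ xs) h with p x in eq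
... | true  = x , here refl , eq
... | false with any-sound p xs h
...   | y , y∈xs , py = y , there y∈xs , py

any-complete : (p : A → Bool) {xs : List A} {x : A} → x ∈ xs → p x ≡ true → any p xs ≡ true
any-complete p {y ∷ xs} (here refl) px rewrite px = refl
any-complete p {y ∷ xs} (there x∈xs) px with p y
... | true  = refl
... | false = any-complete p x∈xs px

∈-filterᵇ⁺ : (p : A → Bool) {xs : List A} {x : A} → x ∈ xs → p x ≡ true → x ∈ filterᵇ p xs
∈-filterᵇ⁺ p {y ∷ xs} (here refl) px rewrite px = here refl
∈-filterᵇ⁺ p {y ∷ xs} (there x∈xs) px with p y
... | true  = there (∈-filterᵇ⁺ p x∈xs px)
... | false = ∈-filterᵇ⁺ p x∈xs px

∈-filterᵇ⁻ : (p : A → Bool) {xs : List A} {x : A} → x ∈ filterᵇ p xs → (x ∈ xs) × (p x ≡ true)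
∈-filterᵇ⁻ p {y ∷ xs} x∈ with p y in eq
∈-filterᵇ⁻ p {y ∷ xs} (here refl)  | true = here refl , eq
∈-filterᵇ⁻ p {y ∷ xs} (there x∈)   | true = map₁ there (∈-filterᵇ⁻ p x∈)
∈-filterᵇ⁻ p {y ∷ xs} x∈           | false = map₁ there (∈-filterᵇ⁻ p x∈)

filterᵇ-unique : (p : A → Bool) {xs : List A} → Unique xs → Unique (filterᵇ p xs)
filterᵇ-unique p {[]}     []           = []
filterᵇ-unique p {y ∷ xs} (y∉xs ∷ uxs) with p y
... | true  = All.tabulate (λ z∈ → All.lookup y∉xs (proj₁ (∈-filterᵇ⁻ p z∈))) ∷ filterᵇ-unique p uxs
... | false = filterᵇ-unique p uxs

module FoldMap {M : Set} {_∙_ : M → M → M} {ε : M} (isCM : IsCommutativeMonoid _≡_ _∙_ ε) where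

  open IsCommutativeMonoid isCM using (assoc; identityˡ; identityʳ)

  commutativeMonoid : CommutativeMonoid 0ℓ 0ℓ
  commutativeMonoid = record { isCommutativeMonoid = isCM }

  open import Algebra.Properties.CommutativeSemigroup (CommutativeMonoid.commutativeSemigroup commutativeMonoid)
    using (interchange)

  foldMap : (A → M) → List A → M
  foldMap f xs = foldr _∙_ ε (map f xs)

  foldMap-++ : (f : A → M) (xs ys : List A) → foldMap f (xs ++ ys) ≡ foldMap f xs ∙ foldMap f ys
  foldMap-++ f []       ys = sym (identityˡ _)
  foldMap-++ f (x ∷ xs) ys = trans (cong (f x ∙_) (foldMap-++ f xs ys)) (sym (assoc (f x) _ _))

  foldMap-map : (f : B → M) (g : A → B) (xs : List A) → foldMap f (map g xs) ≡ foldMap (f ∘ g) xs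
  foldMap-map f g []       = refl
  foldMap-map f g (x ∷ xs) = cong (f (g x) ∙_) (foldMap-map f g xs)

  foldMap-concatMap : (f : B → M) (g : A → List B) (xs : List A) →
    foldMap f (concatMap g xs) ≡ foldMap (λ x → foldMap f (g x)) xs
  foldMap-concatMap f g []       = refl
  foldMap-concatMap f g (x ∷ xs) =
    trans (foldMap-++ f (g x) (concatMap g xs)) (cong (foldMap f (g x) ∙_) (foldMap-concatMap f g xs))

  foldMap-cong : {f g : A → M} (xs : List A) → (∀ x → x ∈ xs → f x ≡ g x) → foldMap f xs ≡ foldMap g xs
  foldMap-cong []       h = refl
  foldMap-cong (x ∷ xs) h = cong₂ _∙_ (h x (here refl)) (foldMap-cong xs (λ y y∈ → h y (there y∈)))

  foldMap-ext : {f g : A → M} (xs : List A) → (∀ x → f x ≡ g x) → foldMap f xs ≡ foldMap g xs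
  foldMap-ext xs h = foldMap-cong xs (λ x _ → h x)

  foldMap-∙ : (f g : A → M) (xs : List A) → foldMap (λ x → f x ∙ g x) xs ≡ foldMap f xs ∙ foldMap g xs
  foldMap-∙ f g []       = sym (identityˡ ε)
  foldMap-∙ f g (x ∷ xs) =
    trans (cong ((f x ∙ g x) ∙_) (foldMap-∙ f g xs)) (interchange (f x) (g x) (foldMap f xs) (foldMap g xs))

  foldMap-ε : {f : A → M} (xs : List A) → (∀ x → x ∈ xs → f x ≡ ε) → foldMap f xs ≡ ε
  foldMap-ε xs h = trans (foldMap-cong xs h) (foldMap-const xs)
    where
    foldMap-const : (xs : List A) → foldMap (λ _ → ε) xs ≡ ε
    foldMap-const []       = refl
    foldMap-const (x ∷ xs) = trans (cong (ε ∙_) (foldMap-const xs)) (identityˡ ε)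

  foldMap-swap : (F : A → B → M) (xs : List A) (ys : List B) →
    foldMap (λ x → foldMap (F x) ys) xs ≡ foldMap (λ y → foldMap (λ x → F x y) xs) ys
  foldMap-swap F []       ys = sym (foldMap-ε ys (λ _ _ → refl))
  foldMap-swap F (x ∷ xs) ys =
    trans (cong (foldMap (F x) ys ∙_) (foldMap-swap F xs ys)) (sym (foldMap-∙ (F x) (λ y → foldMap (λ x → F x y) xs) ys))

  foldMap-↭ : (f : A → M) {xs ys : List A} → xs ↭ ys → foldMap f xs ≡ foldMap f ys
  foldMap-↭ f p = ↭ₛ.foldr-commMonoid (setoid M) isCM (↭⇒↭ₛ (↭.map⁺ f p))

  foldMap-single : (f : A → M) {xs : List A} {x₀ : A} → Unique xs → x₀ ∈ xs →
    (∀ x → x ∈ xs → x ≢ x₀ → f x ≡ ε) → foldMap f xs ≡ f x₀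
  foldMap-single f {x ∷ xs} (x∉xs ∷ _) (here refl) h =
    trans (cong (f x ∙_) (foldMap-ε xs (λ y y∈ → h y (there y∈) (λ y≡x → All.lookup x∉xs y∈ (sym y≡x)))))
          (identityʳ (f x))
  foldMap-single f {x ∷ xs} (x∉xs ∷ uxs) (there x₀∈) h =
    trans (cong₂ _∙_ (h x (here refl) (λ x≡x₀ → All.lookup x∉xs x₀∈ x≡x₀)) (foldMap-single f uxs x₀∈ (λ y y∈ → h y (there y∈))))
          (identityˡ (f _))

  foldMap-≢ε : DecidableEquality M → (f : A → M) (xs : List A) → foldMap f xs ≢ ε → ∃[ x ] (x ∈ xs × f x ≢ ε)
  foldMap-≢ε _≟_ f []       ≢ε = ⊥-elim (≢ε refl)
  foldMap-≢ε _≟_ f (x ∷ xs) ≢ε with f x ≟ ε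
  ... | no fx≢ε  = x , here refl , fx≢ε
  ... | yes fx≡ε with foldMap-≢ε _≟_ f xs (λ ≡ε → ≢ε (trans (cong₂ _∙_ fx≡ε ≡ε) (identityˡ ε)))
  ...   | y , y∈xs , fy≢ε = y , there y∈xs , fy≢ε

open FoldMap ℤ.+-0-isCommutativeMonoid
  using () renaming ( foldMap to ∑; foldMap-++ to ∑-++; foldMap-map to ∑-map; foldMap-concatMap to ∑-concatMap
           ; foldMap-cong to ∑-cong; foldMap-ext to ∑-ext; foldMap-∙ to ∑-+; foldMap-ε to ∑-zero
           ; foldMap-swap to ∑-swap; foldMap-↭ to ∑-↭; foldMap-single to ∑-single; foldMap-≢ε to ∑-≢0 )
open FoldMap ℕ.+-0-isCommutativeMonoid
  using () renaming ( foldMap to ∑ℕ; foldMap-++ to ∑ℕ-++; foldMap-map to ∑ℕ-map; foldMap-ε to ∑ℕ-zero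
                    ; foldMap-↭ to ∑ℕ-↭; foldMap-single to ∑ℕ-single; foldMap-≢ε to ∑ℕ-≢0 )
open FoldMap ℤ.*-1-isCommutativeMonoid
  using () renaming (foldMap to ∏; foldMap-++ to ∏-++; foldMap-map to ∏-map; foldMap-cong to ∏-cong; foldMap-↭ to ∏-↭)

∑-*ˡ : (c : ℤ) (f : A → ℤ) (xs : List A) → c * ∑ f xs ≡ ∑ (λ x → c * f x) xs
∑-*ˡ c f []       = ℤ.*-zeroʳ c
∑-*ˡ c f (x ∷ xs) = trans (ℤ.*-distribˡ-+ c (f x) _) (cong (c * f x +_) (∑-*ˡ c f xs))

∑-*ʳ : (c : ℤ) (f : A → ℤ) (xs : List A) → ∑ f xs * c ≡ ∑ (λ x → f x * c) xs
∑-*ʳ c f xs = trans (ℤ.*-comm _ c) (trans (∑-*ˡ c f xs) (∑-ext xs (λ x → ℤ.*-comm c (f x))))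

∑-filterᵇ : (f : A → ℤ) (p : A → Bool) (xs : List A) → ∑ f (filterᵇ p xs) ≡ ∑ (λ x → 𝟙 (p x) * f x) xs
∑-filterᵇ f p []       = refl
∑-filterᵇ f p (x ∷ xs) with p x
... | true  = cong₂ _+_ (sym (ℤ.*-identityˡ (f x))) (∑-filterᵇ f p xs)
... | false = trans (∑-filterᵇ f p xs) (sym (ℤ.+-identityˡ _))

∈-concatMap⁺′ : (f : A → List B) {xs : List A} {x : A} {y : B} → x ∈ xs → y ∈ f x → y ∈ concatMap f xs
∈-concatMap⁺′ f x∈xs y∈fx = ∈.∈-concatMap⁺ f (lose x∈xs y∈fx)

∈-concatMap⁻′ : (f : A → List B) (xs : List A) {y : B} → y ∈ concatMap f xs → ∃[ x ] (x ∈ xs × y ∈ f x)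
∈-concatMap⁻′ f xs y∈ = find (∈.∈-concatMap⁻ f y∈)

concatMap-unique : (f : A → List B) {xs : List A} → Unique xs → (∀ x → x ∈ xs → Unique (f x)) →
  (∀ {x x′ y} → x ∈ xs → x′ ∈ xs → y ∈ f x → y ∈ f x′ → x ≡ x′) → Unique (concatMap f xs)
concatMap-unique f {[]}     []           _  _        = []
concatMap-unique f {x ∷ xs} (x∉xs ∷ uxs) uf disjoint =
  Unique.++⁺ (uf x (here refl))
    (concatMap-unique f uxs (λ y y∈ → uf y (there y∈)) (λ y∈ y′∈ → disjoint (there y∈) (there y′∈)))
    (λ (v∈fx , v∈rest) → not-in-rest v∈fx v∈rest)
  where
  not-in-rest : ∀ {v} → v ∈ f x → v ∈ concatMap f xs → ⊥
  not-in-rest v∈fx v∈rest with ∈-concatMap⁻′ f xs v∈rest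
  ... | x′ , x′∈xs , v∈fx′ = All.lookup x∉xs x′∈xs (disjoint (here refl) (there x′∈xs) v∈fx v∈fx′)

map-unique : (f : A → B) {xs : List A} → Unique xs → (∀ {x y} → x ∈ xs → y ∈ xs → f x ≡ f y → x ≡ y) →
  Unique (map f xs)
map-unique f {[]}     []           _   = []
map-unique f {x ∷ xs} (x∉xs ∷ uxs) inj =
  All-map⁺ (All.tabulate (λ y∈ → All.lookup x∉xs y∈ ∘ inj (here refl) (there y∈)))
    ∷ map-unique f uxs (λ x∈ y∈ → inj (there x∈) (there y∈))

∈-upTo⁻ : {k n : ℕ} → k ∈ upTo n → k < n
∈-upTo⁻ k∈ with ∈.∈-applyUpTo⁻ id k∈
... | _ , k<n , refl = k<n

upTo-unique : (n : ℕ) → Unique (upTo n)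
upTo-unique n = Unique.applyUpTo⁺₁ id n (λ i<j _ → ℕ.<⇒≢ i<j)

∑-upTo-suc : (f : ℕ → ℤ) (n : ℕ) → ∑ f (upTo (suc n)) ≡ f 0 + ∑ (f ∘ suc) (upTo n)
∑-upTo-suc f n = cong (f 0 +_) (trans (cong (∑ f) (sym (List.map-applyUpTo id suc n))) (∑-map f suc (upTo n)))

range1-unique : (n : ℕ) → Unique (range1 n)
range1-unique n = Unique.map⁺ ℕ.suc-injective (upTo-unique n)

∈-range1⁻ : {x n : ℕ} → x ∈ range1 n → (1 ≤ x) × (x ≤ n)
∈-range1⁻ x∈ with ∈.∈-map⁻ suc x∈
... | _ , y∈ , refl = s≤s z≤n , ∈-upTo⁻ y∈

∈-range1⁺ : {x n : ℕ} → 1 ≤ x → x ≤ n → x ∈ range1 n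
∈-range1⁺ {suc x} _ x≤n = ∈.∈-map⁺ suc (∈.∈-upTo⁺ x≤n)

tuples-unique : (k : ℕ) {vs : List A} → Unique vs → Unique (tuples k vs)
tuples-unique zero    uvs = [] ∷ []
tuples-unique (suc k) {vs} uvs =
  concatMap-unique (λ v → map (v ∷_) (tuples k vs)) uvs
    (λ v _ → Unique.map⁺ (λ e → proj₂ (List.∷-injective e)) (tuples-unique k uvs)) same-head
  where
  same-head : ∀ {x x′ y} → x ∈ vs → x′ ∈ vs → y ∈ map (x ∷_) (tuples k vs) → y ∈ map (x′ ∷_) (tuples k vs) → x ≡ x′
  same-head _ _ y∈ y∈′ with ∈.∈-map⁻ _ y∈ | ∈.∈-map⁻ _ y∈′
  ... | _ , _ , refl | _ , _ , e = proj₁ (List.∷-injective e)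

∈-tuples⁻ : (k : ℕ) (vs : List A) {y : List A} → y ∈ tuples k vs → (length y ≡ k) × All (_∈ vs) y
∈-tuples⁻ zero    vs (here refl) = refl , []
∈-tuples⁻ (suc k) vs y∈ with ∈-concatMap⁻′ (λ v → map (v ∷_) (tuples k vs)) vs y∈
... | v , v∈vs , y∈′ with ∈.∈-map⁻ (v ∷_) y∈′
...   | z , z∈ , refl with ∈-tuples⁻ k vs z∈
...     | len , all∈ = cong suc len , v∈vs ∷ all∈

∈-tuples⁺ : (vs : List A) {y : List A} → All (_∈ vs) y → y ∈ tuples (length y) vs
∈-tuples⁺ vs []                     = here refl
∈-tuples⁺ vs {v ∷ y} (v∈vs ∷ all∈) =
  ∈-concatMap⁺′ (λ v → map (v ∷_) (tuples (length y) vs)) v∈vs (∈.∈-map⁺ (v ∷_) (∈-tuples⁺ vs all∈))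

listsUpTo-unique : (n : ℕ) {vs : List A} → Unique vs → Unique (listsUpTo n vs)
listsUpTo-unique n {vs} uvs =
  concatMap-unique (λ k → tuples k vs) (upTo-unique (suc n)) (λ k _ → tuples-unique k uvs)
    (λ {k} {k′} _ _ y∈ y∈′ → trans (sym (proj₁ (∈-tuples⁻ k vs y∈))) (proj₁ (∈-tuples⁻ k′ vs y∈′)))

∈-listsUpTo⁺ : (n : ℕ) (vs : List A) {y : List A} → length y ≤ n → All (_∈ vs) y → y ∈ listsUpTo n vs
∈-listsUpTo⁺ n vs y≤n all∈ = ∈-concatMap⁺′ (λ k → tuples k vs) (∈.∈-upTo⁺ (s≤s y≤n)) (∈-tuples⁺ vs all∈)

stacksUpTo-unique : (n : ℕ) → Unique (stacksUpTo n)
stacksUpTo-unique n =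
  concatMap-unique (λ d → map (d ,_) (range1 n)) (range1-unique n)
    (λ d _ → Unique.map⁺ (cong proj₂) (range1-unique n)) same-degree
  where
  same-degree : ∀ {d d′ y} → d ∈ range1 n → d′ ∈ range1 n → y ∈ map (d ,_) (range1 n) → y ∈ map (d′ ,_) (range1 n) → d ≡ d′
  same-degree _ _ y∈ y∈′ with ∈.∈-map⁻ _ y∈ | ∈.∈-map⁻ _ y∈′
  ... | _ , _ , refl | _ , _ , e = cong proj₁ e

∈-stacksUpTo⁺ : {n d m : ℕ} → 1 ≤ d → d ≤ n → 1 ≤ m → m ≤ n → (d , m) ∈ stacksUpTo n
∈-stacksUpTo⁺ {n} {d} 1≤d d≤n 1≤m m≤n =
  ∈-concatMap⁺′ (λ d → map (d ,_) (range1 n)) (∈-range1⁺ 1≤d d≤n) (∈.∈-map⁺ (d ,_) (∈-range1⁺ 1≤m m≤n))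

-- The algebra of series

∑-splitsRow-∷ : (F : List ℕ × List ℕ → ℤ) (e : ℕ) (es : List ℕ) →
  ∑ F (splitsRow (e ∷ es)) ≡
  ∑ (λ a → ∑ (λ p → F ((a ∷ proj₁ p) , ((e ∸ a) ∷ proj₂ p))) (splitsRow es)) (upTo (suc e))
∑-splitsRow-∷ F e es =
  trans (∑-concatMap F (λ a → map (λ p → (a ∷ proj₁ p) , ((e ∸ a) ∷ proj₂ p)) (splitsRow es)) (upTo (suc e)))
        (∑-ext (upTo (suc e)) (λ a → ∑-map F (λ p → (a ∷ proj₁ p) , ((e ∸ a) ∷ proj₂ p)) (splitsRow es)))

∑-splits-∷ : (F : Mono × Mono → ℤ) (r : List ℕ) (rs : Mono) →
  ∑ F (splits (r ∷ rs)) ≡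
  ∑ (λ p → ∑ (λ q → F ((proj₁ p ∷ proj₁ q) , (proj₂ p ∷ proj₂ q))) (splits rs)) (splitsRow r)
∑-splits-∷ F r rs =
  trans (∑-concatMap F (λ p → map (λ q → (proj₁ p ∷ proj₁ q) , (proj₂ p ∷ proj₂ q)) (splits rs)) (splitsRow r))
        (∑-ext (splitsRow r) (λ p → ∑-map F (λ q → (proj₁ p ∷ proj₁ q) , (proj₂ p ∷ proj₂ q)) (splits rs)))

∑-splitsRow-factor : (G : List ℕ → List ℕ → List ℕ → ℤ) (g : ℕ → ℕ → ℕ → ℤ) →
  (∀ e es a b x y → G (e ∷ es) (a ∷ x) (b ∷ y) ≡ g e a b * G es x y) → G [] [] [] ≡ 1ℤ →
  ∀ r → ∑ (λ p → G r (proj₁ p) (proj₂ p)) (splitsRow r) ≡ ∏ (λ e → ∑ (λ a → g e a (e ∸ a)) (upTo (suc e))) r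
∑-splitsRow-factor G g G-∷ G-[] []       = trans (ℤ.+-identityʳ _) G-[]
∑-splitsRow-factor G g G-∷ G-[] (e ∷ es) = begin
  ∑ (λ p → G (e ∷ es) (proj₁ p) (proj₂ p)) (splitsRow (e ∷ es))
    ≡⟨ ∑-splitsRow-∷ (λ p → G (e ∷ es) (proj₁ p) (proj₂ p)) e es ⟩
  ∑ (λ a → ∑ (λ p → G (e ∷ es) (a ∷ proj₁ p) ((e ∸ a) ∷ proj₂ p)) (splitsRow es)) (upTo (suc e))
    ≡⟨ ∑-ext (upTo (suc e)) (λ a → trans (∑-ext (splitsRow es) (λ p → G-∷ e es a (e ∸ a) (proj₁ p) (proj₂ p)))
                                          (sym (∑-*ˡ (g e a (e ∸ a)) _ (splitsRow es)))) ⟩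
  ∑ (λ a → g e a (e ∸ a) * ∑ (λ p → G es (proj₁ p) (proj₂ p)) (splitsRow es)) (upTo (suc e))
    ≡⟨ sym (∑-*ʳ _ (λ a → g e a (e ∸ a)) (upTo (suc e))) ⟩
  ∑ (λ a → g e a (e ∸ a)) (upTo (suc e)) * ∑ (λ p → G es (proj₁ p) (proj₂ p)) (splitsRow es)
    ≡⟨ cong (∑ (λ a → g e a (e ∸ a)) (upTo (suc e)) *_) (∑-splitsRow-factor G g G-∷ G-[] es) ⟩
  ∏ (λ e → ∑ (λ a → g e a (e ∸ a)) (upTo (suc e))) (e ∷ es) ∎
  where open ≡-Reasoning

∑-splits-factor : (G : Mono → Mono → Mono → ℤ) (g : List ℕ → List ℕ → List ℕ → ℤ) →
  (∀ r rs x xs y ys → G (r ∷ rs) (x ∷ xs) (y ∷ ys) ≡ g r x y * G rs xs ys) → G [] [] [] ≡ 1ℤ →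
  ∀ μ → ∑ (λ p → G μ (proj₁ p) (proj₂ p)) (splits μ) ≡ ∏ (λ r → ∑ (λ p → g r (proj₁ p) (proj₂ p)) (splitsRow r)) μ
∑-splits-factor G g G-∷ G-[] []       = trans (ℤ.+-identityʳ _) G-[]
∑-splits-factor G g G-∷ G-[] (r ∷ rs) = begin
  ∑ (λ p → G (r ∷ rs) (proj₁ p) (proj₂ p)) (splits (r ∷ rs))
    ≡⟨ ∑-splits-∷ (λ p → G (r ∷ rs) (proj₁ p) (proj₂ p)) r rs ⟩
  ∑ (λ p → ∑ (λ q → G (r ∷ rs) (proj₁ p ∷ proj₁ q) (proj₂ p ∷ proj₂ q)) (splits rs)) (splitsRow r)
    ≡⟨ ∑-ext (splitsRow r) (λ p → trans (∑-ext (splits rs) (λ q → G-∷ r rs (proj₁ p) (proj₁ q) (proj₂ p) (proj₂ q)))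
                                         (sym (∑-*ˡ (g r (proj₁ p) (proj₂ p)) _ (splits rs)))) ⟩
  ∑ (λ p → g r (proj₁ p) (proj₂ p) * ∑ (λ q → G rs (proj₁ q) (proj₂ q)) (splits rs)) (splitsRow r)
    ≡⟨ sym (∑-*ʳ _ (λ p → g r (proj₁ p) (proj₂ p)) (splitsRow r)) ⟩
  ∑ (λ p → g r (proj₁ p) (proj₂ p)) (splitsRow r) * ∑ (λ q → G rs (proj₁ q) (proj₂ q)) (splits rs)
    ≡⟨ cong (∑ (λ p → g r (proj₁ p) (proj₂ p)) (splitsRow r) *_) (∑-splits-factor G g G-∷ G-[] rs) ⟩
  ∏ (λ r → ∑ (λ p → g r (proj₁ p) (proj₂ p)) (splitsRow r)) (r ∷ rs) ∎
  where open ≡-Reasoning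

zeroRow : List ℕ → Bool
zeroRow = all (_≡ᵇ 0)

zeroMono : Mono → Bool
zeroMono = all zeroRow

∑-splitsRow-unitˡ : (X : List ℕ → ℤ) (r : List ℕ) → ∑ (λ p → 𝟙 (zeroRow (proj₁ p)) * X (proj₂ p)) (splitsRow r) ≡ X r
∑-splitsRow-unitˡ X []       = trans (ℤ.+-identityʳ _) (ℤ.*-identityˡ _)
∑-splitsRow-unitˡ X (e ∷ es) = begin
  ∑ (λ p → 𝟙 (zeroRow (proj₁ p)) * X (proj₂ p)) (splitsRow (e ∷ es))
    ≡⟨ ∑-splitsRow-∷ (λ p → 𝟙 (zeroRow (proj₁ p)) * X (proj₂ p)) e es ⟩
  ∑ (λ a → ∑ (λ p → 𝟙 (zeroRow (a ∷ proj₁ p)) * X ((e ∸ a) ∷ proj₂ p)) (splitsRow es)) (upTo (suc e))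
    ≡⟨ ∑-upTo-suc (λ a → ∑ (λ p → 𝟙 (zeroRow (a ∷ proj₁ p)) * X ((e ∸ a) ∷ proj₂ p)) (splitsRow es)) e ⟩
  ∑ (λ p → 𝟙 (zeroRow (proj₁ p)) * X (e ∷ proj₂ p)) (splitsRow es) + ∑ (λ _ → ∑ (λ _ → 0ℤ) (splitsRow es)) (upTo e)
    ≡⟨ cong₂ _+_ (∑-splitsRow-unitˡ (λ y → X (e ∷ y)) es) (∑-zero (upTo e) (λ _ _ → ∑-zero (splitsRow es) (λ _ _ → refl))) ⟩
  X (e ∷ es) + 0ℤ
    ≡⟨ ℤ.+-identityʳ _ ⟩
  X (e ∷ es) ∎
  where open ≡-Reasoning

∑-splits-unitˡ : (X : Mono → ℤ) (μ : Mono) → ∑ (λ p → 𝟙 (zeroMono (proj₁ p)) * X (proj₂ p)) (splits μ) ≡ X μ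
∑-splits-unitˡ X []       = trans (ℤ.+-identityʳ _) (ℤ.*-identityˡ _)
∑-splits-unitˡ X (r ∷ rs) = begin
  ∑ (λ p → 𝟙 (zeroMono (proj₁ p)) * X (proj₂ p)) (splits (r ∷ rs))
    ≡⟨ ∑-splits-∷ (λ p → 𝟙 (zeroMono (proj₁ p)) * X (proj₂ p)) r rs ⟩
  ∑ (λ p → ∑ (λ q → 𝟙 (zeroRow (proj₁ p) ∧ zeroMono (proj₁ q)) * X (proj₂ p ∷ proj₂ q)) (splits rs)) (splitsRow r)
    ≡⟨ ∑-ext (splitsRow r) (λ p → trans (∑-ext (splits rs) (λ q → split-𝟙 (zeroRow (proj₁ p)) (zeroMono (proj₁ q)) _))
                                         (sym (∑-*ˡ (𝟙 (zeroRow (proj₁ p))) _ (splits rs)))) ⟩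
  ∑ (λ p → 𝟙 (zeroRow (proj₁ p)) * ∑ (λ q → 𝟙 (zeroMono (proj₁ q)) * X (proj₂ p ∷ proj₂ q)) (splits rs)) (splitsRow r)
    ≡⟨ ∑-ext (splitsRow r) (λ p → cong (𝟙 (zeroRow (proj₁ p)) *_) (∑-splits-unitˡ (λ y → X (proj₂ p ∷ y)) rs)) ⟩
  ∑ (λ p → 𝟙 (zeroRow (proj₁ p)) * X (proj₂ p ∷ rs)) (splitsRow r)
    ≡⟨ ∑-splitsRow-unitˡ (λ y → X (y ∷ rs)) r ⟩
  X (r ∷ rs) ∎
  where
  open ≡-Reasoning
  split-𝟙 : (a b : Bool) (x : ℤ) → 𝟙 (a ∧ b) * x ≡ 𝟙 a * (𝟙 b * x)
  split-𝟙 a b x = trans (cong (_* x) (𝟙-∧ a b)) (ℤ.*-assoc (𝟙 a) (𝟙 b) x)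

∑-upTo-reverse : (H : ℕ → ℕ → ℤ) (e : ℕ) → ∑ (λ a → H a (e ∸ a)) (upTo (suc e)) ≡ ∑ (λ a → H (e ∸ a) a) (upTo (suc e))
∑-upTo-reverse H zero    = refl
∑-upTo-reverse H (suc e) = begin
  ∑ (λ a → H a (suc e ∸ a)) (upTo (suc (suc e)))
    ≡⟨ ∑-upTo-suc (λ a → H a (suc e ∸ a)) (suc e) ⟩
  H 0 (suc e) + ∑ (λ a → H (suc a) (e ∸ a)) (upTo (suc e))
    ≡⟨ cong (H 0 (suc e) +_) (∑-upTo-reverse (λ x y → H (suc x) y) e) ⟩
  H 0 (suc e) + ∑ (λ a → H (suc (e ∸ a)) a) (upTo (suc e))
    ≡⟨ ℤ.+-comm (H 0 (suc e)) _ ⟩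
  ∑ (λ a → H (suc (e ∸ a)) a) (upTo (suc e)) + H 0 (suc e)
    ≡⟨ cong₂ _+_ (∑-cong (upTo (suc e)) (λ a a∈ → cong (λ z → H z a) (sym (ℕ.+-∸-assoc 1 (ℕ.<⇒≤pred (∈-upTo⁻ a∈))))))
                 (trans (cong (λ z → H z (suc e)) (sym (ℕ.n∸n≡0 (suc e)))) (sym (ℤ.+-identityʳ _))) ⟩
  ∑ (λ a → H (suc e ∸ a) a) (upTo (suc e)) + ∑ (λ a → H (suc e ∸ a) a) (suc e ∷ [])
    ≡⟨ sym (∑-++ (λ a → H (suc e ∸ a) a) (upTo (suc e)) (suc e ∷ [])) ⟩
  ∑ (λ a → H (suc e ∸ a) a) (upTo (suc e) ++ (suc e ∷ []))
    ≡⟨ cong (∑ (λ a → H (suc e ∸ a) a)) (List.upTo-∷ʳ (suc e)) ⟩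
  ∑ (λ a → H (suc e ∸ a) a) (upTo (suc (suc e))) ∎
  where open ≡-Reasoning

∑-splitsRow-swap : (F : List ℕ → List ℕ → ℤ) (r : List ℕ) →
  ∑ (λ p → F (proj₁ p) (proj₂ p)) (splitsRow r) ≡ ∑ (λ p → F (proj₂ p) (proj₁ p)) (splitsRow r)
∑-splitsRow-swap F []       = refl
∑-splitsRow-swap F (e ∷ es) =
  trans (∑-splitsRow-∷ (λ p → F (proj₁ p) (proj₂ p)) e es)
  (trans (∑-ext (upTo (suc e)) (λ a → ∑-splitsRow-swap (λ x y → F (a ∷ x) ((e ∸ a) ∷ y)) es))
  (trans (∑-upTo-reverse (λ a b → ∑ (λ p → F (a ∷ proj₂ p) (b ∷ proj₁ p)) (splitsRow es)) e)
         (sym (∑-splitsRow-∷ (λ p → F (proj₂ p) (proj₁ p)) e es))))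

∑-splits-swap : (F : Mono → Mono → ℤ) (μ : Mono) →
  ∑ (λ p → F (proj₁ p) (proj₂ p)) (splits μ) ≡ ∑ (λ p → F (proj₂ p) (proj₁ p)) (splits μ)
∑-splits-swap F []       = refl
∑-splits-swap F (r ∷ rs) =
  trans (∑-splits-∷ (λ p → F (proj₁ p) (proj₂ p)) r rs)
  (trans (∑-ext (splitsRow r) (λ p → ∑-splits-swap (λ x y → F (proj₁ p ∷ x) (proj₂ p ∷ y)) rs))
  (trans (∑-splitsRow-swap (λ x y → ∑ (λ q → F (x ∷ proj₂ q) (y ∷ proj₁ q)) (splits rs)) r)
         (sym (∑-splits-∷ (λ p → F (proj₂ p) (proj₁ p)) r rs))))

∑-upTo-triangle : (K : ℕ → ℕ → ℕ → ℤ) (e : ℕ) →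
  ∑ (λ a → ∑ (λ b → K b (a ∸ b) (e ∸ a)) (upTo (suc a))) (upTo (suc e)) ≡
  ∑ (λ a → ∑ (λ c → K a c (e ∸ a ∸ c)) (upTo (suc (e ∸ a)))) (upTo (suc e))
∑-upTo-triangle K zero    = refl
∑-upTo-triangle K (suc e) = begin
  ∑ (λ a → ∑ (λ b → K b (a ∸ b) (suc e ∸ a)) (upTo (suc a))) (upTo (suc (suc e)))
    ≡⟨ ∑-ext (upTo (suc (suc e))) (λ a → ∑-upTo-suc (λ b → K b (a ∸ b) (suc e ∸ a)) a) ⟩
  ∑ (λ a → K 0 a (suc e ∸ a) + ∑ (λ b → K (suc b) (a ∸ suc b) (suc e ∸ a)) (upTo a)) (upTo (suc (suc e)))
    ≡⟨ ∑-+ (λ a → K 0 a (suc e ∸ a)) (λ a → ∑ (λ b → K (suc b) (a ∸ suc b) (suc e ∸ a)) (upTo a)) (upTo (suc (suc e))) ⟩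
  row₀ + ∑ (λ a → ∑ (λ b → K (suc b) (a ∸ suc b) (suc e ∸ a)) (upTo a)) (upTo (suc (suc e)))
    ≡⟨ cong (row₀ +_) (trans (∑-upTo-suc (λ a → ∑ (λ b → K (suc b) (a ∸ suc b) (suc e ∸ a)) (upTo a)) (suc e))
                             (ℤ.+-identityˡ _)) ⟩
  row₀ + ∑ (λ a → ∑ (λ b → K (suc b) (a ∸ b) (e ∸ a)) (upTo (suc a))) (upTo (suc e))
    ≡⟨ cong (row₀ +_) (∑-upTo-triangle (λ x y z → K (suc x) y z) e) ⟩
  row₀ + ∑ (λ a → ∑ (λ c → K (suc a) c (e ∸ a ∸ c)) (upTo (suc (e ∸ a)))) (upTo (suc e))
    ≡⟨ sym (∑-upTo-suc (λ a → ∑ (λ c → K a c (suc e ∸ a ∸ c)) (upTo (suc (suc e ∸ a)))) (suc e)) ⟩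
  ∑ (λ a → ∑ (λ c → K a c (suc e ∸ a ∸ c)) (upTo (suc (suc e ∸ a)))) (upTo (suc (suc e))) ∎
  where
  open ≡-Reasoning
  row₀ : ℤ
  row₀ = ∑ (λ a → K 0 a (suc e ∸ a)) (upTo (suc (suc e)))

∑-splitsRow-assoc : (F : List ℕ → List ℕ → List ℕ → ℤ) (r : List ℕ) →
  ∑ (λ P → ∑ (λ Q → F (proj₁ Q) (proj₂ Q) (proj₂ P)) (splitsRow (proj₁ P))) (splitsRow r) ≡
  ∑ (λ P → ∑ (λ Q → F (proj₁ P) (proj₁ Q) (proj₂ Q)) (splitsRow (proj₂ P))) (splitsRow r)
∑-splitsRow-assoc F []       = refl
∑-splitsRow-assoc F (e ∷ es) = begin
  ∑ (λ P → ∑ (λ Q → F (proj₁ Q) (proj₂ Q) (proj₂ P)) (splitsRow (proj₁ P))) (splitsRow (e ∷ es))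
    ≡⟨ ∑-splitsRow-∷ (λ P → ∑ (λ Q → F (proj₁ Q) (proj₂ Q) (proj₂ P)) (splitsRow (proj₁ P))) e es ⟩
  ∑ (λ a → ∑ (λ p → ∑ (λ Q → F (proj₁ Q) (proj₂ Q) ((e ∸ a) ∷ proj₂ p)) (splitsRow (a ∷ proj₁ p))) (splitsRow es)) (upTo (suc e))
    ≡⟨ ∑-ext (upTo (suc e)) (λ a → trans (∑-ext (splitsRow es) (λ p → ∑-splitsRow-∷ (λ Q → F (proj₁ Q) (proj₂ Q) ((e ∸ a) ∷ proj₂ p)) a (proj₁ p)))
          (∑-swap (λ p b → ∑ (λ q → F (b ∷ proj₁ q) ((a ∸ b) ∷ proj₂ q) ((e ∸ a) ∷ proj₂ p)) (splitsRow (proj₁ p))) (splitsRow es) (upTo (suc a)))) ⟩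
  ∑ (λ a → ∑ (λ b → ∑ (λ p → ∑ (λ q → F (b ∷ proj₁ q) ((a ∸ b) ∷ proj₂ q) ((e ∸ a) ∷ proj₂ p))
                                     (splitsRow (proj₁ p))) (splitsRow es)) (upTo (suc a))) (upTo (suc e))
    ≡⟨ ∑-ext (upTo (suc e)) (λ a → ∑-ext (upTo (suc a)) (λ b → ∑-splitsRow-assoc (λ x y z → F (b ∷ x) ((a ∸ b) ∷ y) ((e ∸ a) ∷ z)) es)) ⟩
  ∑ (λ a → ∑ (λ b → K b (a ∸ b) (e ∸ a)) (upTo (suc a))) (upTo (suc e))
    ≡⟨ ∑-upTo-triangle K e ⟩
  ∑ (λ a → ∑ (λ c → K a c (e ∸ a ∸ c)) (upTo (suc (e ∸ a)))) (upTo (suc e))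
    ≡⟨ sym (∑-ext (upTo (suc e)) (λ a → trans (∑-ext (splitsRow es) (λ p → ∑-splitsRow-∷ (λ Q → F (a ∷ proj₁ p) (proj₁ Q) (proj₂ Q)) (e ∸ a) (proj₂ p)))
          (∑-swap (λ p c → ∑ (λ q → F (a ∷ proj₁ p) (c ∷ proj₁ q) ((e ∸ a ∸ c) ∷ proj₂ q)) (splitsRow (proj₂ p))) (splitsRow es) (upTo (suc (e ∸ a)))))) ⟩
  ∑ (λ a → ∑ (λ p → ∑ (λ Q → F (a ∷ proj₁ p) (proj₁ Q) (proj₂ Q)) (splitsRow ((e ∸ a) ∷ proj₂ p))) (splitsRow es)) (upTo (suc e))
    ≡⟨ sym (∑-splitsRow-∷ (λ P → ∑ (λ Q → F (proj₁ P) (proj₁ Q) (proj₂ Q)) (splitsRow (proj₂ P))) e es) ⟩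
  ∑ (λ P → ∑ (λ Q → F (proj₁ P) (proj₁ Q) (proj₂ Q)) (splitsRow (proj₂ P))) (splitsRow (e ∷ es)) ∎
  where
  open ≡-Reasoning
  K : ℕ → ℕ → ℕ → ℤ
  K x y z = ∑ (λ p → ∑ (λ q → F (x ∷ proj₁ p) (y ∷ proj₁ q) (z ∷ proj₂ q)) (splitsRow (proj₂ p))) (splitsRow es)

∑-splits-assoc : (F : Mono → Mono → Mono → ℤ) (μ : Mono) →
  ∑ (λ P → ∑ (λ Q → F (proj₁ Q) (proj₂ Q) (proj₂ P)) (splits (proj₁ P))) (splits μ) ≡
  ∑ (λ P → ∑ (λ Q → F (proj₁ P) (proj₁ Q) (proj₂ Q)) (splits (proj₂ P))) (splits μ)
∑-splits-assoc F []       = refl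
∑-splits-assoc F (r ∷ rs) = begin
  ∑ (λ P → ∑ (λ Q → F (proj₁ Q) (proj₂ Q) (proj₂ P)) (splits (proj₁ P))) (splits (r ∷ rs))
    ≡⟨ ∑-splits-∷ (λ P → ∑ (λ Q → F (proj₁ Q) (proj₂ Q) (proj₂ P)) (splits (proj₁ P))) r rs ⟩
  ∑ (λ p → ∑ (λ q → ∑ (λ Q → F (proj₁ Q) (proj₂ Q) (proj₂ p ∷ proj₂ q)) (splits (proj₁ p ∷ proj₁ q))) (splits rs)) (splitsRow r)
    ≡⟨ ∑-ext (splitsRow r) (λ p → trans (∑-ext (splits rs) (λ q → ∑-splits-∷ (λ Q → F (proj₁ Q) (proj₂ Q) (proj₂ p ∷ proj₂ q)) (proj₁ p) (proj₁ q)))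
         (∑-swap (λ q u → ∑ (λ v → F (proj₁ u ∷ proj₁ v) (proj₂ u ∷ proj₂ v) (proj₂ p ∷ proj₂ q)) (splits (proj₁ q))) (splits rs) (splitsRow (proj₁ p)))) ⟩
  ∑ (λ p → ∑ (λ u → ∑ (λ q → ∑ (λ v → F (proj₁ u ∷ proj₁ v) (proj₂ u ∷ proj₂ v) (proj₂ p ∷ proj₂ q))
                                     (splits (proj₁ q))) (splits rs)) (splitsRow (proj₁ p))) (splitsRow r)
    ≡⟨ ∑-ext (splitsRow r) (λ p → ∑-ext (splitsRow (proj₁ p)) (λ u → ∑-splits-assoc (λ x y z → F (proj₁ u ∷ x) (proj₂ u ∷ y) (proj₂ p ∷ z)) rs)) ⟩
  ∑ (λ p → ∑ (λ u → K (proj₁ u) (proj₂ u) (proj₂ p)) (splitsRow (proj₁ p))) (splitsRow r)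
    ≡⟨ ∑-splitsRow-assoc K r ⟩
  ∑ (λ p → ∑ (λ u → K (proj₁ p) (proj₁ u) (proj₂ u)) (splitsRow (proj₂ p))) (splitsRow r)
    ≡⟨ sym (∑-ext (splitsRow r) (λ p → trans (∑-ext (splits rs) (λ q → ∑-splits-∷ (λ Q → F (proj₁ p ∷ proj₁ q) (proj₁ Q) (proj₂ Q)) (proj₂ p) (proj₂ q)))
         (∑-swap (λ q u → ∑ (λ v → F (proj₁ p ∷ proj₁ q) (proj₁ u ∷ proj₁ v) (proj₂ u ∷ proj₂ v)) (splits (proj₂ q))) (splits rs) (splitsRow (proj₂ p))))) ⟩
  ∑ (λ p → ∑ (λ q → ∑ (λ Q → F (proj₁ p ∷ proj₁ q) (proj₁ Q) (proj₂ Q)) (splits (proj₂ p ∷ proj₂ q))) (splits rs)) (splitsRow r)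
    ≡⟨ sym (∑-splits-∷ (λ P → ∑ (λ Q → F (proj₁ P) (proj₁ Q) (proj₂ Q)) (splits (proj₂ P))) r rs) ⟩
  ∑ (λ P → ∑ (λ Q → F (proj₁ P) (proj₁ Q) (proj₂ Q)) (splits (proj₂ P))) (splits (r ∷ rs)) ∎
  where
  open ≡-Reasoning
  K : List ℕ → List ℕ → List ℕ → ℤ
  K x y z = ∑ (λ q → ∑ (λ v → F (x ∷ proj₁ q) (y ∷ proj₁ v) (z ∷ proj₂ v)) (splits (proj₂ q))) (splits rs)

≋-isEquivalence : IsEquivalence _≋_
≋-isEquivalence = record
  { refl  = λ _ → refl
  ; sym   = λ f≋g μ → sym (f≋g μ)
  ; trans = λ f≋g g≋h μ → trans (f≋g μ) (g≋h μ)
  }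

≋-setoid : Setoid 0ℓ 0ℓ
≋-setoid = record { isEquivalence = ≋-isEquivalence }

open IsEquivalence ≋-isEquivalence public using () renaming (refl to ≋-refl; sym to ≋-sym; trans to ≋-trans)

module ≋-Reasoning = SetoidReasoning ≋-setoid

⊛-cong : {f f′ g g′ : Series} → f ≋ f′ → g ≋ g′ → f ⊛ g ≋ f′ ⊛ g′
⊛-cong f≋f′ g≋g′ μ = ∑-ext (splits μ) (λ p → cong₂ _*_ (f≋f′ (proj₁ p)) (g≋g′ (proj₂ p)))

⊛-comm : (f g : Series) → f ⊛ g ≋ g ⊛ f
⊛-comm f g μ = trans (∑-splits-swap (λ x y → f x * g y) μ) (∑-ext (splits μ) (λ p → ℤ.*-comm (f (proj₂ p)) (g (proj₁ p))))

⊛-assoc : (f g h : Series) → (f ⊛ g) ⊛ h ≋ f ⊛ (g ⊛ h)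
⊛-assoc f g h μ = begin
  ((f ⊛ g) ⊛ h) μ
    ≡⟨ ∑-ext (splits μ) (λ P → ∑-*ʳ (h (proj₂ P)) (λ Q → f (proj₁ Q) * g (proj₂ Q)) (splits (proj₁ P))) ⟩
  ∑ (λ P → ∑ (λ Q → (f (proj₁ Q) * g (proj₂ Q)) * h (proj₂ P)) (splits (proj₁ P))) (splits μ)
    ≡⟨ ∑-splits-assoc (λ x y z → (f x * g y) * h z) μ ⟩
  ∑ (λ P → ∑ (λ Q → (f (proj₁ P) * g (proj₁ Q)) * h (proj₂ Q)) (splits (proj₂ P))) (splits μ)
    ≡⟨ ∑-ext (splits μ) (λ P → trans (∑-ext (splits (proj₂ P)) (λ Q → ℤ.*-assoc (f (proj₁ P)) (g (proj₁ Q)) (h (proj₂ Q))))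
                                     (sym (∑-*ˡ (f (proj₁ P)) (λ Q → g (proj₁ Q) * h (proj₂ Q)) (splits (proj₂ P))))) ⟩
  (f ⊛ (g ⊛ h)) μ ∎
  where open ≡-Reasoning

oneS≡𝟙 : (μ : Mono) → oneS μ ≡ 𝟙 (zeroMono μ)
oneS≡𝟙 μ with zeroMono μ
... | true  = refl
... | false = refl

⊛-identityˡ : (f : Series) → oneS ⊛ f ≋ f
⊛-identityˡ f μ = trans (∑-ext (splits μ) (λ p → cong (_* f (proj₂ p)) (oneS≡𝟙 (proj₁ p)))) (∑-splits-unitˡ f μ)

⊛-isCommutativeMonoid : IsCommutativeMonoid _≋_ _⊛_ oneS
⊛-isCommutativeMonoid = record
  { isMonoid = record
    { isSemigroup = record
      { isMagma = record { isEquivalence = ≋-isEquivalence ; ∙-cong = ⊛-cong }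
      ; assoc   = ⊛-assoc
      }
    ; identity = ⊛-identityˡ , λ f → ≋-trans (⊛-comm f oneS) (⊛-identityˡ f)
    }
  ; comm = ⊛-comm
  }

⊛-distribˡ-ΣS : (f : Series) (gs : List Series) → f ⊛ ΣS gs ≋ ΣS (map (f ⊛_) gs)
⊛-distribˡ-ΣS f gs μ =
  trans (∑-ext (splits μ) (λ p → ∑-*ˡ (f (proj₁ p)) (λ g → g (proj₂ p)) gs))
  (trans (∑-swap (λ p g → f (proj₁ p) * g (proj₂ p)) (splits μ) gs)
         (sym (∑-map (λ g → g μ) (f ⊛_) gs)))

at-part-↭ : (F : ℕ → Series) {τ τ′ : StackPartition} → τ ↭ τ′ → F at-part τ ≋ F at-part τ′
at-part-↭ F {τ} {τ′} τ↭τ′ μ =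
  trans (cong (λ f → f μ) (sym (List.foldr-map _⊛_ (F at-stack_) oneS τ)))
  (trans (↭ₛ.foldr-commMonoid ≋-setoid ⊛-isCommutativeMonoid (↭⇒↭ₛ′ ≋-isEquivalence (↭.map⁺ (F at-stack_) τ↭τ′)) μ)
         (cong (λ f → f μ) (List.foldr-map _⊛_ (F at-stack_) oneS τ′)))

-- Product series

degreeFrom : ℕ → Mono → ℕ
degreeFrom i []       = 0
degreeFrom i (r ∷ rs) = i *ℕ sumℕ r +ℕ degreeFrom (suc i) rs

degree : Mono → ℕ
degree = degreeFrom 1

expProd : (ℕ → ℤ) → Mono → ℤ
expProd φ = ∏ (∏ φ)

-- The degree-n part of the product over all variables x of Σ_e φ e x^e.
prodSeries : ℕ → (ℕ → ℤ) → Series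
prodSeries n φ μ = 𝟙 (degree μ ≡ᵇ n) * expProd φ μ

infixl 7 _∗_

_∗_ : (ℕ → ℤ) → (ℕ → ℤ) → ℕ → ℤ
(φ ∗ ψ) e = ∑ (λ a → φ a * ψ (e ∸ a)) (upTo (suc e))

∑-splits-expProd : (φ ψ : ℕ → ℤ) (μ : Mono) →
  ∑ (λ p → expProd φ (proj₁ p) * expProd ψ (proj₂ p)) (splits μ) ≡ expProd (φ ∗ ψ) μ
∑-splits-expProd φ ψ μ =
  trans (∑-splits-factor (λ _ x y → expProd φ x * expProd ψ y) (λ _ x y → ∏ φ x * ∏ ψ y)
           (λ _ _ x xs y ys → interchange (∏ φ x) (expProd φ xs) (∏ ψ y) (expProd ψ ys)) refl μ)
        (∏-cong μ (λ r _ → ∑-splitsRow-factor (λ _ x y → ∏ φ x * ∏ ψ y) (λ _ a b → φ a * ψ b)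
           (λ _ _ a b x y → interchange (φ a) (∏ φ x) (ψ b) (∏ ψ y)) refl r))
  where
  open import Algebra.Properties.CommutativeSemigroup ℤ.*-commutativeSemigroup using (interchange)

sumℕ-splitsRow : (r : List ℕ) {p : List ℕ × List ℕ} → p ∈ splitsRow r → sumℕ (proj₁ p) +ℕ sumℕ (proj₂ p) ≡ sumℕ r
sumℕ-splitsRow [] (here refl) = refl
sumℕ-splitsRow (e ∷ es) p∈ with ∈-concatMap⁻′ (λ a → map (λ p → (a ∷ proj₁ p) , ((e ∸ a) ∷ proj₂ p)) (splitsRow es)) (upTo (suc e)) p∈
... | a , a∈ , p∈′ with ∈.∈-map⁻ (λ p → (a ∷ proj₁ p) , ((e ∸ a) ∷ proj₂ p)) p∈′
...   | q , q∈ , refl = begin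
  (a +ℕ sumℕ (proj₁ q)) +ℕ ((e ∸ a) +ℕ sumℕ (proj₂ q))
    ≡⟨ interchange a (sumℕ (proj₁ q)) (e ∸ a) (sumℕ (proj₂ q)) ⟩
  (a +ℕ (e ∸ a)) +ℕ (sumℕ (proj₁ q) +ℕ sumℕ (proj₂ q))
    ≡⟨ cong₂ _+ℕ_ (ℕ.m+[n∸m]≡n (ℕ.<⇒≤pred (∈-upTo⁻ a∈))) (sumℕ-splitsRow es q∈) ⟩
  e +ℕ sumℕ es ∎
  where
  open ≡-Reasoning
  open import Algebra.Properties.CommutativeSemigroup ℕ.+-commutativeSemigroup using (interchange)

degreeFrom-splits : (i : ℕ) (μ : Mono) {p : Mono × Mono} → p ∈ splits μ →
  degreeFrom i (proj₁ p) +ℕ degreeFrom i (proj₂ p) ≡ degreeFrom i μ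
degreeFrom-splits i [] (here refl) = refl
degreeFrom-splits i (r ∷ rs) p∈ with ∈-concatMap⁻′ (λ p → map (λ q → (proj₁ p ∷ proj₁ q) , (proj₂ p ∷ proj₂ q)) (splits rs)) (splitsRow r) p∈
... | p , p∈r , p∈′ with ∈.∈-map⁻ (λ q → (proj₁ p ∷ proj₁ q) , (proj₂ p ∷ proj₂ q)) p∈′
...   | q , q∈ , refl = begin
  (i *ℕ sumℕ (proj₁ p) +ℕ degreeFrom (suc i) (proj₁ q)) +ℕ (i *ℕ sumℕ (proj₂ p) +ℕ degreeFrom (suc i) (proj₂ q))
    ≡⟨ regroup i (sumℕ (proj₁ p)) (degreeFrom (suc i) (proj₁ q)) (sumℕ (proj₂ p)) (degreeFrom (suc i) (proj₂ q)) ⟩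
  i *ℕ (sumℕ (proj₁ p) +ℕ sumℕ (proj₂ p)) +ℕ (degreeFrom (suc i) (proj₁ q) +ℕ degreeFrom (suc i) (proj₂ q))
    ≡⟨ cong₂ (λ x y → i *ℕ x +ℕ y) (sumℕ-splitsRow r p∈r) (degreeFrom-splits (suc i) rs q∈) ⟩
  i *ℕ sumℕ r +ℕ degreeFrom (suc i) rs ∎
  where
  open ≡-Reasoning
  open ℕ-Solver
  regroup : ∀ i a b c d → (i *ℕ a +ℕ b) +ℕ (i *ℕ c +ℕ d) ≡ i *ℕ (a +ℕ c) +ℕ (b +ℕ d)
  regroup = solve 5 (λ i a b c d → (i :* a :+ b) :+ (i :* c :+ d) := i :* (a :+ c) :+ (b :+ d)) refl

*-≢0 : (x y : ℤ) → x * y ≢ 0ℤ → (x ≢ 0ℤ) × (y ≢ 0ℤ)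
*-≢0 x y xy≢0 = (λ x≡0 → xy≢0 (trans (cong (_* y) x≡0) (ℤ.*-zeroˡ y)))
              , (λ y≡0 → xy≢0 (trans (cong (x *_) y≡0) (ℤ.*-zeroʳ x)))

expProd-degree-∣ : (Q : ℕ) (φ : ℕ → ℤ) → (∀ e → φ e ≢ 0ℤ → Q ∣ e) →
  (i : ℕ) (μ : Mono) → expProd φ μ ≢ 0ℤ → Q ∣ degreeFrom i μ
expProd-degree-∣ Q φ supp i []       _ = Q ∣0
expProd-degree-∣ Q φ supp i (r ∷ rs) ≢0 =
  ∣m∣n⇒∣m+n (∣n⇒∣m*n i (row-∣ r (proj₁ factors≢0))) (expProd-degree-∣ Q φ supp (suc i) rs (proj₂ factors≢0))
  where
  factors≢0 : (∏ φ r ≢ 0ℤ) × (expProd φ rs ≢ 0ℤ)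
  factors≢0 = *-≢0 (∏ φ r) (expProd φ rs) ≢0
  row-∣ : (r : List ℕ) → ∏ φ r ≢ 0ℤ → Q ∣ sumℕ r
  row-∣ []       _   = Q ∣0
  row-∣ (e ∷ es) ≢0′ = ∣m∣n⇒∣m+n (supp e (proj₁ (*-≢0 (φ e) (∏ φ es) ≢0′))) (row-∣ es (proj₂ (*-≢0 (φ e) (∏ φ es) ≢0′)))

-- A ≠ 0 forces d₁ = k Q, and then only the term c = k survives.
∑-graded-pair : (Q : ℕ) → 1 ≤ Q → (N : ℕ) (Cs : List ℕ) → Unique Cs →
  (∀ c → c ∈ Cs → c *ℕ Q ≤ N) → (∀ c → c *ℕ Q ≤ N → c ∈ Cs) →
  (d₁ d₂ : ℕ) (A B : ℤ) → (A ≢ 0ℤ → Q ∣ d₁) →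
  ∑ (λ c → (𝟙 (d₁ ≡ᵇ c *ℕ Q) * A) * (𝟙 (d₂ ≡ᵇ N ∸ c *ℕ Q) * B)) Cs ≡ 𝟙 (d₁ +ℕ d₂ ≡ᵇ N) * (A * B)
∑-graded-pair Q 1≤Q N Cs uCs Cs≤N ≤N⇒Cs d₁ d₂ A B A-∣ with A ℤ.≟ 0ℤ
... | yes refl =
  trans (∑-zero Cs (λ c _ → trans (cong (_* (𝟙 (d₂ ≡ᵇ N ∸ c *ℕ Q) * B)) (ℤ.*-zeroʳ (𝟙 (d₁ ≡ᵇ c *ℕ Q))))
                                   (ℤ.*-zeroˡ (𝟙 (d₂ ≡ᵇ N ∸ c *ℕ Q) * B))))
        (sym (trans (cong (𝟙 (d₁ +ℕ d₂ ≡ᵇ N) *_) (ℤ.*-zeroˡ B)) (ℤ.*-zeroʳ (𝟙 (d₁ +ℕ d₂ ≡ᵇ N)))))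
... | no A≢0 with A-∣ A≢0
...   | divides-refl k = on-multiple (k *ℕ Q ℕ.≤? N)
  where
  instance
    _ : NonZero Q
    _ = >-nonZero 1≤Q
  term : ℕ → ℤ
  term c = (𝟙 (k *ℕ Q ≡ᵇ c *ℕ Q) * A) * (𝟙 (d₂ ≡ᵇ N ∸ c *ℕ Q) * B)
  term-off : ∀ c → c ≢ k → term c ≡ 0ℤ
  term-off c c≢k rewrite ≢⇒≡ᵇ-false (λ kQ≡cQ → c≢k (sym (ℕ.*-cancelʳ-≡ k c Q kQ≡cQ))) =
    trans (cong (_* (𝟙 (d₂ ≡ᵇ N ∸ c *ℕ Q) * B)) (ℤ.*-zeroˡ A)) (ℤ.*-zeroˡ (𝟙 (d₂ ≡ᵇ N ∸ c *ℕ Q) * B))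
  on-multiple : Dec (k *ℕ Q ≤ N) → ∑ term Cs ≡ 𝟙 (k *ℕ Q +ℕ d₂ ≡ᵇ N) * (A * B)
  on-multiple (yes kQ≤N) = begin
    ∑ term Cs
      ≡⟨ ∑-single term uCs (≤N⇒Cs k kQ≤N) (λ c _ → term-off c) ⟩
    (𝟙 (k *ℕ Q ≡ᵇ k *ℕ Q) * A) * (𝟙 (d₂ ≡ᵇ N ∸ k *ℕ Q) * B)
      ≡⟨ cong (λ b → (𝟙 b * A) * (𝟙 (d₂ ≡ᵇ N ∸ k *ℕ Q) * B)) (≡⇒≡ᵇ {k *ℕ Q} refl) ⟩
    (1ℤ * A) * (𝟙 (d₂ ≡ᵇ N ∸ k *ℕ Q) * B)
      ≡⟨ solve 3 (λ i A B → (con 1ℤ :* A) :* (i :* B) := i :* (A :* B)) refl (𝟙 (d₂ ≡ᵇ N ∸ k *ℕ Q)) A B ⟩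
    𝟙 (d₂ ≡ᵇ N ∸ k *ℕ Q) * (A * B)
      ≡⟨ cong (λ b → 𝟙 b * (A * B)) (Bool-ext _ _
           (λ h → ≡⇒≡ᵇ (trans (cong (k *ℕ Q +ℕ_) (≡ᵇ⇒≡ _ _ h)) (ℕ.m+[n∸m]≡n kQ≤N)))
           (λ h → ≡⇒≡ᵇ (trans (sym (ℕ.m+n∸m≡n (k *ℕ Q) d₂)) (cong (_∸ k *ℕ Q) (≡ᵇ⇒≡ _ _ h))))) ⟩
    𝟙 (k *ℕ Q +ℕ d₂ ≡ᵇ N) * (A * B) ∎
    where
    open ≡-Reasoning
    open +-*-Solver
  on-multiple (no kQ≰N) =
    trans (∑-zero Cs (λ c c∈ → term-off c (λ { refl → kQ≰N (Cs≤N c c∈) })))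
          (sym (cong (λ b → 𝟙 b * (A * B)) (≢⇒≡ᵇ-false (λ kQ+d₂≡N → kQ≰N (subst (k *ℕ Q ≤_) kQ+d₂≡N (ℕ.m≤m+n _ d₂))))))

ΣS-prodSeries-⊛ : (Q : ℕ) → 1 ≤ Q → (N : ℕ) (φ ψ : ℕ → ℤ) → (∀ e → φ e ≢ 0ℤ → Q ∣ e) →
  (Cs : List ℕ) → Unique Cs → (∀ c → c ∈ Cs → c *ℕ Q ≤ N) → (∀ c → c *ℕ Q ≤ N → c ∈ Cs) →
  ΣS (map (λ c → prodSeries (c *ℕ Q) φ ⊛ prodSeries (N ∸ c *ℕ Q) ψ) Cs) ≋ prodSeries N (φ ∗ ψ)
ΣS-prodSeries-⊛ Q 1≤Q N φ ψ supp Cs uCs Cs≤N ≤N⇒Cs μ = begin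
  ΣS (map (λ c → prodSeries (c *ℕ Q) φ ⊛ prodSeries (N ∸ c *ℕ Q) ψ) Cs) μ
    ≡⟨ ∑-map (λ g → g μ) (λ c → prodSeries (c *ℕ Q) φ ⊛ prodSeries (N ∸ c *ℕ Q) ψ) Cs ⟩
  ∑ (λ c → ∑ (λ p → prodSeries (c *ℕ Q) φ (proj₁ p) * prodSeries (N ∸ c *ℕ Q) ψ (proj₂ p)) (splits μ)) Cs
    ≡⟨ ∑-swap (λ c p → prodSeries (c *ℕ Q) φ (proj₁ p) * prodSeries (N ∸ c *ℕ Q) ψ (proj₂ p)) Cs (splits μ) ⟩
  ∑ (λ p → ∑ (λ c → prodSeries (c *ℕ Q) φ (proj₁ p) * prodSeries (N ∸ c *ℕ Q) ψ (proj₂ p)) Cs) (splits μ)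
    ≡⟨ ∑-cong (splits μ) (λ p p∈ → trans
          (∑-graded-pair Q 1≤Q N Cs uCs Cs≤N ≤N⇒Cs (degree (proj₁ p)) (degree (proj₂ p)) (expProd φ (proj₁ p)) (expProd ψ (proj₂ p))
             (expProd-degree-∣ Q φ supp 1 (proj₁ p)))
          (cong (λ d → 𝟙 (d ≡ᵇ N) * (expProd φ (proj₁ p) * expProd ψ (proj₂ p))) (degreeFrom-splits 1 μ p∈))) ⟩
  ∑ (λ p → 𝟙 (degree μ ≡ᵇ N) * (expProd φ (proj₁ p) * expProd ψ (proj₂ p))) (splits μ)
    ≡⟨ sym (∑-*ˡ (𝟙 (degree μ ≡ᵇ N)) (λ p → expProd φ (proj₁ p) * expProd ψ (proj₂ p)) (splits μ)) ⟩
  𝟙 (degree μ ≡ᵇ N) * ∑ (λ p → expProd φ (proj₁ p) * expProd ψ (proj₂ p)) (splits μ)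
    ≡⟨ cong (𝟙 (degree μ ≡ᵇ N) *_) (∑-splits-expProd φ ψ μ) ⟩
  prodSeries N (φ ∗ ψ) μ ∎
  where open ≡-Reasoning

zeroRow⇔sum≡0 : (r : List ℕ) → (zeroRow r ≡ true → sumℕ r ≡ 0) × (sumℕ r ≡ 0 → zeroRow r ≡ true)
zeroRow⇔sum≡0 []          = (λ _ → refl) , (λ _ → refl)
zeroRow⇔sum≡0 (zero ∷ es) = zeroRow⇔sum≡0 es
zeroRow⇔sum≡0 (suc e ∷ es) = (λ ()) , (λ ())

degree≡0⇒zeroMono : (i : ℕ) (μ : Mono) → degreeFrom (suc i) μ ≡ 0 → zeroMono μ ≡ true
degree≡0⇒zeroMono i []       _    = refl
degree≡0⇒zeroMono i (r ∷ rs) deg≡0 =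
  cong₂ _∧_ (proj₂ (zeroRow⇔sum≡0 r) (ℕ.m+n≡0⇒m≡0 (sumℕ r) (ℕ.m+n≡0⇒m≡0 (suc i *ℕ sumℕ r) deg≡0)))
            (degree≡0⇒zeroMono (suc i) rs (ℕ.m+n≡0⇒n≡0 (suc i *ℕ sumℕ r) deg≡0))

zeroMono⇒degree≡0 : (i : ℕ) (μ : Mono) → zeroMono μ ≡ true → degreeFrom i μ ≡ 0
zeroMono⇒degree≡0 i []       _ = refl
zeroMono⇒degree≡0 i (r ∷ rs) z with ∧-true (zeroRow r) (zeroMono rs) z
... | zr , zrs = cong₂ _+ℕ_ (trans (cong (i *ℕ_) (proj₁ (zeroRow⇔sum≡0 r) zr)) (ℕ.*-zeroʳ i))
                            (zeroMono⇒degree≡0 (suc i) rs zrs)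

expProd-zeroMono : (φ : ℕ → ℤ) → φ 0 ≡ 1ℤ → (μ : Mono) → zeroMono μ ≡ true → expProd φ μ ≡ 1ℤ
expProd-zeroMono φ φ0≡1 []       _ = refl
expProd-zeroMono φ φ0≡1 (r ∷ rs) z with ∧-true (zeroRow r) (zeroMono rs) z
... | zr , zrs = cong₂ _*_ (row r zr) (expProd-zeroMono φ φ0≡1 rs zrs)
  where
  row : (r : List ℕ) → zeroRow r ≡ true → ∏ φ r ≡ 1ℤ
  row []          _  = refl
  row (zero ∷ es) zr = cong₂ _*_ φ0≡1 (row es zr)

prodSeries-zero : (φ : ℕ → ℤ) → φ 0 ≡ 1ℤ → prodSeries 0 φ ≋ oneS
prodSeries-zero φ φ0≡1 μ with zeroMono μ in z
... | true rewrite zeroMono⇒degree≡0 1 μ z = trans (ℤ.*-identityˡ _) (expProd-zeroMono φ φ0≡1 μ z)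
... | false with degree μ ≡ᵇ 0 in deg≡0
...   | true  = ⊥-elim (false≢true (trans (sym z) (degree≡0⇒zeroMono 0 μ (≡ᵇ⇒≡ _ _ deg≡0))))
...   | false = refl

δ : ℕ → ℕ → ℤ
δ k e = 𝟙 (e ≡ᵇ k)

prodSeries-δ0 : (N : ℕ) → N ≢ 0 → prodSeries N (δ 0) ≋ λ _ → 0ℤ
prodSeries-δ0 N N≢0 μ with zeroMono μ in z
... | false = trans (cong (𝟙 (degree μ ≡ᵇ N) *_) (trans (expProd-δ0 μ) (cong 𝟙 z))) (ℤ.*-zeroʳ (𝟙 (degree μ ≡ᵇ N)))
  where
  expProd-δ0 : (μ : Mono) → expProd (δ 0) μ ≡ 𝟙 (zeroMono μ)
  expProd-δ0 []       = refl
  expProd-δ0 (r ∷ rs) = trans (cong₂ _*_ (row r) (expProd-δ0 rs)) (sym (𝟙-∧ (zeroRow r) (zeroMono rs)))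
    where
    row : (r : List ℕ) → ∏ (δ 0) r ≡ 𝟙 (zeroRow r)
    row []       = refl
    row (e ∷ es) = trans (cong (δ 0 e *_) (row es)) (sym (𝟙-∧ (e ≡ᵇ 0) (zeroRow es)))
... | true rewrite zeroMono⇒degree≡0 1 μ z | ≢⇒≡ᵇ-false (N≢0 ∘ sym) = refl

prodSeries-local : (N : ℕ) (φ ψ : ℕ → ℤ) → (∀ e → e ≤ N → φ e ≡ ψ e) → prodSeries N φ ≋ prodSeries N ψ
prodSeries-local N φ ψ φ≡ψ μ with degree μ ≡ᵇ N in deg≡N
... | false = refl
... | true  = cong (1ℤ *_) (expProd-local 0 μ (ℕ.≤-reflexive (≡ᵇ⇒≡ _ _ deg≡N)))
  where
  row-local : (r : List ℕ) → sumℕ r ≤ N → ∏ φ r ≡ ∏ ψ r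
  row-local []       _   = refl
  row-local (e ∷ es) ≤N = cong₂ _*_ (φ≡ψ e (ℕ.≤-trans (ℕ.m≤m+n e (sumℕ es)) ≤N))
                                    (row-local es (ℕ.≤-trans (ℕ.m≤n+m (sumℕ es) e) ≤N))
  expProd-local : (i : ℕ) (μ : Mono) → degreeFrom (suc i) μ ≤ N → expProd φ μ ≡ expProd ψ μ
  expProd-local i []       _   = refl
  expProd-local i (r ∷ rs) ≤N = cong₂ _*_
    (row-local r (ℕ.≤-trans (ℕ.m≤m+n (sumℕ r) (i *ℕ sumℕ r)) (ℕ.≤-trans (ℕ.m≤m+n (suc i *ℕ sumℕ r) _) ≤N)))
    (expProd-local (suc i) rs (ℕ.≤-trans (ℕ.m≤n+m _ (suc i *ℕ sumℕ r)) ≤N))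

eqRow-sound : (x y : List ℕ) → eqRow x y ≡ true → x ≡ y
eqRow-sound []      []      _ = refl
eqRow-sound (a ∷ x) (b ∷ y) h with ∧-true (a ≡ᵇ b) (eqRow x y) h
... | a≡b , x≡y = cong₂ _∷_ (≡ᵇ⇒≡ a b a≡b) (eqRow-sound x y x≡y)

eqMono-sound : (x y : Mono) → eqMono x y ≡ true → x ≡ y
eqMono-sound []      []      _ = refl
eqMono-sound (a ∷ x) (b ∷ y) h with ∧-true (eqRow a b) (eqMono x y) h
... | a≡b , x≡y = cong₂ _∷_ (eqRow-sound a b a≡b) (eqMono-sound x y x≡y)

degreeFrom-powMono : (M i : ℕ) (a : Mono) → degreeFrom i (powMono M a) ≡ M *ℕ degreeFrom i a
degreeFrom-powMono M i []       = sym (ℕ.*-zeroʳ M)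
degreeFrom-powMono M i (r ∷ rs) = begin
  i *ℕ sumℕ (map (M *ℕ_) r) +ℕ degreeFrom (suc i) (powMono M rs)
    ≡⟨ cong₂ (λ x y → i *ℕ x +ℕ y) (sumℕ-map-* r) (degreeFrom-powMono M (suc i) rs) ⟩
  i *ℕ (M *ℕ sumℕ r) +ℕ M *ℕ degreeFrom (suc i) rs
    ≡⟨ solve 4 (λ i M s d → i :* (M :* s) :+ M :* d := M :* (i :* s :+ d)) refl i M (sumℕ r) (degreeFrom (suc i) rs) ⟩
  M *ℕ (i *ℕ sumℕ r +ℕ degreeFrom (suc i) rs) ∎
  where
  open ≡-Reasoning
  open ℕ-Solver
  sumℕ-map-* : (r : List ℕ) → sumℕ (map (M *ℕ_) r) ≡ M *ℕ sumℕ r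
  sumℕ-map-* []       = sym (ℕ.*-zeroʳ M)
  sumℕ-map-* (e ∷ es) = trans (cong (M *ℕ e +ℕ_) (sumℕ-map-* es)) (sym (ℕ.*-distribˡ-+ M e (sumℕ es)))

-- The coefficients of φ(x^M).
dilate : ℕ → (ℕ → ℤ) → ℕ → ℤ
dilate M φ e = ∑ (λ a → 𝟙 (M *ℕ a ≡ᵇ e) * φ a) (upTo (suc e))

∑-splits-subst^ : (M : ℕ) (φ : ℕ → ℤ) (μ : Mono) →
  ∑ (λ p → 𝟙 (eqMono (powMono M (proj₁ p)) μ) * expProd φ (proj₁ p)) (splits μ) ≡ expProd (dilate M φ) μ
∑-splits-subst^ M φ μ =
  trans (∑-splits-factor (λ ν x _ → 𝟙 (eqMono (powMono M x) ν) * expProd φ x) (λ r x _ → 𝟙 (eqRow (map (M *ℕ_) x) r) * ∏ φ x)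
          (λ r rs x xs _ _ → trans (cong (_* (∏ φ x * expProd φ xs)) (𝟙-∧ (eqRow (map (M *ℕ_) x) r) (eqMono (powMono M xs) rs)))
                                   (interchange (𝟙 (eqRow (map (M *ℕ_) x) r)) (𝟙 (eqMono (powMono M xs) rs)) (∏ φ x) (expProd φ xs)))
          refl μ)
  (∏-cong μ (λ r _ → ∑-splitsRow-factor (λ r x _ → 𝟙 (eqRow (map (M *ℕ_) x) r) * ∏ φ x) (λ e a _ → 𝟙 (M *ℕ a ≡ᵇ e) * φ a)
          (λ e es a _ x _ → trans (cong (_* (φ a * ∏ φ x)) (𝟙-∧ (M *ℕ a ≡ᵇ e) (eqRow (map (M *ℕ_) x) es)))
                                  (interchange (𝟙 (M *ℕ a ≡ᵇ e)) (𝟙 (eqRow (map (M *ℕ_) x) es)) (φ a) (∏ φ x)))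
          refl r))
  where
  open import Algebra.Properties.CommutativeSemigroup ℤ.*-commutativeSemigroup using (interchange)

subst^-cong : (M : ℕ) {f g : Series} → f ≋ g → subst^ M f ≋ subst^ M g
subst^-cong M f≋g μ = ∑-ext (splits μ) (λ p → cong (λ z → if eqMono (powMono M (proj₁ p)) μ then z else 0ℤ) (f≋g (proj₁ p)))

subst^-prodSeries : (M : ℕ) → 1 ≤ M → (n : ℕ) (φ : ℕ → ℤ) → subst^ M (prodSeries n φ) ≋ prodSeries (n *ℕ M) (dilate M φ)
subst^-prodSeries M 1≤M n φ μ = begin
  subst^ M (prodSeries n φ) μ
    ≡⟨ ∑-ext (splits μ) (λ p → trans (if-then-0 (eqMono (powMono M (proj₁ p)) μ) (prodSeries n φ (proj₁ p))) (degree-matches (proj₁ p))) ⟩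
  ∑ (λ p → 𝟙 (degree μ ≡ᵇ n *ℕ M) * (𝟙 (eqMono (powMono M (proj₁ p)) μ) * expProd φ (proj₁ p))) (splits μ)
    ≡⟨ sym (∑-*ˡ (𝟙 (degree μ ≡ᵇ n *ℕ M)) _ (splits μ)) ⟩
  𝟙 (degree μ ≡ᵇ n *ℕ M) * ∑ (λ p → 𝟙 (eqMono (powMono M (proj₁ p)) μ) * expProd φ (proj₁ p)) (splits μ)
    ≡⟨ cong (𝟙 (degree μ ≡ᵇ n *ℕ M) *_) (∑-splits-subst^ M φ μ) ⟩
  prodSeries (n *ℕ M) (dilate M φ) μ ∎
  where
  open ≡-Reasoning
  degree-matches : (a : Mono) → 𝟙 (eqMono (powMono M a) μ) * prodSeries n φ a ≡
                                𝟙 (degree μ ≡ᵇ n *ℕ M) * (𝟙 (eqMono (powMono M a) μ) * expProd φ a)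
  degree-matches a with eqMono (powMono M a) μ in aᴹ≡μ
  ... | false = trans (ℤ.*-zeroˡ (prodSeries n φ a))
                      (sym (trans (cong (𝟙 (degree μ ≡ᵇ n *ℕ M) *_) (ℤ.*-zeroˡ (expProd φ a))) (ℤ.*-zeroʳ (𝟙 (degree μ ≡ᵇ n *ℕ M)))))
  ... | true  = trans (ℤ.*-identityˡ (prodSeries n φ a))
                      (cong₂ _*_ (cong 𝟙 (Bool-ext _ _ ⇒ ⇐)) (sym (ℤ.*-identityˡ (expProd φ a))))
    where
    degree-μ : degree μ ≡ M *ℕ degree a
    degree-μ = trans (cong degree (sym (eqMono-sound (powMono M a) μ aᴹ≡μ))) (degreeFrom-powMono M 1 a)
    ⇒ : (degree a ≡ᵇ n) ≡ true → (degree μ ≡ᵇ n *ℕ M) ≡ true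
    ⇒ h = ≡⇒≡ᵇ (trans degree-μ (trans (cong (M *ℕ_) (≡ᵇ⇒≡ _ _ h)) (ℕ.*-comm M n)))
    ⇐ : (degree μ ≡ᵇ n *ℕ M) ≡ true → (degree a ≡ᵇ n) ≡ true
    ⇐ h = ≡⇒≡ᵇ (ℕ.*-cancelˡ-≡ (degree a) n M {{>-nonZero 1≤M}} (trans (sym degree-μ) (trans (≡ᵇ⇒≡ _ _ h) (ℕ.*-comm n M))))

dilate-∣ : (Q : ℕ) (φ : ℕ → ℤ) (e : ℕ) → dilate Q φ e ≢ 0ℤ → Q ∣ e
dilate-∣ Q φ e ≢0 with ∑-≢0 ℤ._≟_ (λ a → 𝟙 (Q *ℕ a ≡ᵇ e) * φ a) (upTo (suc e)) ≢0
... | a , _ , term≢0 with Q *ℕ a ≡ᵇ e in Qa≡e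
...   | true  = divides a (trans (sym (≡ᵇ⇒≡ _ _ Qa≡e)) (ℕ.*-comm Q a))
...   | false = ⊥-elim (term≢0 (ℤ.*-zeroˡ (φ a)))

dilate-0 : (Q : ℕ) (φ : ℕ → ℤ) → φ 0 ≡ 1ℤ → dilate Q φ 0 ≡ 1ℤ
dilate-0 Q φ φ0≡1 rewrite ℕ.*-zeroʳ Q | φ0≡1 = refl

-- Stack partitions

LexLe : ℕ × ℕ → ℕ × ℕ → Set
LexLe (d , m) (d′ , m′) = (d < d′) ⊎ ((d ≡ d′) × (m ≤ m′))

≤ˢ⇒LexLe : (a b : ℕ × ℕ) → (a ≤ˢ b) ≡ true → LexLe a b
≤ˢ⇒LexLe (d , m) (d′ , m′) h with d ≡ᵇ d′ in d≡d′
... | true  = inj₂ (≡ᵇ⇒≡ d d′ d≡d′ , ≤ᵇ⇒≤ m m′ h)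
... | false = inj₁ (ℕ.≤∧≢⇒< (≤ᵇ⇒≤ d d′ h) (λ d≡d′′ → false≢true (trans (sym d≡d′) (≡⇒≡ᵇ d≡d′′))))

LexLe⇒≤ˢ : (a b : ℕ × ℕ) → LexLe a b → (a ≤ˢ b) ≡ true
LexLe⇒≤ˢ (d , m) (d′ , m′) (inj₁ d<d′) rewrite ≢⇒≡ᵇ-false (ℕ.<⇒≢ d<d′) = ≤⇒≤ᵇ (ℕ.<⇒≤ d<d′)
LexLe⇒≤ˢ (d , m) (d′ , m′) (inj₂ (refl , m≤m′)) rewrite ≡⇒≡ᵇ {d} refl = ≤⇒≤ᵇ m≤m′

LexLe-trans : (a b c : ℕ × ℕ) → LexLe a b → LexLe b c → LexLe a c
LexLe-trans _ _ _ (inj₁ p)          (inj₁ q)          = inj₁ (ℕ.<-trans p q)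
LexLe-trans _ _ _ (inj₁ p)          (inj₂ (refl , _)) = inj₁ p
LexLe-trans _ _ _ (inj₂ (refl , _)) (inj₁ q)          = inj₁ q
LexLe-trans _ _ _ (inj₂ (refl , p)) (inj₂ (refl , q)) = inj₂ (refl , ℕ.≤-trans p q)

LexLe-antisym : (a b : ℕ × ℕ) → LexLe a b → LexLe b a → a ≡ b
LexLe-antisym _       _ (inj₁ p)          (inj₁ q)          = ⊥-elim (ℕ.<-asym p q)
LexLe-antisym _       _ (inj₁ p)          (inj₂ (refl , _)) = ⊥-elim (ℕ.<-irrefl refl p)
LexLe-antisym _       _ (inj₂ (refl , _)) (inj₁ q)          = ⊥-elim (ℕ.<-irrefl refl q)
LexLe-antisym (d , _) _ (inj₂ (refl , p)) (inj₂ (_ , q))    = cong (d ,_) (ℕ.≤-antisym p q)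

LexLe-total : (a b : ℕ × ℕ) → LexLe a b ⊎ LexLe b a
LexLe-total (d , m) (d′ , m′) with ℕ.<-cmp d d′
... | tri< d<d′ _ _ = inj₁ (inj₁ d<d′)
... | tri> _ _ d>d′ = inj₂ (inj₁ d>d′)
... | tri≈ _ refl _ with ℕ.≤-total m m′
...   | inj₁ m≤m′ = inj₁ (inj₂ (refl , m≤m′))
...   | inj₂ m′≤m = inj₂ (inj₂ (refl , m′≤m))

module StackOrder (key : Stack → ℕ × ℕ) (key-injective : ∀ {s t} → key s ≡ key t → s ≡ t) where

  _≼_ : Stack → Stack → Set
  s ≼ t = (key s ≤ˢ key t) ≡ true

  ≼⇒LexLe : ∀ {s t} → s ≼ t → LexLe (key s) (key t)
  ≼⇒LexLe {s} {t} = ≤ˢ⇒LexLe (key s) (key t)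

  LexLe⇒≼ : ∀ {s t} → LexLe (key s) (key t) → s ≼ t
  LexLe⇒≼ {s} {t} = LexLe⇒≤ˢ (key s) (key t)

  decTotalOrder : DecTotalOrder 0ℓ 0ℓ 0ℓ
  decTotalOrder = record
    { Carrier = Stack
    ; _≈_ = _≡_
    ; _≤_ = _≼_
    ; isDecTotalOrder = record
      { isTotalOrder = record
        { isPartialOrder = record
          { isPreorder = record
            { isEquivalence = isEquivalence
            ; reflexive = λ { {s} refl → LexLe⇒≼ (inj₂ (refl , ℕ.≤-refl)) }
            ; trans = λ {s} {t} {u} s≼t t≼u → LexLe⇒≼ (LexLe-trans (key s) (key t) (key u) (≼⇒LexLe s≼t) (≼⇒LexLe t≼u))
            }
          ; antisym = λ {s} {t} s≼t t≼s → key-injective (LexLe-antisym (key s) (key t) (≼⇒LexLe s≼t) (≼⇒LexLe t≼s))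
          }
        ; total = λ s t → ⊎-map LexLe⇒≼ LexLe⇒≼ (LexLe-total (key s) (key t))
        }
      ; _≟_ = ≡-dec ℕ._≟_ ℕ._≟_
      ; _≤?_ = λ s t → (key s ≤ˢ key t) Bool.≟ true
      }
    }

module ByDegree = StackOrder id id

swap-injective : {s t : Stack} → swap s ≡ swap t → s ≡ t
swap-injective {_ , _} {_ , _} refl = refl

module ByMultiplicity = StackOrder swap swap-injective

degreeDescending : DecTotalOrder 0ℓ 0ℓ 0ℓ
degreeDescending = Flip.decTotalOrder ByDegree.decTotalOrder

module SortByDegree = Data.List.Sort degreeDescending
module SortByMultiplicity = Data.List.Sort ByMultiplicity.decTotalOrder

SortedByDegree : StackPartition → Set
SortedByDegree = Linked (λ s t → (t ≤ˢ s) ≡ true)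

SortedByMultiplicity : StackPartition → Set
SortedByMultiplicity = Linked ByMultiplicity._≼_

sortByDegree : StackPartition → StackPartition
sortByDegree = SortByDegree.sort

sortByMultiplicity : StackPartition → StackPartition
sortByMultiplicity = SortByMultiplicity.sort

sortedByDegree-unique : {xs ys : StackPartition} → SortedByDegree xs → SortedByDegree ys → xs ↭ ys → xs ≡ ys
sortedByDegree-unique sxs sys p =
  Pointwise-≡⇒≡ (Sorted.↗↭↗⇒≋ (DecTotalOrder.totalOrder degreeDescending) sxs sys (↭⇒↭ₛ p))

sortedByMultiplicity-unique : {xs ys : StackPartition} → SortedByMultiplicity xs → SortedByMultiplicity ys → xs ↭ ys → xs ≡ ys
sortedByMultiplicity-unique sxs sys p =
  Pointwise-≡⇒≡ (Sorted.↗↭↗⇒≋ (DecTotalOrder.totalOrder ByMultiplicity.decTotalOrder) sxs sys (↭⇒↭ₛ p))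

weaklyDecreasing⇒Sorted : (τ : StackPartition) → weaklyDecreasing τ ≡ true → SortedByDegree τ
weaklyDecreasing⇒Sorted []          _ = []
weaklyDecreasing⇒Sorted (s ∷ [])     _ = [-]
weaklyDecreasing⇒Sorted (s ∷ tτ@(t ∷ τ)) h =
  proj₁ (∧-true (t ≤ˢ s) (weaklyDecreasing tτ) h) ∷ weaklyDecreasing⇒Sorted tτ (proj₂ (∧-true (t ≤ˢ s) (weaklyDecreasing tτ) h))

Sorted⇒weaklyDecreasing : (τ : StackPartition) → SortedByDegree τ → weaklyDecreasing τ ≡ true
Sorted⇒weaklyDecreasing []          _            = refl
Sorted⇒weaklyDecreasing (s ∷ [])     _            = refl
Sorted⇒weaklyDecreasing (s ∷ t ∷ τ) (t≤s ∷ sτ) = cong₂ _∧_ t≤s (Sorted⇒weaklyDecreasing (t ∷ τ) sτ)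

PositiveStack : Stack → Set
PositiveStack s = (1 ≤ deg s) × (1 ≤ mult s)

IsStackPartitionOf : ℕ → StackPartition → Set
IsStackPartitionOf n τ = All PositiveStack τ × (size τ ≡ n) × SortedByDegree τ

isStackPartitionOf-sound : (n : ℕ) (τ : StackPartition) → isStackPartitionOf n τ ≡ true → IsStackPartitionOf n τ
isStackPartitionOf-sound n τ h with ∧-true (all (λ s → (1 ≤ᵇ deg s) ∧ (1 ≤ᵇ mult s)) τ) _ h
... | pos , rest with ∧-true (size τ ≡ᵇ n) (weaklyDecreasing τ) rest
...   | size≡n , wd = All.map positive (all-sound _ τ pos) , ≡ᵇ⇒≡ _ _ size≡n , weaklyDecreasing⇒Sorted τ wd
  where
  positive : {s : Stack} → ((1 ≤ᵇ deg s) ∧ (1 ≤ᵇ mult s)) ≡ true → PositiveStack s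
  positive {s} h′ with ∧-true (1 ≤ᵇ deg s) (1 ≤ᵇ mult s) h′
  ... | 1≤d , 1≤m = ≤ᵇ⇒≤ 1 (deg s) 1≤d , ≤ᵇ⇒≤ 1 (mult s) 1≤m

isStackPartitionOf-complete : (n : ℕ) (τ : StackPartition) → IsStackPartitionOf n τ → isStackPartitionOf n τ ≡ true
isStackPartitionOf-complete n τ (pos , size≡n , sτ) =
  cong₂ _∧_ (all-complete _ τ (All.map (λ (1≤d , 1≤m) → cong₂ _∧_ (≤⇒≤ᵇ 1≤d) (≤⇒≤ᵇ 1≤m)) pos))
            (cong₂ _∧_ (≡⇒≡ᵇ size≡n) (Sorted⇒weaklyDecreasing τ sτ))

stack≤size : (τ : StackPartition) {s : Stack} → s ∈ τ → deg s *ℕ mult s ≤ size τ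
stack≤size (t ∷ τ) (here refl) = ℕ.m≤m+n _ _
stack≤size (t ∷ τ) (there s∈)  = ℕ.≤-trans (stack≤size τ s∈) (ℕ.m≤n+m _ _)

length≤size : (τ : StackPartition) → All PositiveStack τ → length τ ≤ size τ
length≤size []             []                 = z≤n
length≤size ((d , m) ∷ τ) ((1≤d , 1≤m) ∷ pos) = ℕ.+-mono-≤ (ℕ.*-mono-≤ 1≤d 1≤m) (length≤size τ pos)

∈-stackPartitions⁻ : (n : ℕ) {τ : StackPartition} → τ ∈ stackPartitions n → IsStackPartitionOf n τ
∈-stackPartitions⁻ n {τ} τ∈ =
  isStackPartitionOf-sound n τ (proj₂ (∈-filterᵇ⁻ (isStackPartitionOf n) {listsUpTo n (stacksUpTo n)} τ∈))

∈-stackPartitions⁺ : (n : ℕ) {τ : StackPartition} → IsStackPartitionOf n τ → τ ∈ stackPartitions n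
∈-stackPartitions⁺ n {τ} h@(pos , size≡n , _) =
  ∈-filterᵇ⁺ (isStackPartitionOf n)
    (∈-listsUpTo⁺ n (stacksUpTo n) (subst (length τ ≤_) size≡n (length≤size τ pos)) (All.tabulate listed))
    (isStackPartitionOf-complete n τ h)
  where
  listed : {s : Stack} → s ∈ τ → s ∈ stacksUpTo n
  listed {d , m} s∈ with All.lookup pos s∈
  ... | 1≤d , 1≤m = ∈-stacksUpTo⁺ 1≤d (ℕ.≤-trans (ℕ.m≤m*n d m {{>-nonZero 1≤m}}) dm≤n)
                                  1≤m (ℕ.≤-trans (ℕ.m≤n*m m d {{>-nonZero 1≤d}}) dm≤n)
    where
    dm≤n : d *ℕ m ≤ n
    dm≤n = subst (d *ℕ m ≤_) size≡n (stack≤size τ s∈)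

stackPartitions-unique : (n : ℕ) → Unique (stackPartitions n)
stackPartitions-unique n =
  filterᵇ-unique (isStackPartitionOf n) (listsUpTo-unique n (stacksUpTo-unique n))

n<2^n : (n : ℕ) → n < 2 ^ℕ n
n<2^n zero    = s≤s z≤n
n<2^n (suc n) = subst (_≤ 2 ^ℕ suc n) (ℕ.+-comm (suc n) 1)
                  (ℕ.+-mono-≤ (n<2^n n) (ℕ.≤-trans (ℕ.m^n>0 2 n) (ℕ.m≤m+n (2 ^ℕ n) 0)))

PowerOf2Mult : Stack → Set
PowerOf2Mult s = ∃[ e ] (mult s ≡ 2 ^ℕ e)

DistinctMults : StackPartition → Set
DistinctMults = AllPairs (λ s t → mult s ≢ mult t)

GoodIndex : StackPartition → Set
GoodIndex τ = All PowerOf2Mult τ × DistinctMults τ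

goodIndex-sound : (τ : StackPartition) → goodIndex τ ≡ true → GoodIndex τ
goodIndex-sound τ h with ∧-true (all (λ s → isPowerOf2 (mult s)) τ) (distinctMults τ) h
... | pow2 , distinct = All.map (λ {s} → powerOf2 {s}) (all-sound (λ s → isPowerOf2 (mult s)) τ pow2) , distinct-sound τ distinct
  where
  powerOf2 : {s : Stack} → isPowerOf2 (mult s) ≡ true → PowerOf2Mult s
  powerOf2 {s} h′ with any-sound (λ e → (2 ^ℕ e) ≡ᵇ mult s) (upTo (suc (mult s))) h′
  ... | e , _ , 2^e≡m = e , sym (≡ᵇ⇒≡ _ _ 2^e≡m)
  distinct-sound : (τ : StackPartition) → distinctMults τ ≡ true → DistinctMults τ
  distinct-sound []      _ = []
  distinct-sound (s ∷ τ) h′ with ∧-true (all (λ t → not (mult s ≡ᵇ mult t)) τ) (distinctMults τ) h′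
  ... | s-apart , rest = All.map (λ {t} → apart {t}) (all-sound (λ t → not (mult s ≡ᵇ mult t)) τ s-apart) ∷ distinct-sound τ rest
    where
    apart : {t : Stack} → not (mult s ≡ᵇ mult t) ≡ true → mult s ≢ mult t
    apart {t} h″ ms≡mt rewrite ≡⇒≡ᵇ ms≡mt = false≢true h″

goodIndex-complete : (τ : StackPartition) → GoodIndex τ → goodIndex τ ≡ true
goodIndex-complete τ (pow2 , distinct) =
  cong₂ _∧_ (all-complete (λ s → isPowerOf2 (mult s)) τ (All.map (λ {s} → powerOf2 {s}) pow2)) (distinct-complete τ distinct)
  where
  powerOf2 : {s : Stack} → PowerOf2Mult s → isPowerOf2 (mult s) ≡ true
  powerOf2 (e , refl) = any-complete (λ x → (2 ^ℕ x) ≡ᵇ (2 ^ℕ e)) (∈.∈-upTo⁺ (s≤s (ℕ.<⇒≤ (n<2^n e)))) (≡⇒≡ᵇ {2 ^ℕ e} refl)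
  distinct-complete : (τ : StackPartition) → DistinctMults τ → distinctMults τ ≡ true
  distinct-complete []      []               = refl
  distinct-complete (s ∷ τ) (s-apart ∷ rest) =
    cong₂ _∧_ (all-complete (λ t → not (mult s ≡ᵇ mult t)) τ (All.map (λ {t} → cong not ∘ ≢⇒≡ᵇ-false {mult s} {mult t}) s-apart)) (distinct-complete τ rest)

∈-goodStackPartitions⁻ : (d : ℕ) {τ : StackPartition} → τ ∈ goodStackPartitions d → GoodIndex τ × IsStackPartitionOf d τ
∈-goodStackPartitions⁻ d {τ} τ∈ with ∈-filterᵇ⁻ goodIndex {stackPartitions d} τ∈
... | τ∈′ , good = goodIndex-sound τ good , ∈-stackPartitions⁻ d τ∈′

∈-goodStackPartitions⁺ : (d : ℕ) {τ : StackPartition} → GoodIndex τ → IsStackPartitionOf d τ → τ ∈ goodStackPartitions d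
∈-goodStackPartitions⁺ d {τ} good τ⊩d = ∈-filterᵇ⁺ goodIndex (∈-stackPartitions⁺ d τ⊩d) (goodIndex-complete τ good)

goodStackPartitions-unique : (d : ℕ) → Unique (goodStackPartitions d)
goodStackPartitions-unique d = filterᵇ-unique goodIndex (stackPartitions-unique d)

AllPairs-resp-↭ : {R : A → A → Set} → (∀ {x y} → R x y → R y x) → {xs ys : List A} → xs ↭ ys → AllPairs R xs → AllPairs R ys
AllPairs-resp-↭ {A = A} {R = R} R-sym p = ↭ₛ.AllPairs-resp-↭ (setoid A) R-sym (resp₂ R) (↭⇒↭ₛ p)

-- Monomial polysymmetric functions

zipStacks : StackPartition → List ℕ → List (Stack × ℕ)
zipStacks (t ∷ ts) (b ∷ bs) = (t , b) ∷ zipStacks ts bs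
zipStacks _        _        = []

apart : Stack → ℕ → Stack × ℕ → Bool
apart s a p = not ((deg s ≡ᵇ deg (proj₁ p)) ∧ (a ≡ᵇ proj₂ p))

all-zipStacks-unique : (f : Stack × ℕ → Bool) (g : StackPartition → List ℕ → Bool) →
  (∀ t ts b bs → g (t ∷ ts) (b ∷ bs) ≡ (f (t , b) ∧ g ts bs)) → (∀ bs → g [] bs ≡ true) → (∀ t ts → g (t ∷ ts) [] ≡ true) →
  (ts : StackPartition) (bs : List ℕ) → g ts bs ≡ all f (zipStacks ts bs)
all-zipStacks-unique f g g-∷ g-[]ˡ g-[]ʳ []       bs       = g-[]ˡ bs
all-zipStacks-unique f g g-∷ g-[]ˡ g-[]ʳ (t ∷ ts) []       = g-[]ʳ t ts
all-zipStacks-unique f g g-∷ g-[]ˡ g-[]ʳ (t ∷ ts) (b ∷ bs) =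
  trans (g-∷ t ts b bs) (cong (f (t , b) ∧_) (all-zipStacks-unique f g g-∷ g-[]ˡ g-[]ʳ ts bs))

-- Defs.admissible zips with a function local to its definition, which cannot be named here:
-- admissibleZip is that zip (followed by the test against the head) and is found by unification.
mutual
  admissibleZip : Stack → ℕ → StackPartition → List ℕ → StackPartition → List ℕ → Bool
  admissibleZip = _

  admissible-∷ : (s : Stack) (a : ℕ) (τ : StackPartition) (α : List ℕ) →
    admissible (s ∷ τ) (a ∷ α) ≡ (all (apart s a) (zipStacks τ α) ∧ admissible τ α)
  admissible-∷ s a []      α       = refl
  admissible-∷ s a (t ∷ τ) []      = refl
  admissible-∷ s a (t ∷ τ) (b ∷ α) with t ∷ τ | b ∷ α
  ... | tτ | bα = cong (λ rest → (apart s a (t , b) ∧ rest) ∧ admissible (t ∷ τ) (b ∷ α))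
                       (all-zipStacks-unique (apart s a) (admissibleZip s a tτ bα)
                          (λ _ _ _ _ → refl) (λ _ → refl) (λ _ _ → refl) τ α)

-- An entry (i , j , e) records the exponent e of the variable x_{i,j}.
Entry : Set
Entry = ℕ × ℕ × ℕ

entryVar : Entry → ℕ × ℕ
entryVar (i , j , e) = i , j

entryStack : Entry → Stack
entryStack (i , j , e) = i , e

entryIndex : Entry → ℕ
entryIndex (i , j , e) = j

entryExp : Entry → ℕ
entryExp (i , j , e) = e

toEntry : Stack × ℕ → Entry
toEntry ((d , m) , a) = d , a , m

zipEntries : StackPartition → List ℕ → List Entry
zipEntries τ α = map toEntry (zipStacks τ α)

_≠var_ : Entry → Entry → Set
t ≠var u = entryVar t ≢ entryVar u

≠var-sym : ∀ {t u} → t ≠var u → u ≠var t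
≠var-sym t≠u = t≠u ∘ sym

≠var⇒Unique : {ts : List Entry} → AllPairs _≠var_ ts → Unique ts
≠var⇒Unique = AllPairs.map (λ t≠u t≡u → t≠u (cong entryVar t≡u))

apart⇔≠var : (s : Stack) (a : ℕ) (p : Stack × ℕ) → (apart s a p ≡ true → toEntry (s , a) ≠var toEntry p)
                                                  × (toEntry (s , a) ≠var toEntry p → apart s a p ≡ true)
apart⇔≠var (d , m) a ((d′ , m′) , b) with d ≡ᵇ d′ in d≡d′ | a ≡ᵇ b in a≡b
... | true  | true  = (λ ()) , λ ≠ → ⊥-elim (≠ (cong₂ _,_ (≡ᵇ⇒≡ d d′ d≡d′) (≡ᵇ⇒≡ a b a≡b)))
... | true  | false = (λ _ eq → false≢true (trans (sym a≡b) (≡⇒≡ᵇ (cong proj₂ eq)))) , λ _ → refl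
... | false | _     = (λ _ eq → false≢true (trans (sym d≡d′) (≡⇒≡ᵇ (cong proj₁ eq)))) , λ _ → refl

admissible-sound : (τ : StackPartition) (α : List ℕ) → admissible τ α ≡ true → AllPairs _≠var_ (zipEntries τ α)
admissible-sound []      α       _ = []
admissible-sound (s ∷ τ) []      _ = []
admissible-sound (s ∷ τ) (a ∷ α) h with ∧-true (all (apart s a) (zipStacks τ α)) (admissible τ α) (trans (sym (admissible-∷ s a τ α)) h)
... | head-apart , rest =
  All-map⁺ (All.map (λ {p} → proj₁ (apart⇔≠var s a p)) (all-sound (apart s a) (zipStacks τ α) head-apart))
    ∷ admissible-sound τ α rest

admissible-complete : (τ : StackPartition) (α : List ℕ) → AllPairs _≠var_ (zipEntries τ α) → admissible τ α ≡ true
admissible-complete []      α       _ = refl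
admissible-complete (s ∷ τ) []      _ = refl
admissible-complete (s ∷ τ) (a ∷ α) (head-apart ∷ rest) = trans (admissible-∷ s a τ α)
  (cong₂ _∧_ (all-complete (apart s a) (zipStacks τ α) (All.map (λ {p} → proj₂ (apart⇔≠var s a p)) (All-map⁻ head-apart)))
             (admissible-complete τ α rest))

expAt : ℕ → ℕ → Entry → ℕ
expAt i j (i′ , j′ , e) = if (i′ ≡ᵇ i) ∧ (j′ ≡ᵇ j) then e else 0

stackExpo≡∑ : (τ : StackPartition) (α : List ℕ) (i j : ℕ) → stackExpo τ α i j ≡ ∑ℕ (expAt i j) (zipEntries τ α)
stackExpo≡∑ []      α       i j = refl
stackExpo≡∑ (s ∷ τ) []      i j = refl
stackExpo≡∑ (s ∷ τ) (a ∷ α) i j = cong (expAt i j (toEntry (s , a)) +ℕ_) (stackExpo≡∑ τ α i j)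

zipEntries-stacks : (τ : StackPartition) (α : List ℕ) → length α ≡ length τ → map entryStack (zipEntries τ α) ≡ τ
zipEntries-stacks []      α       _   = refl
zipEntries-stacks (s ∷ τ) (a ∷ α) len = cong (s ∷_) (zipEntries-stacks τ α (ℕ.suc-injective len))

zipEntries-entries : (ts : List Entry) → zipEntries (map entryStack ts) (map entryIndex ts) ≡ ts
zipEntries-entries []             = refl
zipEntries-entries ((i , j , e) ∷ ts) = cong ((i , j , e) ∷_) (zipEntries-entries ts)

∈-zipStacks⁻ : {τ : StackPartition} {α : List ℕ} {s : Stack} {a : ℕ} → (s , a) ∈ zipStacks τ α → (s ∈ τ) × (a ∈ α)
∈-zipStacks⁻ {t ∷ τ} {b ∷ α} (here refl) = here refl , here refl
∈-zipStacks⁻ {t ∷ τ} {b ∷ α} (there p∈)  = ×-map there there (∈-zipStacks⁻ {τ} {α} p∈)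

Bounded : StackPartition → Mono → ℕ → ℕ → Set
Bounded τ μ i j = (1 ≤ i) × (i ≤ length μ ⊔ maxDeg τ) × (1 ≤ j) × (j ≤ rowBound μ)

produces-sound : (τ : StackPartition) (α : List ℕ) (μ : Mono) → produces τ α μ ≡ true →
  ∀ i j → Bounded τ μ i j → expo μ i j ≡ stackExpo τ α i j
produces-sound τ α μ h i j (1≤i , i≤ , 1≤j , j≤) =
  ≡ᵇ⇒≡ _ _ (All.lookup (all-sound _ (range1 (rowBound μ))
                          (All.lookup (all-sound _ (range1 (length μ ⊔ maxDeg τ)) h) (∈-range1⁺ 1≤i i≤)))
                       (∈-range1⁺ 1≤j j≤))

produces-complete : (τ : StackPartition) (α : List ℕ) (μ : Mono) →
  (∀ i j → Bounded τ μ i j → expo μ i j ≡ stackExpo τ α i j) → produces τ α μ ≡ true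
produces-complete τ α μ h =
  all-complete _ (range1 (length μ ⊔ maxDeg τ)) (All.tabulate (λ {i} i∈ →
    all-complete _ (range1 (rowBound μ)) (All.tabulate (λ {j} j∈ →
      ≡⇒≡ᵇ (h i j (proj₁ (∈-range1⁻ i∈) , proj₂ (∈-range1⁻ i∈) , proj₁ (∈-range1⁻ j∈) , proj₂ (∈-range1⁻ j∈)))))))

rowEntries : ℕ → ℕ → List ℕ → List Entry
rowEntries i j []           = []
rowEntries i j (zero ∷ es)  = rowEntries i (suc j) es
rowEntries i j (suc e ∷ es) = (i , j , suc e) ∷ rowEntries i (suc j) es

monoEntries : ℕ → Mono → List Entry
monoEntries i []       = []
monoEntries i (r ∷ rs) = rowEntries i 1 r ++ monoEntries (suc i) rs

entries : Mono → List Entry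
entries = monoEntries 1

entryStacks : Mono → StackPartition
entryStacks μ = map entryStack (entries μ)

∸-suc : {j j′ : ℕ} → j < j′ → j′ ∸ j ≡ suc (j′ ∸ suc j)
∸-suc {j} {suc k} (s≤s j≤k) = ℕ.+-∸-assoc 1 j≤k

∈-rowEntries⁻ : ∀ i j r {i′ j′ e} → (i′ , j′ , e) ∈ rowEntries i j r →
  (i′ ≡ i) × (j ≤ j′) × (e ≢ 0) × (at 0 r (j′ ∸ j) ≡ e)
∈-rowEntries⁻ i j (zero ∷ es) t∈ with ∈-rowEntries⁻ i (suc j) es t∈
... | i′≡i , j<j′ , e≢0 , at≡e = i′≡i , ℕ.<⇒≤ j<j′ , e≢0 , trans (cong (at 0 (zero ∷ es)) (∸-suc j<j′)) at≡e
∈-rowEntries⁻ i j (suc e ∷ es) (here refl) = refl , ℕ.≤-refl , (λ ()) , cong (at 0 (suc e ∷ es)) (ℕ.n∸n≡0 j)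
∈-rowEntries⁻ i j (suc e ∷ es) (there t∈) with ∈-rowEntries⁻ i (suc j) es t∈
... | i′≡i , j<j′ , e≢0 , at≡e = i′≡i , ℕ.<⇒≤ j<j′ , e≢0 , trans (cong (at 0 (suc e ∷ es)) (∸-suc j<j′)) at≡e

∈-rowEntries⁺ : ∀ i j r {j′ e} → j ≤ j′ → e ≢ 0 → at 0 r (j′ ∸ j) ≡ e → (i , j′ , e) ∈ rowEntries i j r
∈-rowEntries⁺ i j []       _   e≢0 at≡e = ⊥-elim (e≢0 (sym at≡e))
∈-rowEntries⁺ i j (x ∷ es) j≤j′ e≢0 at≡e with ℕ.m≤n⇒m<n∨m≡n j≤j′
... | inj₂ refl with trans (sym (cong (at 0 (x ∷ es)) (ℕ.n∸n≡0 j))) at≡e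
...   | refl with x
...     | zero   = ⊥-elim (e≢0 refl)
...     | suc _  = here refl
∈-rowEntries⁺ i j (x ∷ es) j≤j′ e≢0 at≡e | inj₁ j<j′
  with ∈-rowEntries⁺ i (suc j) es j<j′ e≢0 (trans (sym (cong (at 0 (x ∷ es)) (∸-suc j<j′))) at≡e)
... | t∈ with x
...   | zero  = t∈
...   | suc _ = there t∈

∈-monoEntries⁻ : ∀ i μ {i′ j′ e} → (i′ , j′ , e) ∈ monoEntries i μ →
  (i ≤ i′) × (1 ≤ j′) × (e ≢ 0) × (at 0 (at [] μ (i′ ∸ i)) (j′ ∸ 1) ≡ e)
∈-monoEntries⁻ i (r ∷ rs) {i′} {j′} t∈ with ∈.∈-++⁻ (rowEntries i 1 r) t∈
... | inj₁ t∈r with ∈-rowEntries⁻ i 1 r t∈r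
...   | refl , 1≤j′ , e≢0 , at≡e =
  ℕ.≤-refl , 1≤j′ , e≢0 , trans (cong (λ k → at 0 (at [] (r ∷ rs) k) (j′ ∸ 1)) (ℕ.n∸n≡0 i)) at≡e
∈-monoEntries⁻ i (r ∷ rs) {i′} {j′} t∈ | inj₂ t∈rs with ∈-monoEntries⁻ (suc i) rs t∈rs
...   | i<i′ , 1≤j′ , e≢0 , at≡e =
  ℕ.<⇒≤ i<i′ , 1≤j′ , e≢0 , trans (cong (λ k → at 0 (at [] (r ∷ rs) k) (j′ ∸ 1)) (∸-suc i<i′)) at≡e

∈-monoEntries⁺ : ∀ i μ {i′ j′ e} → i ≤ i′ → 1 ≤ j′ → e ≢ 0 → at 0 (at [] μ (i′ ∸ i)) (j′ ∸ 1) ≡ e →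
  (i′ , j′ , e) ∈ monoEntries i μ
∈-monoEntries⁺ i []       _    _    e≢0 at≡e = ⊥-elim (e≢0 (sym at≡e))
∈-monoEntries⁺ i (r ∷ rs) {i′} {j′} i≤i′ 1≤j′ e≢0 at≡e with ℕ.m≤n⇒m<n∨m≡n i≤i′
... | inj₂ refl = ∈.∈-++⁺ˡ (∈-rowEntries⁺ i 1 r 1≤j′ e≢0
                    (trans (sym (cong (λ k → at 0 (at [] (r ∷ rs) k) (j′ ∸ 1)) (ℕ.n∸n≡0 i))) at≡e))
... | inj₁ i<i′ = ∈.∈-++⁺ʳ (rowEntries i 1 r) (∈-monoEntries⁺ (suc i) rs i<i′ 1≤j′ e≢0
                    (trans (sym (cong (λ k → at 0 (at [] (r ∷ rs) k) (j′ ∸ 1)) (∸-suc i<i′))) at≡e))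

∈-entries⁻ : ∀ μ {i j e} → (i , j , e) ∈ entries μ → (1 ≤ i) × (1 ≤ j) × (e ≢ 0) × (expo μ i j ≡ e)
∈-entries⁻ μ = ∈-monoEntries⁻ 1 μ

∈-entries⁺ : ∀ μ {i j e} → 1 ≤ i → 1 ≤ j → e ≢ 0 → expo μ i j ≡ e → (i , j , e) ∈ entries μ
∈-entries⁺ μ = ∈-monoEntries⁺ 1 μ

entries-≠var : (μ : Mono) → AllPairs _≠var_ (entries μ)
entries-≠var μ = AllPairs-map⁻ (monoVars-unique 1 μ)
  where
  rowVars-unique : ∀ i j r → Unique (map entryVar (rowEntries i j r))
  rowVars-unique i j []           = []
  rowVars-unique i j (zero ∷ es)  = rowVars-unique i (suc j) es
  rowVars-unique i j (suc e ∷ es) =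
    All-map⁺ (All.tabulate (λ { {_ , _ , _} t∈ eq → ℕ.<⇒≢ (proj₁ (proj₂ (∈-rowEntries⁻ i (suc j) es t∈))) (cong proj₂ eq) }))
      ∷ rowVars-unique i (suc j) es
  monoVars-unique : ∀ i μ → Unique (map entryVar (monoEntries i μ))
  monoVars-unique i []       = []
  monoVars-unique i (r ∷ rs) rewrite List.map-++ entryVar (rowEntries i 1 r) (monoEntries (suc i) rs) =
    Unique.++⁺ (rowVars-unique i 1 r) (monoVars-unique (suc i) rs) (λ (k∈r , k∈rs) → different-rows k∈r k∈rs)
    where
    different-rows : ∀ {k} → k ∈ map entryVar (rowEntries i 1 r) → k ∈ map entryVar (monoEntries (suc i) rs) → ⊥
    different-rows k∈r k∈rs with ∈.∈-map⁻ entryVar k∈r | ∈.∈-map⁻ entryVar k∈rs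
    ... | (_ , _ , _) , t∈r , refl | (_ , _ , _) , t∈rs , eq =
      ℕ.<⇒≢ (subst (i <_) (cong proj₁ (sym eq)) (proj₁ (∈-monoEntries⁻ (suc i) rs t∈rs))) (sym (proj₁ (∈-rowEntries⁻ i 1 r t∈r)))

size-entryStacks : (μ : Mono) → size (entryStacks μ) ≡ degree μ
size-entryStacks μ = trans (∑ℕ-map (λ s → deg s *ℕ mult s) entryStack (entries μ)) (mono 1 μ)
  where
  row : ∀ i j r → ∑ℕ (λ t → proj₁ t *ℕ entryExp t) (rowEntries i j r) ≡ i *ℕ sumℕ r
  row i j []           = sym (ℕ.*-zeroʳ i)
  row i j (zero ∷ es)  = row i (suc j) es
  row i j (suc e ∷ es) = trans (cong (i *ℕ suc e +ℕ_) (row i (suc j) es)) (sym (ℕ.*-distribˡ-+ i (suc e) (sumℕ es)))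
  mono : ∀ i μ → ∑ℕ (λ t → proj₁ t *ℕ entryExp t) (monoEntries i μ) ≡ degreeFrom i μ
  mono i []       = refl
  mono i (r ∷ rs) = trans (∑ℕ-++ _ (rowEntries i 1 r) (monoEntries (suc i) rs)) (cong₂ _+ℕ_ (row i 1 r) (mono (suc i) rs))

∏-entries : (φ : ℕ → ℤ) → φ 0 ≡ 1ℤ → (μ : Mono) → ∏ (φ ∘ entryExp) (entries μ) ≡ expProd φ μ
∏-entries φ φ0≡1 = mono 1
  where
  row : ∀ i j r → ∏ (φ ∘ entryExp) (rowEntries i j r) ≡ ∏ φ r
  row i j []           = refl
  row i j (zero ∷ es)  = trans (row i (suc j) es) (sym (trans (cong (_* ∏ φ es) φ0≡1) (ℤ.*-identityˡ _)))
  row i j (suc e ∷ es) = cong (φ (suc e) *_) (row i (suc j) es)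
  mono : ∀ i μ → ∏ (φ ∘ entryExp) (monoEntries i μ) ≡ expProd φ μ
  mono i []       = refl
  mono i (r ∷ rs) = trans (∏-++ _ (rowEntries i 1 r) (monoEntries (suc i) rs)) (cong₂ _*_ (row i 1 r) (mono (suc i) rs))

expo≢0⇒bounded : ∀ μ i j → 1 ≤ i → 1 ≤ j → expo μ i j ≢ 0 → (i ≤ length μ) × (j ≤ rowBound μ)
expo≢0⇒bounded μ (suc i) (suc j) _ _ ≢0 = row-index μ i j ≢0 , ℕ.≤-trans (column-index (at [] μ i) j ≢0) (row-length μ i)
  where
  column-index : ∀ (r : List ℕ) k → at 0 r k ≢ 0 → k < length r
  column-index []      k       ≢0′ = ⊥-elim (≢0′ refl)
  column-index (x ∷ r) zero    _   = s≤s z≤n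
  column-index (x ∷ r) (suc k) ≢0′ = s≤s (column-index r k ≢0′)
  row-index : ∀ (μ : Mono) k l → at 0 (at [] μ k) l ≢ 0 → k < length μ
  row-index []      k       l ≢0′ = ⊥-elim (≢0′ refl)
  row-index (r ∷ μ) zero    l _   = s≤s z≤n
  row-index (r ∷ μ) (suc k) l ≢0′ = s≤s (row-index μ k l ≢0′)
  row-length : ∀ (μ : Mono) k → length (at [] μ k) ≤ rowBound μ
  row-length []      k       = z≤n
  row-length (r ∷ μ) zero    = ℕ.m≤m⊔n (length r) (rowBound μ)
  row-length (r ∷ μ) (suc k) = ℕ.≤-trans (row-length μ k) (ℕ.m≤n⊔m (length r) (rowBound μ))

Mᵇ : StackPartition → Mono → Bool
Mᵇ τ μ = any (λ α → admissible τ α ∧ produces τ α μ) (tuples (length τ) (range1 (rowBound μ)))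

M≡𝟙 : (τ : StackPartition) (μ : Mono) → M τ μ ≡ 𝟙 (Mᵇ τ μ)
M≡𝟙 τ μ with Mᵇ τ μ
... | true  = refl
... | false = refl

≠var-∈ : {ts : List Entry} → AllPairs _≠var_ ts → ∀ {t u : Entry} → t ∈ ts → u ∈ ts → t ≢ u → t ≠var u
≠var-∈ ≠ts {t} {u} t∈ u∈ t≢u with ∈.∈-AllPairs₂ ≠ts t∈ u∈
... | inj₁ t≡u        = ⊥-elim (t≢u t≡u)
... | inj₂ (inj₁ t≠u) = t≠u
... | inj₂ (inj₂ u≠t) = ≠var-sym {u} {t} u≠t

expAt-var : ∀ i j t → entryVar t ≡ (i , j) → expAt i j t ≡ entryExp t
expAt-var i j (i , j , e) refl rewrite ≡⇒≡ᵇ {i} refl | ≡⇒≡ᵇ {j} refl = refl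

expAt-other : ∀ i j t → entryVar t ≢ (i , j) → expAt i j t ≡ 0
expAt-other i j (i′ , j′ , e) ≢ij with i′ ≡ᵇ i in i′≡i | j′ ≡ᵇ j in j′≡j
... | true  | true  = ⊥-elim (≢ij (cong₂ _,_ (≡ᵇ⇒≡ _ _ i′≡i) (≡ᵇ⇒≡ _ _ j′≡j)))
... | true  | false = refl
... | false | _     = refl

∑-expAt-∈ : (ts : List Entry) (i j : ℕ) {t : Entry} → AllPairs _≠var_ ts → t ∈ ts → entryVar t ≡ (i , j) →
  ∑ℕ (expAt i j) ts ≡ entryExp t
∑-expAt-∈ ts i j {t} ≠ts t∈ t-ij =
  trans (∑ℕ-single (expAt i j) (≠var⇒Unique ≠ts) t∈
          (λ u u∈ u≢t → expAt-other i j u (λ u-ij → ≠var-∈ ≠ts u∈ t∈ u≢t (trans u-ij (sym t-ij)))))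
        (expAt-var i j t t-ij)

∑-expAt-entries : (μ : Mono) (i j : ℕ) → 1 ≤ i → 1 ≤ j → ∑ℕ (expAt i j) (entries μ) ≡ expo μ i j
∑-expAt-entries μ i j 1≤i 1≤j with expo μ i j ℕ.≟ 0
... | no  ≢0 = ∑-expAt-∈ (entries μ) i j (entries-≠var μ) (∈-entries⁺ μ 1≤i 1≤j ≢0 refl) refl
... | yes ≡0 = trans (∑ℕ-zero (entries μ) (λ t t∈ → expAt-other i j t (absent t t∈))) (sym ≡0)
  where
  absent : ∀ t → t ∈ entries μ → entryVar t ≢ (i , j)
  absent (_ , _ , _) t∈ refl with ∈-entries⁻ μ t∈
  ... | _ , _ , e≢0 , expo≡e = e≢0 (trans (sym expo≡e) ≡0)

module Witness (τ : StackPartition) (μ : Mono) (α : List ℕ) (pos : All PositiveStack τ)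
               (α∈ : All (_∈ range1 (rowBound μ)) α) (≠vars : AllPairs _≠var_ (zipEntries τ α))
               (exps : ∀ i j → Bounded τ μ i j → expo μ i j ≡ stackExpo τ α i j) where

  expo≡∑ : ∀ i j → Bounded τ μ i j → expo μ i j ≡ ∑ℕ (expAt i j) (zipEntries τ α)
  expo≡∑ i j b = trans (exps i j b) (stackExpo≡∑ τ α i j)

  zipEntries⊆entries : ∀ {t} → t ∈ zipEntries τ α → t ∈ entries μ
  zipEntries⊆entries t∈ with ∈.∈-map⁻ toEntry t∈
  ... | ((d , m) , a) , p∈ , refl with ∈-zipStacks⁻ {τ} {α} p∈
  ...   | s∈ , a∈ with All.lookup pos s∈ | ∈-range1⁻ (All.lookup α∈ a∈)
  ...     | 1≤d , 1≤m | 1≤a , a≤ =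
    ∈-entries⁺ μ 1≤d 1≤a (ℕ.<⇒≢ 1≤m ∘ sym)
      (trans (expo≡∑ d a (1≤d , ℕ.≤-trans (deg≤maxDeg τ s∈) (ℕ.m≤n⊔m (length μ) (maxDeg τ)) , 1≤a , a≤))
             (∑-expAt-∈ (zipEntries τ α) d a ≠vars t∈ refl))
    where
    deg≤maxDeg : ∀ τ {s} → s ∈ τ → deg s ≤ maxDeg τ
    deg≤maxDeg (t ∷ τ) (here refl) = ℕ.m≤m⊔n (deg t) (maxDeg τ)
    deg≤maxDeg (t ∷ τ) (there s∈)  = ℕ.≤-trans (deg≤maxDeg τ s∈) (ℕ.m≤n⊔m (deg t) (maxDeg τ))

  entries⊆zipEntries : ∀ {t} → t ∈ entries μ → t ∈ zipEntries τ α
  entries⊆zipEntries {i , j , e} t∈ with ∈-entries⁻ μ t∈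
  ... | 1≤i , 1≤j , e≢0 , expo≡e with expo≢0⇒bounded μ i j 1≤i 1≤j (e≢0 ∘ trans (sym expo≡e))
  ...   | i≤ , j≤ with trans (sym expo≡e) (expo≡∑ i j (1≤i , ℕ.≤-trans i≤ (ℕ.m≤m⊔n (length μ) (maxDeg τ)) , 1≤j , j≤))
  ...     | e≡∑ with ∑ℕ-≢0 ℕ._≟_ (expAt i j) (zipEntries τ α) (e≢0 ∘ trans e≡∑)
  ...       | u , u∈ , u≢0 with ≡-dec ℕ._≟_ ℕ._≟_ (entryVar u) (i , j)
  ...         | no  u≢ij = ⊥-elim (u≢0 (expAt-other i j u u≢ij))
  ...         | yes u-ij = subst (_∈ zipEntries τ α) (entry-≡ u u-ij (sym (trans e≡∑ (∑-expAt-∈ _ i j ≠vars u∈ u-ij)))) u∈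
    where
    entry-≡ : ∀ u → entryVar u ≡ (i , j) → entryExp u ≡ e → u ≡ (i , j , e)
    entry-≡ (i , j , e) refl refl = refl

  zipEntries↭entries : zipEntries τ α ↭ entries μ
  zipEntries↭entries =
    ∼bag⇒↭ (unique∧set⇒bag (≠var⇒Unique ≠vars) (≠var⇒Unique (entries-≠var μ)) (mk⇔ zipEntries⊆entries entries⊆zipEntries))

M-sound : (τ : StackPartition) (μ : Mono) → All PositiveStack τ → Mᵇ τ μ ≡ true → entryStacks μ ↭ τ
M-sound τ μ pos h with any-sound (λ α → admissible τ α ∧ produces τ α μ) (tuples (length τ) (range1 (rowBound μ))) h
... | α , α∈ , adm∧prod with ∧-true (admissible τ α) (produces τ α μ) adm∧prod | ∈-tuples⁻ (length τ) (range1 (rowBound μ)) α∈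
...   | adm , prod | len , α⊆ =
  subst (entryStacks μ ↭_) (zipEntries-stacks τ α len)
    (↭.map⁺ entryStack (↭-sym (Witness.zipEntries↭entries τ μ α pos α⊆ (admissible-sound τ α adm) (produces-sound τ α μ prod))))

M-complete : (ts : List Entry) (μ : Mono) → ts ↭ entries μ → Mᵇ (map entryStack ts) μ ≡ true
M-complete ts μ ts↭ =
  any-complete (λ α → admissible τ α ∧ produces τ α μ) indices∈ (cong₂ _∧_ adm prod)
  where
  τ : StackPartition
  τ = map entryStack ts
  zip≡ts : zipEntries τ (map entryIndex ts) ≡ ts
  zip≡ts = zipEntries-entries ts
  indices⊆ : All (_∈ range1 (rowBound μ)) (map entryIndex ts)
  indices⊆ = All-map⁺ (All.tabulate (λ { {i , j , e} t∈ → index∈ (∈-entries⁻ μ (↭.∈-resp-↭ ts↭ t∈)) }))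
    where
    index∈ : ∀ {i j e} → (1 ≤ i) × (1 ≤ j) × (e ≢ 0) × (expo μ i j ≡ e) → j ∈ range1 (rowBound μ)
    index∈ {i} {j} (1≤i , 1≤j , e≢0 , expo≡e) = ∈-range1⁺ 1≤j (proj₂ (expo≢0⇒bounded μ i j 1≤i 1≤j (e≢0 ∘ trans (sym expo≡e))))
  indices∈ : map entryIndex ts ∈ tuples (length τ) (range1 (rowBound μ))
  indices∈ = subst (λ k → map entryIndex ts ∈ tuples k (range1 (rowBound μ)))
                   (trans (List.length-map entryIndex ts) (sym (List.length-map entryStack ts)))
                   (∈-tuples⁺ (range1 (rowBound μ)) indices⊆)
  adm : admissible τ (map entryIndex ts) ≡ true
  adm = admissible-complete τ (map entryIndex ts)
          (subst (AllPairs _≠var_) (sym zip≡ts) (AllPairs-resp-↭ (λ {t} {u} → ≠var-sym {t} {u}) (↭-sym ts↭) (entries-≠var μ)))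
  prod : produces τ (map entryIndex ts) μ ≡ true
  prod = produces-complete τ (map entryIndex ts) μ (λ i j (1≤i , _ , 1≤j , _) →
    sym (trans (stackExpo≡∑ τ (map entryIndex ts) i j)
        (trans (cong (∑ℕ (expAt i j)) zip≡ts)
        (trans (∑ℕ-↭ (expAt i j) ts↭) (∑-expAt-entries μ i j 1≤i 1≤j)))))

shape : Mono → StackPartition
shape μ = sortByDegree (entryStacks μ)

module Shape (μ : Mono) where

  entryStacks↭shape : entryStacks μ ↭ shape μ
  entryStacks↭shape = ↭-sym (SortByDegree.sort-↭ (entryStacks μ))

  shape-positive : All PositiveStack (shape μ)
  shape-positive = ↭.All-resp-↭ entryStacks↭shape (All-map⁺ (All.tabulate positive))
    where
    positive : ∀ {t} → t ∈ entries μ → PositiveStack (entryStack t)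
    positive {i , j , e} t∈ with ∈-entries⁻ μ t∈
    ... | 1≤i , _ , e≢0 , _ = 1≤i , ℕ.n≢0⇒n>0 e≢0

  size-shape : size (shape μ) ≡ degree μ
  size-shape = trans (∑ℕ-↭ (λ s → deg s *ℕ mult s) (↭-sym entryStacks↭shape)) (size-entryStacks μ)

  M-shape : Mᵇ (shape μ) μ ≡ true
  M-shape with ↭.↭-map-inv entryStack entryStacks↭shape
  ... | ts , shape≡ , ts↭ = subst (λ τ → Mᵇ τ μ ≡ true) (sym shape≡) (M-complete ts μ (↭-sym ts↭))

  M-size : ∀ τ → All PositiveStack τ → Mᵇ τ μ ≡ true → size τ ≡ degree μ
  M-size τ pos h = trans (∑ℕ-↭ (λ s → deg s *ℕ mult s) (↭-sym (M-sound τ μ pos h))) (size-entryStacks μ)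

  M-unique : ∀ τ → All PositiveStack τ → SortedByDegree τ → Mᵇ τ μ ≡ true → τ ≡ shape μ
  M-unique τ pos sorted h =
    sym (sortedByDegree-unique (SortByDegree.sort-↗ (entryStacks μ)) sorted (↭-trans (↭-sym entryStacks↭shape) (M-sound τ μ pos h)))

  ∑-stackPartitions-M : (w : StackPartition → ℤ) (d : ℕ) →
    ∑ (λ τ → w τ * M τ μ) (stackPartitions d) ≡ 𝟙 (degree μ ≡ᵇ d) * w (shape μ)
  ∑-stackPartitions-M w d with degree μ ℕ.≟ d
  ... | yes refl rewrite ≡⇒≡ᵇ {degree μ} refl = begin
    ∑ (λ τ → w τ * M τ μ) (stackPartitions (degree μ))
      ≡⟨ ∑-single (λ τ → w τ * M τ μ) (stackPartitions-unique (degree μ))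
           (∈-stackPartitions⁺ (degree μ) (shape-positive , size-shape , SortByDegree.sort-↗ (entryStacks μ)))
           (λ τ τ∈ τ≢shape → trans (cong (w τ *_) (M-other τ τ∈ τ≢shape)) (ℤ.*-zeroʳ (w τ))) ⟩
    w (shape μ) * M (shape μ) μ
      ≡⟨ cong (w (shape μ) *_) (trans (M≡𝟙 (shape μ) μ) (cong 𝟙 M-shape)) ⟩
    w (shape μ) * 1ℤ
      ≡⟨ trans (ℤ.*-identityʳ _) (sym (ℤ.*-identityˡ _)) ⟩
    1ℤ * w (shape μ) ∎
    where
    open ≡-Reasoning
    M-other : ∀ τ → τ ∈ stackPartitions (degree μ) → τ ≢ shape μ → M τ μ ≡ 0ℤ
    M-other τ τ∈ τ≢shape with Mᵇ τ μ in h
    ... | false = refl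
    ... | true with ∈-stackPartitions⁻ (degree μ) τ∈
    ...   | pos , _ , sorted = ⊥-elim (τ≢shape (M-unique τ pos sorted h))
  ... | no degree≢d rewrite ≢⇒≡ᵇ-false degree≢d =
    ∑-zero (stackPartitions d) (λ τ τ∈ → trans (cong (w τ *_) (M-zero τ τ∈)) (ℤ.*-zeroʳ (w τ)))
    where
    M-zero : ∀ τ → τ ∈ stackPartitions d → M τ μ ≡ 0ℤ
    M-zero τ τ∈ with Mᵇ τ μ in h
    ... | false = refl
    ... | true with ∈-stackPartitions⁻ d τ∈
    ...   | pos , size≡d , _ = ⊥-elim (degree≢d (trans (sym (M-size τ pos h)) size≡d))

  ∑-stackPartitions-M-∏ : (w : StackPartition → ℤ) (φ : ℕ → ℤ) → φ 0 ≡ 1ℤ →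
    (∀ τ → All PositiveStack τ → w τ ≡ ∏ (φ ∘ mult) τ) →
    (d : ℕ) → ∑ (λ τ → w τ * M τ μ) (stackPartitions d) ≡ prodSeries d φ μ
  ∑-stackPartitions-M-∏ w φ φ0≡1 w≡∏ d =
    trans (∑-stackPartitions-M w d) (cong (𝟙 (degree μ ≡ᵇ d) *_) (begin
      w (shape μ)                       ≡⟨ w≡∏ (shape μ) shape-positive ⟩
      ∏ (φ ∘ mult) (shape μ)            ≡⟨ ∏-↭ (φ ∘ mult) (↭-sym entryStacks↭shape) ⟩
      ∏ (φ ∘ mult) (entryStacks μ)      ≡⟨ ∏-map (φ ∘ mult) entryStack (entries μ) ⟩
      ∏ (φ ∘ entryExp) (entries μ)      ≡⟨ ∏-entries φ φ0≡1 μ ⟩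
      expProd φ μ                       ∎))
    where open ≡-Reasoning

open Shape using (∑-stackPartitions-M-∏)

[1-x]⁻¹ : ℕ → ℤ
[1-x]⁻¹ _ = 1ℤ

[1+x]⁻¹ : ℕ → ℤ
[1+x]⁻¹ e = -1ℤ ^ e

[1-x] : ℕ → ℤ
[1-x] zero          = 1ℤ
[1-x] (suc zero)    = -1ℤ
[1-x] (suc (suc _)) = 0ℤ

[1+x] : ℕ → ℤ
[1+x] zero          = 1ℤ
[1+x] (suc zero)    = 1ℤ
[1+x] (suc (suc _)) = 0ℤ

H≋prodSeries : (d : ℕ) → H d ≋ prodSeries d [1-x]⁻¹
H≋prodSeries d μ =
  trans (∑-map (λ g → g μ) M (stackPartitions d))
  (trans (∑-ext (stackPartitions d) (λ τ → sym (ℤ.*-identityˡ (M τ μ))))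
         (∑-stackPartitions-M-∏ μ (λ _ → 1ℤ) [1-x]⁻¹ refl weight d))
  where
  weight : ∀ τ → All PositiveStack τ → 1ℤ ≡ ∏ ([1-x]⁻¹ ∘ mult) τ
  weight []      _         = refl
  weight (s ∷ τ) (_ ∷ pos) = trans (weight τ pos) (sym (ℤ.*-identityˡ _))

H⁺≋prodSeries : (d : ℕ) → H⁺ d ≋ prodSeries d [1+x]⁻¹
H⁺≋prodSeries d μ =
  trans (∑-map (λ g → g μ) (λ α → (-1ℤ ^ area α) ·S M α) (stackPartitions d))
        (∑-stackPartitions-M-∏ μ (λ τ → -1ℤ ^ area τ) [1+x]⁻¹ refl weight d)
  where
  weight : ∀ τ → All PositiveStack τ → -1ℤ ^ area τ ≡ ∏ ([1+x]⁻¹ ∘ mult) τ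
  weight []      _         = refl
  weight (s ∷ τ) (_ ∷ pos) = trans (ℤ.^-distribˡ-+-* -1ℤ (mult s) (area τ)) (cong (-1ℤ ^ mult s *_) (weight τ pos))

E⁺≋prodSeries : (d : ℕ) → E⁺ d ≋ prodSeries d [1+x]
E⁺≋prodSeries d μ =
  trans (∑-map (λ g → g μ) M (partitions d))
  (trans (∑-filterᵇ (λ τ → M τ μ) isOrdinary (stackPartitions d))
         (∑-stackPartitions-M-∏ μ (λ τ → 𝟙 (isOrdinary τ)) [1+x] refl weight d))
  where
  ordinary : ∀ m → 1 ≤ m → 𝟙 (m ≡ᵇ 1) ≡ [1+x] m
  ordinary (suc zero)    _ = refl
  ordinary (suc (suc m)) _ = refl
  weight : ∀ τ → All PositiveStack τ → 𝟙 (isOrdinary τ) ≡ ∏ ([1+x] ∘ mult) τ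
  weight []      _                 = refl
  weight (s ∷ τ) ((_ , 1≤m) ∷ pos) =
    trans (𝟙-∧ (mult s ≡ᵇ 1) (isOrdinary τ)) (cong₂ _*_ (ordinary (mult s) 1≤m) (weight τ pos))

E≋prodSeries : (d : ℕ) → E d ≋ prodSeries d [1-x]
E≋prodSeries d μ =
  trans (∑-map (λ g → g μ) (λ α → (-1ℤ ^ ℓ α) ·S M α) (partitions d))
  (trans (∑-filterᵇ (λ α → (-1ℤ ^ ℓ α) * M α μ) isOrdinary (stackPartitions d))
  (trans (∑-ext (stackPartitions d) (λ α → sym (ℤ.*-assoc (𝟙 (isOrdinary α)) (-1ℤ ^ ℓ α) (M α μ))))
         (∑-stackPartitions-M-∏ μ (λ τ → 𝟙 (isOrdinary τ) * (-1ℤ ^ ℓ τ)) [1-x] refl weight d)))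
  where
  open +-*-Solver
  ordinary : ∀ m → 1 ≤ m → 𝟙 (m ≡ᵇ 1) * -1ℤ ≡ [1-x] m
  ordinary (suc zero)    _ = refl
  ordinary (suc (suc m)) _ = refl
  weight : ∀ τ → All PositiveStack τ → 𝟙 (isOrdinary τ) * (-1ℤ ^ ℓ τ) ≡ ∏ ([1-x] ∘ mult) τ
  weight []      _                 = refl
  weight (s ∷ τ) ((_ , 1≤m) ∷ pos) = begin
    𝟙 ((mult s ≡ᵇ 1) ∧ isOrdinary τ) * (-1ℤ * -1ℤ ^ length τ)
      ≡⟨ cong (_* (-1ℤ * -1ℤ ^ length τ)) (𝟙-∧ (mult s ≡ᵇ 1) (isOrdinary τ)) ⟩
    (𝟙 (mult s ≡ᵇ 1) * 𝟙 (isOrdinary τ)) * (-1ℤ * -1ℤ ^ length τ)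
      ≡⟨ solve 3 (λ a b c → (a :* b) :* (con -1ℤ :* c) := (a :* con -1ℤ) :* (b :* c)) refl
           (𝟙 (mult s ≡ᵇ 1)) (𝟙 (isOrdinary τ)) (-1ℤ ^ length τ) ⟩
    (𝟙 (mult s ≡ᵇ 1) * -1ℤ) * (𝟙 (isOrdinary τ) * -1ℤ ^ length τ)
      ≡⟨ cong₂ _*_ (ordinary (mult s) 1≤m) (weight τ pos) ⟩
    ∏ ([1-x] ∘ mult) (s ∷ τ) ∎
    where open ≡-Reasoning

-- Distinct dyadic multiplicities

P≤2P : (P : ℕ) → P ≤ 2 *ℕ P
P≤2P P = ℕ.m≤m+n P (P +ℕ 0)

P<2P : (P : ℕ) → 1 ≤ P → P < 2 *ℕ P
P<2P P 1≤P = subst (P <_) (cong (P +ℕ_) (sym (ℕ.+-identityʳ P))) (ℕ.m<m+n P 1≤P)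

multiplesUpTo : ℕ → ℕ → List ℕ
multiplesUpTo n P = filterᵇ (λ c → c *ℕ P ≤ᵇ n) (upTo (suc n))

multiplesUpTo-unique : (n P : ℕ) → Unique (multiplesUpTo n P)
multiplesUpTo-unique n P = filterᵇ-unique (λ c → c *ℕ P ≤ᵇ n) (upTo-unique (suc n))

∈-multiplesUpTo⁻ : {n P c : ℕ} → c ∈ multiplesUpTo n P → c *ℕ P ≤ n
∈-multiplesUpTo⁻ {n} {P} {c} c∈ = ≤ᵇ⇒≤ (c *ℕ P) n (proj₂ (∈-filterᵇ⁻ (λ c → c *ℕ P ≤ᵇ n) {upTo (suc n)} c∈))

∈-multiplesUpTo⁺ : {n P c : ℕ} → 1 ≤ P → c *ℕ P ≤ n → c ∈ multiplesUpTo n P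
∈-multiplesUpTo⁺ {n} {P} {c} 1≤P cP≤n =
  ∈-filterᵇ⁺ (λ c → c *ℕ P ≤ᵇ n) (∈.∈-upTo⁺ (s≤s (ℕ.≤-trans (ℕ.m≤m*n c P {{>-nonZero 1≤P}}) cP≤n))) (≤⇒≤ᵇ cP≤n)

cons⁺ : ℕ → ℕ → StackPartition → StackPartition
cons⁺ zero    P v = v
cons⁺ (suc c) P v = (suc c , P) ∷ v

-- The stack partitions of n with distinct multiplicities among P, 2P, …, 2^(K-1) P,
-- listed with increasing multiplicities.
dyadicPartitions : ℕ → ℕ → ℕ → List StackPartition
dyadicPartitions zero    P n = if n ≡ᵇ 0 then [] ∷ [] else []
dyadicPartitions (suc K) P n =
  concatMap (λ c → map (cons⁺ c P) (dyadicPartitions K (2 *ℕ P) (n ∸ c *ℕ P))) (multiplesUpTo n P)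

-- The coefficients of ∏_{k<K} φ(x^(Q 2^k)).
dyadicProduct : (ℕ → ℤ) → ℕ → ℕ → ℕ → ℤ
dyadicProduct φ zero    Q = δ 0
dyadicProduct φ (suc K) Q = dilate Q φ ∗ dyadicProduct φ K (2 *ℕ Q)

ΣS-concatMap : (Φ : B → Series) (g : A → List B) (xs : List A) →
  ΣS (map Φ (concatMap g xs)) ≋ ΣS (map (λ a → ΣS (map Φ (g a))) xs)
ΣS-concatMap Φ g xs μ =
  trans (∑-map (λ f → f μ) Φ (concatMap g xs))
  (trans (∑-concatMap (λ v → Φ v μ) g xs)
  (trans (∑-ext xs (λ a → sym (∑-map (λ f → f μ) Φ (g a))))
         (sym (∑-map (λ f → f μ) (λ a → ΣS (map Φ (g a))) xs))))

ΣS-cong : {Φ Ψ : A → Series} (xs : List A) → (∀ a → Φ a ≋ Ψ a) → ΣS (map Φ xs) ≋ ΣS (map Ψ xs)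
ΣS-cong {Φ = Φ} {Ψ} xs Φ≋Ψ μ =
  trans (∑-map (λ f → f μ) Φ xs) (trans (∑-ext xs (λ a → Φ≋Ψ a μ)) (sym (∑-map (λ f → f μ) Ψ xs)))

ΣS-map : (Φ : B → Series) (g : A → B) (xs : List A) → ΣS (map Φ (map g xs)) ≋ ΣS (map (Φ ∘ g) xs)
ΣS-map Φ g xs μ =
  trans (∑-map (λ f → f μ) Φ (map g xs)) (trans (∑-map (λ v → Φ v μ) g xs) (sym (∑-map (λ f → f μ) (Φ ∘ g) xs)))

module DyadicSum (F : ℕ → Series) (φ : ℕ → ℤ) (φ0≡1 : φ 0 ≡ 1ℤ) (F≋ : ∀ c → F c ≋ prodSeries c φ)
                 (m : ℕ) (1≤m : 1 ≤ m) where

  Φ : StackPartition → Series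
  Φ v = F at-part (m ·τ v)

  Φ-cons⁺ : (c P : ℕ) → 1 ≤ P → (v : StackPartition) →
    Φ (cons⁺ c P v) ≋ prodSeries (c *ℕ (m *ℕ P)) (dilate (m *ℕ P) φ) ⊛ Φ v
  Φ-cons⁺ zero    P 1≤P v = ≋-sym (≋-trans (⊛-cong (prodSeries-zero (dilate (m *ℕ P) φ) (dilate-0 (m *ℕ P) φ φ0≡1)) ≋-refl)
                                           (⊛-identityˡ (Φ v)))
  Φ-cons⁺ (suc c) P 1≤P v = ⊛-cong (≋-trans (subst^-cong (m *ℕ P) (F≋ (suc c)))
                                             (subst^-prodSeries (m *ℕ P) (ℕ.*-mono-≤ 1≤m 1≤P) (suc c) φ)) ≋-refl

  ΣS-cons⁺ : (c P : ℕ) → 1 ≤ P → (vs : List StackPartition) →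
    ΣS (map Φ (map (cons⁺ c P) vs)) ≋ prodSeries (c *ℕ (m *ℕ P)) (dilate (m *ℕ P) φ) ⊛ ΣS (map Φ vs)
  ΣS-cons⁺ c P 1≤P vs = begin
    ΣS (map Φ (map (cons⁺ c P) vs))         ≈⟨ ΣS-map Φ (cons⁺ c P) vs ⟩
    ΣS (map (Φ ∘ cons⁺ c P) vs)             ≈⟨ ΣS-cong vs (Φ-cons⁺ c P 1≤P) ⟩
    ΣS (map (λ v → stack ⊛ Φ v) vs)         ≈⟨ ≋-sym (ΣS-map (stack ⊛_) Φ vs) ⟩
    ΣS (map (stack ⊛_) (map Φ vs))          ≈⟨ ≋-sym (⊛-distribˡ-ΣS stack (map Φ vs)) ⟩
    stack ⊛ ΣS (map Φ vs)                   ∎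
    where
    open ≋-Reasoning
    stack : Series
    stack = prodSeries (c *ℕ (m *ℕ P)) (dilate (m *ℕ P) φ)

  ΣS-dyadicPartitions : ∀ K P n → 1 ≤ P → ΣS (map Φ (dyadicPartitions K P n)) ≋ prodSeries (n *ℕ m) (dyadicProduct φ K (m *ℕ P))
  ΣS-dyadicPartitions zero    P zero    _ μ = trans (ℤ.+-identityʳ _) (sym (prodSeries-zero (δ 0) refl μ))
  ΣS-dyadicPartitions zero    P (suc n) _ μ =
    sym (prodSeries-δ0 (suc n *ℕ m) (λ n*m≡0 → ℕ.<⇒≢ 1≤m (sym (ℕ.m+n≡0⇒m≡0 m n*m≡0))) μ)
  ΣS-dyadicPartitions (suc K) P n 1≤P = begin
    ΣS (map Φ (dyadicPartitions (suc K) P n))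
      ≈⟨ ΣS-concatMap Φ (λ c → map (cons⁺ c P) (rest c)) (multiplesUpTo n P) ⟩
    ΣS (map (λ c → ΣS (map Φ (map (cons⁺ c P) (rest c)))) (multiplesUpTo n P))
      ≈⟨ ΣS-cong (multiplesUpTo n P) (λ c → ≋-trans (ΣS-cons⁺ c P 1≤P (rest c))
           (⊛-cong (≋-refl {prodSeries (c *ℕ Q) (dilate Q φ)})
                   (≋-trans (ΣS-dyadicPartitions K (2 *ℕ P) (n ∸ c *ℕ P) (ℕ.≤-trans 1≤P (P≤2P P))) (remaining c)))) ⟩
    ΣS (map (λ c → prodSeries (c *ℕ Q) (dilate Q φ) ⊛ prodSeries (n *ℕ m ∸ c *ℕ Q) (dyadicProduct φ K (2 *ℕ Q))) (multiplesUpTo n P))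
      ≈⟨ ΣS-prodSeries-⊛ Q 1≤Q (n *ℕ m) (dilate Q φ) (dyadicProduct φ K (2 *ℕ Q)) (dilate-∣ Q φ)
           (multiplesUpTo n P) (multiplesUpTo-unique n P) c∈⇒ ⇒c∈ ⟩
    prodSeries (n *ℕ m) (dyadicProduct φ (suc K) (m *ℕ P)) ∎
    where
    open ≋-Reasoning
    open ℕ-Solver
    Q : ℕ
    Q = m *ℕ P
    1≤Q : 1 ≤ Q
    1≤Q = ℕ.*-mono-≤ 1≤m 1≤P
    rest : ℕ → List StackPartition
    rest c = dyadicPartitions K (2 *ℕ P) (n ∸ c *ℕ P)
    cPm≡cQ : ∀ c → c *ℕ P *ℕ m ≡ c *ℕ Q
    cPm≡cQ c = solve 3 (λ c P m → c :* P :* m := c :* (m :* P)) refl c P m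
    remaining : ∀ c → prodSeries ((n ∸ c *ℕ P) *ℕ m) (dyadicProduct φ K (m *ℕ (2 *ℕ P)))
                    ≋ prodSeries (n *ℕ m ∸ c *ℕ Q) (dyadicProduct φ K (2 *ℕ Q))
    remaining c μ = cong₂ (λ a b → prodSeries a (dyadicProduct φ K b) μ)
      (trans (ℕ.*-distribʳ-∸ m n (c *ℕ P)) (cong (n *ℕ m ∸_) (cPm≡cQ c)))
      (solve 2 (λ m P → m :* (con 2 :* P) := con 2 :* (m :* P)) refl m P)
    c∈⇒ : ∀ c → c ∈ multiplesUpTo n P → c *ℕ Q ≤ n *ℕ m
    c∈⇒ c c∈ = subst (_≤ n *ℕ m) (cPm≡cQ c) (ℕ.*-monoˡ-≤ m (∈-multiplesUpTo⁻ {n} c∈))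
    ⇒c∈ : ∀ c → c *ℕ Q ≤ n *ℕ m → c ∈ multiplesUpTo n P
    ⇒c∈ c cQ≤nm = ∈-multiplesUpTo⁺ 1≤P (ℕ.*-cancelʳ-≤ (c *ℕ P) n m {{>-nonZero 1≤m}} (subst (_≤ n *ℕ m) (sym (cPm≡cQ c)) cQ≤nm))

DyadicMult : ℕ → ℕ → ℕ → Set
DyadicMult zero    P x = ⊥
DyadicMult (suc K) P x = (x ≡ P) ⊎ DyadicMult K (2 *ℕ P) x

DyadicMult-≥ : ∀ K P x → DyadicMult K P x → P ≤ x
DyadicMult-≥ (suc K) P x (inj₁ refl) = ℕ.≤-refl
DyadicMult-≥ (suc K) P x (inj₂ x∈) = ℕ.≤-trans (P≤2P P) (DyadicMult-≥ K (2 *ℕ P) x x∈)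

DyadicMult⇒pow : ∀ K P x → DyadicMult K P x → ∃[ k ] (x ≡ P *ℕ 2 ^ℕ k)
DyadicMult⇒pow (suc K) P x (inj₁ refl) = 0 , sym (ℕ.*-identityʳ P)
DyadicMult⇒pow (suc K) P x (inj₂ x∈) with DyadicMult⇒pow K (2 *ℕ P) x x∈
... | k , x≡ = suc k , trans x≡ (solve 2 (λ P y → con 2 :* P :* y := P :* (con 2 :* y)) refl P (2 ^ℕ k))
  where open ℕ-Solver

pow⇒DyadicMult : ∀ K P x k → x ≡ P *ℕ 2 ^ℕ k → k < K → DyadicMult K P x
pow⇒DyadicMult (suc K) P x zero    x≡ _         = inj₁ (trans x≡ (ℕ.*-identityʳ P))
pow⇒DyadicMult (suc K) P x (suc k) x≡ (s≤s k<K) =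
  inj₂ (pow⇒DyadicMult K (2 *ℕ P) x k (trans x≡ (solve 2 (λ P y → P :* (con 2 :* y) := con 2 :* P :* y) refl P (2 ^ℕ k))) k<K)
  where open ℕ-Solver

DyadicStack : ℕ → ℕ → Stack → Set
DyadicStack K P s = (1 ≤ deg s) × DyadicMult K P (mult s)

narrow : ∀ {K P t} → DyadicStack (suc K) P t → mult t ≢ P → DyadicStack K (2 *ℕ P) t
narrow (1≤d , inj₁ m≡P) m≢P = ⊥-elim (m≢P m≡P)
narrow (1≤d , inj₂ m∈)  _   = 1≤d , m∈

sorted-head-≤ : (s : Stack) (v : StackPartition) → SortedByMultiplicity (s ∷ v) → All (λ t → mult s ≤ mult t) v
sorted-head-≤ s v sorted with Linked⇒AllPairs (λ {x} {y} {z} → DecTotalOrder.trans ByMultiplicity.decTotalOrder {x} {y} {z}) sorted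
... | s≼v ∷ _ = All.map (λ {t} s≼t → multiplicity-≤ (ByMultiplicity.≼⇒LexLe {s} {t} s≼t)) s≼v
  where
  multiplicity-≤ : ∀ {t} → LexLe (mult s , deg s) (mult t , deg t) → mult s ≤ mult t
  multiplicity-≤ (inj₁ ms<mt)        = ℕ.<⇒≤ ms<mt
  multiplicity-≤ (inj₂ (ms≡mt , _)) = ℕ.≤-reflexive ms≡mt

sorted-tail : {s : Stack} {v : StackPartition} → SortedByMultiplicity (s ∷ v) → SortedByMultiplicity v
sorted-tail [-]      = []
sorted-tail (_ ∷ sv) = sv

∈-dyadicPartitions-cons⁺ : ∀ K P c {n v} → 1 ≤ P → v ∈ dyadicPartitions K (2 *ℕ P) n →
  cons⁺ c P v ∈ dyadicPartitions (suc K) P (c *ℕ P +ℕ n)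
∈-dyadicPartitions-cons⁺ K P c {n} {v} 1≤P v∈ =
  ∈-concatMap⁺′ (λ c′ → map (cons⁺ c′ P) (dyadicPartitions K (2 *ℕ P) (c *ℕ P +ℕ n ∸ c′ *ℕ P)))
    (∈-multiplesUpTo⁺ 1≤P (ℕ.m≤m+n (c *ℕ P) n))
    (∈.∈-map⁺ (cons⁺ c P) (subst (λ k → v ∈ dyadicPartitions K (2 *ℕ P) k) (sym (ℕ.m+n∸m≡n (c *ℕ P) n)) v∈))

∈-dyadicPartitions⁺ : ∀ K P v → 1 ≤ P → SortedByMultiplicity v → All (DyadicStack K P) v → DistinctMults v →
  v ∈ dyadicPartitions K P (size v)
∈-dyadicPartitions⁺ zero    P []      _   _      _               _ = here refl
∈-dyadicPartitions⁺ zero    P (s ∷ v) _   _      ((_ , ()) ∷ _)  _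
∈-dyadicPartitions⁺ (suc K) P []      1≤P _      _               _ =
  ∈-dyadicPartitions-cons⁺ K P 0 1≤P (∈-dyadicPartitions⁺ K (2 *ℕ P) [] (ℕ.≤-trans 1≤P (P≤2P P)) [] [] [])
∈-dyadicPartitions⁺ (suc K) P ((suc c , .P) ∷ v) 1≤P sorted ((_ , inj₁ refl) ∷ dyadic) (P∉v ∷ distinct) =
  ∈-dyadicPartitions-cons⁺ K P (suc c) 1≤P
    (∈-dyadicPartitions⁺ K (2 *ℕ P) v (ℕ.≤-trans 1≤P (P≤2P P)) (sorted-tail sorted)
       (All.zipWith (λ (t-dyadic , P≢mt) → narrow t-dyadic (P≢mt ∘ sym)) (dyadic , P∉v)) distinct)
∈-dyadicPartitions⁺ (suc K) P (s ∷ v) 1≤P sorted ((1≤d , inj₂ ms∈) ∷ dyadic) distinct =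
  ∈-dyadicPartitions-cons⁺ K P 0 1≤P
    (∈-dyadicPartitions⁺ K (2 *ℕ P) (s ∷ v) (ℕ.≤-trans 1≤P (P≤2P P)) sorted
       ((1≤d , ms∈) ∷ All.zipWith (λ (t-dyadic , ms≤mt) → narrow t-dyadic (above-P ms≤mt)) (dyadic , sorted-head-≤ s v sorted))
       distinct)
  where
  above-P : ∀ {x} → mult s ≤ x → x ≢ P
  above-P ms≤x refl = ℕ.<⇒≱ (ℕ.<-≤-trans (P<2P P 1≤P) (DyadicMult-≥ K (2 *ℕ P) (mult s) ms∈)) ms≤x

∈-dyadicPartitions⁻ : ∀ K P n v → 1 ≤ P → v ∈ dyadicPartitions K P n →
  SortedByMultiplicity v × All (DyadicStack K P) v × DistinctMults v × (size v ≡ n)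
∈-dyadicPartitions⁻ zero    P zero .[] _ (here refl) = [] , [] , [] , refl
∈-dyadicPartitions⁻ (suc K) P n v 1≤P v∈
  with ∈-concatMap⁻′ (λ c → map (cons⁺ c P) (dyadicPartitions K (2 *ℕ P) (n ∸ c *ℕ P))) (multiplesUpTo n P) v∈
... | c , c∈ , v∈′ with ∈.∈-map⁻ (cons⁺ c P) v∈′
...   | w , w∈ , refl with ∈-dyadicPartitions⁻ K (2 *ℕ P) (n ∸ c *ℕ P) w (ℕ.≤-trans 1≤P (P≤2P P)) w∈
...     | sorted , dyadic , distinct , size≡ = cons c (∈-multiplesUpTo⁻ {n} c∈) size≡
  where
  widen : All (DyadicStack (suc K) P) w
  widen = All.map (λ (1≤d , m∈) → 1≤d , inj₂ m∈) dyadic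
  above-P : All (λ t → P < mult t) w
  above-P = All.map (λ {t} (_ , m∈) → ℕ.<-≤-trans (P<2P P 1≤P) (DyadicMult-≥ K (2 *ℕ P) (mult t) m∈)) dyadic
  cons : ∀ c → c *ℕ P ≤ n → size w ≡ n ∸ c *ℕ P →
    SortedByMultiplicity (cons⁺ c P w) × All (DyadicStack (suc K) P) (cons⁺ c P w) × DistinctMults (cons⁺ c P w) × (size (cons⁺ c P w) ≡ n)
  cons zero    _    size≡′ = sorted , widen , distinct , size≡′
  cons (suc c) cP≤n size≡′ =
    head-sorted above-P sorted , (s≤s z≤n , inj₁ refl) ∷ widen , All.map ℕ.<⇒≢ above-P ∷ distinct ,
    trans (cong (suc c *ℕ P +ℕ_) size≡′) (ℕ.m+[n∸m]≡n cP≤n)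
    where
    head-sorted : ∀ {u} → All (λ t → P < mult t) u → SortedByMultiplicity u → SortedByMultiplicity ((suc c , P) ∷ u)
    head-sorted {[]}    _          _  = [-]
    head-sorted {t ∷ _} (P<mt ∷ _) su = ByMultiplicity.LexLe⇒≼ {suc c , P} {t} (inj₁ P<mt) ∷ su

headDegreeAt : ℕ → StackPartition → ℕ
headDegreeAt P []      = 0
headDegreeAt P (s ∷ _) = if mult s ≡ᵇ P then deg s else 0

headDegreeAt-cons⁺ : ∀ K P n c v → 1 ≤ P → v ∈ dyadicPartitions K (2 *ℕ P) n → headDegreeAt P (cons⁺ c P v) ≡ c
headDegreeAt-cons⁺ K P n (suc c) v       1≤P _  rewrite ≡⇒≡ᵇ {P} refl = refl
headDegreeAt-cons⁺ K P n zero    []      1≤P _  = refl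
headDegreeAt-cons⁺ K P n zero    (t ∷ v) 1≤P t∈ with ∈-dyadicPartitions⁻ K (2 *ℕ P) n (t ∷ v) (ℕ.≤-trans 1≤P (P≤2P P)) t∈
... | _ , (_ , mt∈) ∷ _ , _ , _ rewrite ≢⇒≡ᵇ-false (ℕ.>⇒≢ (ℕ.<-≤-trans (P<2P P 1≤P) (DyadicMult-≥ K (2 *ℕ P) (mult t) mt∈))) = refl

dyadicPartitions-unique : ∀ K P n → 1 ≤ P → Unique (dyadicPartitions K P n)
dyadicPartitions-unique zero    P zero    _   = [] ∷ []
dyadicPartitions-unique zero    P (suc n) _   = []
dyadicPartitions-unique (suc K) P n       1≤P =
  concatMap-unique (λ c → map (cons⁺ c P) (dyadicPartitions K (2 *ℕ P) (n ∸ c *ℕ P))) (multiplesUpTo-unique n P)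
    (λ c _ → Unique.map⁺ (cons⁺-injective c) (dyadicPartitions-unique K (2 *ℕ P) (n ∸ c *ℕ P) (ℕ.≤-trans 1≤P (P≤2P P))))
    same-c
  where
  cons⁺-injective : ∀ c {x y} → cons⁺ c P x ≡ cons⁺ c P y → x ≡ y
  cons⁺-injective zero    x≡y = x≡y
  cons⁺-injective (suc c) x≡y = proj₂ (List.∷-injective x≡y)
  same-c : ∀ {c c′ v} → c ∈ multiplesUpTo n P → c′ ∈ multiplesUpTo n P →
    v ∈ map (cons⁺ c P) (dyadicPartitions K (2 *ℕ P) (n ∸ c *ℕ P)) →
    v ∈ map (cons⁺ c′ P) (dyadicPartitions K (2 *ℕ P) (n ∸ c′ *ℕ P)) → c ≡ c′
  same-c {c} {c′} _ _ v∈ v∈′ with ∈.∈-map⁻ (cons⁺ c P) v∈ | ∈.∈-map⁻ (cons⁺ c′ P) v∈′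
  ... | w , w∈ , refl | w′ , w′∈ , eq =
    trans (sym (headDegreeAt-cons⁺ K P _ c w 1≤P w∈)) (trans (cong (headDegreeAt P) eq) (headDegreeAt-cons⁺ K P _ c′ w′ 1≤P w′∈))

exponent<d : (d e : ℕ) → 2 ^ℕ e ≤ d → e < d
exponent<d d e 2^e≤d with e ℕ.<? d
... | yes e<d = e<d
... | no  e≮d = ⊥-elim (ℕ.<⇒≱ (n<2^n d) (ℕ.≤-trans (ℕ.^-monoʳ-≤ 2 (ℕ.≮⇒≥ e≮d)) 2^e≤d))

module GoodAsDyadic (d : ℕ) where

  good⇒dyadic : {τ : StackPartition} → τ ∈ goodStackPartitions d → τ ∈ map sortByDegree (dyadicPartitions d 1 d)
  good⇒dyadic {τ} τ∈ with ∈-goodStackPartitions⁻ d τ∈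
  ... | (pow2 , distinct) , (pos , size≡d , sorted) =
    subst (_∈ map sortByDegree (dyadicPartitions d 1 d)) (sym τ≡) (∈.∈-map⁺ sortByDegree (subst (λ n → v ∈ dyadicPartitions d 1 n) size-v v∈))
    where
    v : StackPartition
    v = sortByMultiplicity τ
    v↭τ : v ↭ τ
    v↭τ = SortByMultiplicity.sort-↭ τ
    dyadic : ∀ {s} → s ∈ τ → DyadicStack d 1 s
    dyadic {s} s∈ with All.lookup pos s∈ | All.lookup pow2 s∈
    ... | 1≤deg , 1≤mult | e , m≡2^e = 1≤deg , pow⇒DyadicMult d 1 (mult s) e (trans m≡2^e (sym (ℕ.*-identityˡ _)))
      (exponent<d d e (subst (_≤ d) m≡2^e (ℕ.≤-trans (ℕ.m≤n*m (mult s) (deg s) {{>-nonZero 1≤deg}})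
                                                  (subst (deg s *ℕ mult s ≤_) size≡d (stack≤size τ s∈)))))
    v∈ : v ∈ dyadicPartitions d 1 (size v)
    v∈ = ∈-dyadicPartitions⁺ d 1 v (s≤s z≤n) (SortByMultiplicity.sort-↗ τ) (↭.All-resp-↭ (↭-sym v↭τ) (All.tabulate dyadic))
           (AllPairs-resp-↭ (_∘ sym) (↭-sym v↭τ) distinct)
    size-v : size v ≡ d
    size-v = trans (∑ℕ-↭ (λ s → deg s *ℕ mult s) v↭τ) size≡d
    τ≡ : τ ≡ sortByDegree v
    τ≡ = sortedByDegree-unique sorted (SortByDegree.sort-↗ v) (↭-trans (↭-sym v↭τ) (↭-sym (SortByDegree.sort-↭ v)))

  dyadic⇒good : {τ : StackPartition} → τ ∈ map sortByDegree (dyadicPartitions d 1 d) → τ ∈ goodStackPartitions d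
  dyadic⇒good τ∈ with ∈.∈-map⁻ sortByDegree τ∈
  ... | v , v∈ , refl with ∈-dyadicPartitions⁻ d 1 d v (s≤s z≤n) v∈
  ...   | _ , dyadic , distinct , size≡d =
    ∈-goodStackPartitions⁺ d (↭.All-resp-↭ τ↭ (All.map pow2 dyadic) , AllPairs-resp-↭ (_∘ sym) τ↭ distinct)
                             (↭.All-resp-↭ τ↭ (All.map positive dyadic) , size-τ , SortByDegree.sort-↗ v)
    where
    τ↭ : v ↭ sortByDegree v
    τ↭ = ↭-sym (SortByDegree.sort-↭ v)
    pow2 : ∀ {s} → DyadicStack d 1 s → PowerOf2Mult s
    pow2 {s} (_ , m∈) with DyadicMult⇒pow d 1 (mult s) m∈
    ... | k , m≡ = k , trans m≡ (ℕ.*-identityˡ _)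
    positive : ∀ {s} → DyadicStack d 1 s → PositiveStack s
    positive {s} (1≤deg , m∈) = 1≤deg , DyadicMult-≥ d 1 (mult s) m∈
    size-τ : size (sortByDegree v) ≡ d
    size-τ = trans (∑ℕ-↭ (λ s → deg s *ℕ mult s) (↭-sym τ↭)) size≡d

  goodStackPartitions↭ : goodStackPartitions d ↭ map sortByDegree (dyadicPartitions d 1 d)
  goodStackPartitions↭ =
    ∼bag⇒↭ (unique∧set⇒bag (goodStackPartitions-unique d)
              (map-unique sortByDegree (dyadicPartitions-unique d 1 d (s≤s z≤n)) sort-injective)
              (mk⇔ good⇒dyadic dyadic⇒good))
    where
    sort-injective : ∀ {v w} → v ∈ dyadicPartitions d 1 d → w ∈ dyadicPartitions d 1 d → sortByDegree v ≡ sortByDegree w → v ≡ w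
    sort-injective {v} {w} v∈ w∈ sv≡sw =
      sortedByMultiplicity-unique (proj₁ (∈-dyadicPartitions⁻ d 1 d v (s≤s z≤n) v∈)) (proj₁ (∈-dyadicPartitions⁻ d 1 d w (s≤s z≤n) w∈))
        (↭-trans (↭-sym (SortByDegree.sort-↭ v)) (subst (_↭ w) (sym sv≡sw) (SortByDegree.sort-↭ w)))

  ΣS-goodStackPartitions : (Ψ : StackPartition → Series) → (∀ {τ τ′} → τ ↭ τ′ → Ψ τ ≋ Ψ τ′) →
    ΣS (map Ψ (goodStackPartitions d)) ≋ ΣS (map Ψ (dyadicPartitions d 1 d))
  ΣS-goodStackPartitions Ψ Ψ-↭ μ =
    trans (∑-map (λ f → f μ) Ψ (goodStackPartitions d))
    (trans (∑-↭ (λ τ → Ψ τ μ) goodStackPartitions↭)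
    (trans (∑-map (λ τ → Ψ τ μ) sortByDegree (dyadicPartitions d 1 d))
    (trans (∑-ext (dyadicPartitions d 1 d) (λ v → Ψ-↭ (SortByDegree.sort-↭ v) μ))
           (sym (∑-map (λ f → f μ) Ψ (dyadicPartitions d 1 d))))))

-- Power series in one variable

<⊎≡+ : (P e : ℕ) → (e < P) ⊎ ∃[ e′ ] (e ≡ e′ +ℕ P)
<⊎≡+ P e with e ℕ.<? P
... | yes e<P = inj₁ e<P
... | no  e≮P = inj₂ (e ∸ P , sym (ℕ.m∸n+n≡m (ℕ.≮⇒≥ e≮P)))

periodic-induction : (Q : ℕ) → 1 ≤ Q → (P : ℕ → Set) → (∀ e → e < Q → P e) → (∀ e → P e → P (e +ℕ Q)) → ∀ e → P e
periodic-induction Q 1≤Q P base step = <-rec P go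
  where
  go : ∀ e → (∀ {e′} → e′ < e → P e′) → P e
  go e rec with <⊎≡+ Q e
  ... | inj₁ e<Q          = base e e<Q
  ... | inj₂ (e′ , refl) = step e′ (rec (ℕ.m<m+n e′ 1≤Q))

∗-cong-≤ : (f : ℕ → ℤ) {g g′ : ℕ → ℤ} (e : ℕ) → (∀ x → x ≤ e → g x ≡ g′ x) → (f ∗ g) e ≡ (f ∗ g′) e
∗-cong-≤ f e g≡g′ = ∑-cong (upTo (suc e)) (λ a _ → cong (f a *_) (g≡g′ (e ∸ a) (ℕ.m∸n≤m e a)))

∗-+ʳ : (f g h : ℕ → ℤ) (e : ℕ) → (f ∗ (λ x → g x + h x)) e ≡ (f ∗ g) e + (f ∗ h) e
∗-+ʳ f g h e = trans (∑-ext (upTo (suc e)) (λ a → ℤ.*-distribˡ-+ (f a) (g (e ∸ a)) (h (e ∸ a))))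
                     (∑-+ (λ a → f a * g (e ∸ a)) (λ a → f a * h (e ∸ a)) (upTo (suc e)))

∗-+ˡ : (f g h : ℕ → ℤ) (e : ℕ) → ((λ x → f x + g x) ∗ h) e ≡ (f ∗ h) e + (g ∗ h) e
∗-+ˡ f g h e = trans (∑-ext (upTo (suc e)) (λ a → ℤ.*-distribʳ-+ (h (e ∸ a)) (f a) (g a)))
                     (∑-+ (λ a → f a * h (e ∸ a)) (λ a → g a * h (e ∸ a)) (upTo (suc e)))

∗-scaleʳ : (f g : ℕ → ℤ) (c : ℤ) (e : ℕ) → (f ∗ (λ x → c * g x)) e ≡ c * (f ∗ g) e
∗-scaleʳ f g c e = trans (∑-ext (upTo (suc e)) (λ a → solve 3 (λ c x y → x :* (c :* y) := c :* (x :* y)) refl c (f a) (g (e ∸ a))))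
                         (sym (∑-*ˡ c (λ a → f a * g (e ∸ a)) (upTo (suc e))))
  where open +-*-Solver

∗-scaleˡ : (f g : ℕ → ℤ) (c : ℤ) (e : ℕ) → ((λ x → c * f x) ∗ g) e ≡ c * (f ∗ g) e
∗-scaleˡ f g c e = trans (∑-ext (upTo (suc e)) (λ a → ℤ.*-assoc c (f a) (g (e ∸ a))))
                         (sym (∑-*ˡ c (λ a → f a * g (e ∸ a)) (upTo (suc e))))

∗-δʳ : (f : ℕ → ℤ) {k e : ℕ} → k ≤ e → (f ∗ δ k) e ≡ f (e ∸ k)
∗-δʳ f {k} {e} k≤e =
  trans (∑-single (λ a → f a * δ k (e ∸ a)) (upTo-unique (suc e)) (∈.∈-upTo⁺ (s≤s (ℕ.m∸n≤m e k)))
           (λ a a∈ a≢ → trans (cong (λ b → f a * 𝟙 b) (≢⇒≡ᵇ-false {e ∸ a} {k} (λ e∸a≡k → a≢ (trans (sym (ℕ.m∸[m∸n]≡n (ℕ.<⇒≤pred (∈-upTo⁻ a∈))))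
                                                                                          (cong (e ∸_) e∸a≡k)))))
                                 (ℤ.*-zeroʳ (f a))))
        (trans (cong (λ b → f (e ∸ k) * 𝟙 b) (≡⇒≡ᵇ (ℕ.m∸[m∸n]≡n k≤e))) (ℤ.*-identityʳ (f (e ∸ k))))

∗-δʳ-< : (f : ℕ → ℤ) {k e : ℕ} → e < k → (f ∗ δ k) e ≡ 0ℤ
∗-δʳ-< f {k} {e} e<k =
  ∑-zero (upTo (suc e)) (λ a _ → trans (cong (λ b → f a * 𝟙 b) (≢⇒≡ᵇ-false {e ∸ a} {k} (λ e∸a≡k → ℕ.<⇒≱ e<k (subst (_≤ e) e∸a≡k (ℕ.m∸n≤m e a)))))
                                       (ℤ.*-zeroʳ (f a)))

∗-δˡ : (g : ℕ → ℤ) {k e : ℕ} → k ≤ e → (δ k ∗ g) e ≡ g (e ∸ k)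
∗-δˡ g {k} {e} k≤e =
  trans (∑-single (λ a → δ k a * g (e ∸ a)) (upTo-unique (suc e)) (∈.∈-upTo⁺ (s≤s k≤e))
           (λ a _ a≢k → cong (_* g (e ∸ a)) (cong 𝟙 (≢⇒≡ᵇ-false a≢k))))
        (trans (cong (λ b → 𝟙 b * g (e ∸ k)) (≡⇒≡ᵇ {k} refl)) (ℤ.*-identityˡ (g (e ∸ k))))

∗-δˡ-< : (g : ℕ → ℤ) {k e : ℕ} → e < k → (δ k ∗ g) e ≡ 0ℤ
∗-δˡ-< g {k} {e} e<k =
  ∑-zero (upTo (suc e)) (λ a a∈ → cong (_* g (e ∸ a)) (cong 𝟙 (≢⇒≡ᵇ-false {a} {k} (λ { refl → ℕ.<⇒≱ e<k (ℕ.<⇒≤pred (∈-upTo⁻ a∈)) }))))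

dilate-* : (P : ℕ) → 1 ≤ P → (φ : ℕ → ℤ) (k : ℕ) → dilate P φ (k *ℕ P) ≡ φ k
dilate-* P 1≤P φ k =
  trans (∑-single (λ a → 𝟙 (P *ℕ a ≡ᵇ k *ℕ P) * φ a) (upTo-unique (suc (k *ℕ P))) (∈.∈-upTo⁺ (s≤s (ℕ.m≤m*n k P {{>-nonZero 1≤P}})))
           (λ a _ a≢k → cong (_* φ a) (cong 𝟙 (≢⇒≡ᵇ-false (λ Pa≡kP → a≢k (ℕ.*-cancelˡ-≡ a k P {{>-nonZero 1≤P}} (trans Pa≡kP (ℕ.*-comm k P))))))))
        (trans (cong (λ b → 𝟙 b * φ k) (≡⇒≡ᵇ (ℕ.*-comm P k))) (ℤ.*-identityˡ (φ k)))

dilate-∤ : (P : ℕ) (φ : ℕ → ℤ) {e : ℕ} → ¬ P ∣ e → dilate P φ e ≡ 0ℤ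
dilate-∤ P φ {e} P∤e = ∑-zero (upTo (suc e)) (λ a _ → vanish a)
  where
  vanish : ∀ a → 𝟙 (P *ℕ a ≡ᵇ e) * φ a ≡ 0ℤ
  vanish a with P *ℕ a ≡ᵇ e in Pa≡e
  ... | true  = ⊥-elim (P∤e (divides a (trans (sym (≡ᵇ⇒≡ _ _ Pa≡e)) (ℕ.*-comm P a))))
  ... | false = refl

dilate-below : (P : ℕ) → 1 ≤ P → (φ : ℕ → ℤ) {e : ℕ} → e < P → dilate P φ e ≡ δ 0 e * φ 0
dilate-below P 1≤P φ {zero}  _     = trans (dilate-* P 1≤P φ 0) (sym (ℤ.*-identityˡ (φ 0)))
dilate-below P 1≤P φ {suc e} e<P = dilate-∤ P φ (λ P∣e → ℕ.<⇒≱ e<P (∣⇒≤ P∣e))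

dilate-shift : (P : ℕ) → 1 ≤ P → (φ : ℕ → ℤ) (e : ℕ) → dilate P φ (e +ℕ P) ≡ dilate P (φ ∘ suc) e
dilate-shift P 1≤P φ e with P ∣? e
... | yes (divides-refl k) = trans (cong (dilate P φ) (ℕ.+-comm (k *ℕ P) P))
                                   (trans (dilate-* P 1≤P φ (suc k)) (sym (dilate-* P 1≤P (φ ∘ suc) k)))
... | no  P∤e = trans (dilate-∤ P φ (λ P∣e+P → P∤e (∣m+n∣m⇒∣n (subst (P ∣_) (ℕ.+-comm e P) P∣e+P) (∣-refl {P}))))
                      (sym (dilate-∤ P (φ ∘ suc) P∤e))

dilate-shift² : (P : ℕ) → 1 ≤ P → (φ : ℕ → ℤ) (e : ℕ) → dilate P φ (e +ℕ 2 *ℕ P) ≡ dilate P (φ ∘ suc ∘ suc) e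
dilate-shift² P 1≤P φ e =
  trans (cong (dilate P φ) (solve 2 (λ e P → e :+ con 2 :* P := (e :+ P) :+ P) refl e P))
        (trans (dilate-shift P 1≤P φ (e +ℕ P)) (dilate-shift P 1≤P (φ ∘ suc) e))
  where open ℕ-Solver

dilate-local : (P : ℕ) {φ ψ : ℕ → ℤ} (e : ℕ) → (∀ a → a *ℕ P ≡ e → φ a ≡ ψ a) → dilate P φ e ≡ dilate P ψ e
dilate-local P {φ} {ψ} e φ≡ψ = ∑-ext (upTo (suc e)) term
  where
  term : ∀ a → 𝟙 (P *ℕ a ≡ᵇ e) * φ a ≡ 𝟙 (P *ℕ a ≡ᵇ e) * ψ a
  term a with P *ℕ a ≡ᵇ e in Pa≡e
  ... | true  = cong (1ℤ *_) (φ≡ψ a (trans (ℕ.*-comm a P) (≡ᵇ⇒≡ _ _ Pa≡e)))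
  ... | false = refl

dilate-linear : (P : ℕ) → 1 ≤ P → (φ : ℕ → ℤ) → (∀ a → φ (suc (suc a)) ≡ 0ℤ) →
  (e : ℕ) → dilate P φ e ≡ φ 0 * δ 0 e + φ 1 * δ P e
dilate-linear P 1≤P φ φ≥2≡0 e with P ∣? e
... | no P∤e = trans (dilate-∤ P φ P∤e) (sym (cong₂ _+_
                 (trans (cong (λ b → φ 0 * 𝟙 b) (≢⇒≡ᵇ-false {e} {0} (λ { refl → P∤e (P ∣0) }))) (ℤ.*-zeroʳ (φ 0)))
                 (trans (cong (λ b → φ 1 * 𝟙 b) (≢⇒≡ᵇ-false {e} {P} (λ { refl → P∤e (∣-refl {P}) }))) (ℤ.*-zeroʳ (φ 1)))))
... | yes (divides-refl k) = trans (dilate-* P 1≤P φ k) (coefficient k)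
  where
  coefficient : ∀ k → φ k ≡ φ 0 * δ 0 (k *ℕ P) + φ 1 * δ P (k *ℕ P)
  coefficient zero          rewrite ≢⇒≡ᵇ-false {0} {P} (ℕ.<⇒≢ 1≤P) = solve 2 (λ a b → a := a :* con 1ℤ :+ b :* con 0ℤ) refl (φ 0) (φ 1)
    where open +-*-Solver
  coefficient (suc zero)    rewrite ℕ.+-identityʳ P | ≢⇒≡ᵇ-false {P} {0} (ℕ.<⇒≢ 1≤P ∘ sym) | ≡⇒≡ᵇ {P} refl =
    solve 2 (λ a b → b := a :* con 0ℤ :+ b :* con 1ℤ) refl (φ 0) (φ 1)
    where open +-*-Solver
  coefficient (suc (suc k)) rewrite φ≥2≡0 k
                                  | ≢⇒≡ᵇ-false {suc (suc k) *ℕ P} {0} (ℕ.<⇒≢ (ℕ.≤-trans 1≤P (ℕ.m≤m+n P _)) ∘ sym)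
                                  | ≢⇒≡ᵇ-false {suc (suc k) *ℕ P} {P} (ℕ.<⇒≢ (ℕ.m<m+n P (ℕ.≤-trans 1≤P (ℕ.m≤m+n P (k *ℕ P)))) ∘ sym) =
    solve 2 (λ a b → con 0ℤ := a :* con 0ℤ :+ b :* con 0ℤ) refl (φ 0) (φ 1)
    where open +-*-Solver

[1+x]⁻¹-suc² : (a : ℕ) → [1+x]⁻¹ (suc (suc a)) ≡ [1+x]⁻¹ a
[1+x]⁻¹-suc² a = trans (sym (ℤ.*-assoc -1ℤ -1ℤ (-1ℤ ^ a))) (ℤ.*-identityˡ (-1ℤ ^ a))

dilate-[1+x]⁻¹-below : (Q : ℕ) {e : ℕ} → e < 2 *ℕ Q → dilate Q [1+x]⁻¹ e ≡ dilate Q [1-x] e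
dilate-[1+x]⁻¹-below Q {e} e<2Q = dilate-local Q e low-coefficients
  where
  low-coefficients : ∀ a → a *ℕ Q ≡ e → [1+x]⁻¹ a ≡ [1-x] a
  low-coefficients zero          _    = refl
  low-coefficients (suc zero)    _    = refl
  low-coefficients (suc (suc a)) aQ≡e =
    ⊥-elim (ℕ.<⇒≱ e<2Q (subst (2 *ℕ Q ≤_) aQ≡e (ℕ.≤-trans (ℕ.≤-reflexive (cong (Q +ℕ_) (ℕ.+-identityʳ Q)))
                                                          (ℕ.+-monoʳ-≤ Q (ℕ.m≤m+n Q _)))))

dilate-[1-x]-vanishes : (Q : ℕ) → 1 ≤ Q → (e : ℕ) → dilate Q [1-x] (e +ℕ 2 *ℕ Q) ≡ 0ℤ
dilate-[1-x]-vanishes Q 1≤Q e =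
  trans (dilate-shift² Q 1≤Q [1-x] e) (∑-zero (upTo (suc e)) (λ a _ → ℤ.*-zeroʳ (𝟙 (Q *ℕ a ≡ᵇ e))))

dilate-[1-x]-step : (Q : ℕ) → 1 ≤ Q → (e : ℕ) → (dilate Q [1+x]⁻¹ ∗ dilate (2 *ℕ Q) [1-x]) e ≡ dilate Q [1-x] e
dilate-[1-x]-step Q 1≤Q e = begin
  (f ∗ dilate (2 *ℕ Q) [1-x]) e
    ≡⟨ ∗-cong-≤ f e (λ x _ → dilate-linear (2 *ℕ Q) (ℕ.≤-trans 1≤Q (P≤2P Q)) [1-x] (λ _ → refl) x) ⟩
  (f ∗ (λ x → 1ℤ * δ 0 x + -1ℤ * δ (2 *ℕ Q) x)) e
    ≡⟨ ∗-+ʳ f (λ x → 1ℤ * δ 0 x) (λ x → -1ℤ * δ (2 *ℕ Q) x) e ⟩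
  (f ∗ (λ x → 1ℤ * δ 0 x)) e + (f ∗ (λ x → -1ℤ * δ (2 *ℕ Q) x)) e
    ≡⟨ cong₂ _+_ (trans (∗-scaleʳ f (δ 0) 1ℤ e) (trans (ℤ.*-identityˡ _) (∗-δʳ f z≤n)))
                 (trans (∗-scaleʳ f (δ (2 *ℕ Q)) -1ℤ e) (ℤ.-1*i≡-i _)) ⟩
  f e - (f ∗ δ (2 *ℕ Q)) e
    ≡⟨ by-size (<⊎≡+ (2 *ℕ Q) e) ⟩
  dilate Q [1-x] e ∎
  where
  open ≡-Reasoning
  f : ℕ → ℤ
  f = dilate Q [1+x]⁻¹
  by-size : (e < 2 *ℕ Q) ⊎ ∃[ e′ ] (e ≡ e′ +ℕ 2 *ℕ Q) → f e - (f ∗ δ (2 *ℕ Q)) e ≡ dilate Q [1-x] e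
  by-size (inj₁ e<2Q) = begin
    f e - (f ∗ δ (2 *ℕ Q)) e  ≡⟨ cong (λ x → f e - x) (∗-δʳ-< f e<2Q) ⟩
    f e + 0ℤ                   ≡⟨ ℤ.+-identityʳ (f e) ⟩
    f e                        ≡⟨ dilate-[1+x]⁻¹-below Q e<2Q ⟩
    dilate Q [1-x] e           ∎
  by-size (inj₂ (e′ , refl)) = begin
    f (e′ +ℕ 2 *ℕ Q) - (f ∗ δ (2 *ℕ Q)) (e′ +ℕ 2 *ℕ Q)
      ≡⟨ cong (λ x → f (e′ +ℕ 2 *ℕ Q) - x) (trans (∗-δʳ f (ℕ.m≤n+m (2 *ℕ Q) e′)) (cong f (ℕ.m+n∸n≡m e′ (2 *ℕ Q)))) ⟩
    f (e′ +ℕ 2 *ℕ Q) - f e′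
      ≡⟨ cong (_- f e′) (trans (dilate-shift² Q 1≤Q [1+x]⁻¹ e′) (dilate-local Q e′ (λ a _ → [1+x]⁻¹-suc² a))) ⟩
    f e′ - f e′
      ≡⟨ ℤ.+-inverseʳ (f e′) ⟩
    0ℤ
      ≡⟨ sym (dilate-[1-x]-vanishes Q 1≤Q e′) ⟩
    dilate Q [1-x] (e′ +ℕ 2 *ℕ Q) ∎

dilate-[1-x]⁻¹-below : (Q : ℕ) → 1 ≤ Q → {x : ℕ} → x < Q → dilate (2 *ℕ Q) [1-x]⁻¹ x ≡ dilate Q [1-x]⁻¹ x
dilate-[1-x]⁻¹-below Q 1≤Q x<Q =
  trans (dilate-below (2 *ℕ Q) (ℕ.≤-trans 1≤Q (P≤2P Q)) [1-x]⁻¹ (ℕ.<-≤-trans x<Q (P≤2P Q)))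
        (sym (dilate-below Q 1≤Q [1-x]⁻¹ x<Q))

-- The left side is [2Q ∣ x + Q] + [2Q ∣ x] and the right side [Q ∣ x]: when Q ∣ x, exactly one of
-- x + Q and x is a multiple of 2Q.
dilate-[1-x]⁻¹-consecutive : (Q : ℕ) → 1 ≤ Q → (x : ℕ) →
  dilate (2 *ℕ Q) [1-x]⁻¹ (x +ℕ Q) + dilate (2 *ℕ Q) [1-x]⁻¹ x ≡ dilate Q [1-x]⁻¹ x
dilate-[1-x]⁻¹-consecutive Q 1≤Q = periodic-induction Q 1≤Q (λ x → g (x +ℕ Q) + g x ≡ h x) base step
  where
  open ≡-Reasoning
  g h : ℕ → ℤ
  g = dilate (2 *ℕ Q) [1-x]⁻¹
  h = dilate Q [1-x]⁻¹
  1≤2Q : 1 ≤ 2 *ℕ Q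
  1≤2Q = ℕ.≤-trans 1≤Q (P≤2P Q)
  base : ∀ x → x < Q → g (x +ℕ Q) + g x ≡ h x
  base x x<Q = begin
    g (x +ℕ Q) + g x
      ≡⟨ cong (_+ g x) (dilate-below (2 *ℕ Q) 1≤2Q [1-x]⁻¹ (subst (x +ℕ Q <_) (cong (Q +ℕ_) (sym (ℕ.+-identityʳ Q))) (ℕ.+-monoˡ-< Q x<Q))) ⟩
    δ 0 (x +ℕ Q) * 1ℤ + g x
      ≡⟨ cong (λ b → 𝟙 b * 1ℤ + g x) (≢⇒≡ᵇ-false {x +ℕ Q} {0} (λ x+Q≡0 → ℕ.<⇒≢ 1≤Q (sym (ℕ.m+n≡0⇒n≡0 x x+Q≡0)))) ⟩
    0ℤ + g x
      ≡⟨ trans (ℤ.+-identityˡ (g x)) (dilate-[1-x]⁻¹-below Q 1≤Q x<Q) ⟩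
    h x ∎
  step : ∀ x → g (x +ℕ Q) + g x ≡ h x → g (x +ℕ Q +ℕ Q) + g (x +ℕ Q) ≡ h (x +ℕ Q)
  step x hyp = begin
    g (x +ℕ Q +ℕ Q) + g (x +ℕ Q)
      ≡⟨ cong (λ y → g y + g (x +ℕ Q)) (solve 2 (λ x Q → x :+ Q :+ Q := x :+ con 2 :* Q) refl x Q) ⟩
    g (x +ℕ 2 *ℕ Q) + g (x +ℕ Q)
      ≡⟨ cong (_+ g (x +ℕ Q)) (dilate-shift (2 *ℕ Q) 1≤2Q [1-x]⁻¹ x) ⟩
    g x + g (x +ℕ Q)
      ≡⟨ trans (ℤ.+-comm (g x) (g (x +ℕ Q))) hyp ⟩
    h x
      ≡⟨ sym (dilate-shift Q 1≤Q [1-x]⁻¹ x) ⟩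
    h (x +ℕ Q) ∎
    where open ℕ-Solver

dilate-[1-x]⁻¹-step : (Q : ℕ) → 1 ≤ Q → (e : ℕ) → (dilate Q [1+x] ∗ dilate (2 *ℕ Q) [1-x]⁻¹) e ≡ dilate Q [1-x]⁻¹ e
dilate-[1-x]⁻¹-step Q 1≤Q e = begin
  (dilate Q [1+x] ∗ g) e
    ≡⟨ ∑-ext (upTo (suc e)) (λ a → cong (_* g (e ∸ a)) (dilate-linear Q 1≤Q [1+x] (λ _ → refl) a)) ⟩
  ((λ x → 1ℤ * δ 0 x + 1ℤ * δ Q x) ∗ g) e
    ≡⟨ ∗-+ˡ (λ x → 1ℤ * δ 0 x) (λ x → 1ℤ * δ Q x) g e ⟩
  ((λ x → 1ℤ * δ 0 x) ∗ g) e + ((λ x → 1ℤ * δ Q x) ∗ g) e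
    ≡⟨ cong₂ _+_ (trans (∗-scaleˡ (δ 0) g 1ℤ e) (trans (ℤ.*-identityˡ _) (∗-δˡ g z≤n)))
                 (trans (∗-scaleˡ (δ Q) g 1ℤ e) (ℤ.*-identityˡ _)) ⟩
  g e + (δ Q ∗ g) e
    ≡⟨ by-size (<⊎≡+ Q e) ⟩
  dilate Q [1-x]⁻¹ e ∎
  where
  open ≡-Reasoning
  g : ℕ → ℤ
  g = dilate (2 *ℕ Q) [1-x]⁻¹
  by-size : (e < Q) ⊎ ∃[ e′ ] (e ≡ e′ +ℕ Q) → g e + (δ Q ∗ g) e ≡ dilate Q [1-x]⁻¹ e
  by-size (inj₁ e<Q)        =
    trans (cong (g e +_) (∗-δˡ-< g e<Q)) (trans (ℤ.+-identityʳ (g e)) (dilate-[1-x]⁻¹-below Q 1≤Q e<Q))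
  by-size (inj₂ (e′ , refl)) = begin
    g (e′ +ℕ Q) + (δ Q ∗ g) (e′ +ℕ Q)
      ≡⟨ cong (g (e′ +ℕ Q) +_) (trans (∗-δˡ g (ℕ.m≤n+m Q e′)) (cong g (ℕ.m+n∸n≡m e′ Q))) ⟩
    g (e′ +ℕ Q) + g e′
      ≡⟨ dilate-[1-x]⁻¹-consecutive Q 1≤Q e′ ⟩
    dilate Q [1-x]⁻¹ e′
      ≡⟨ sym (dilate-shift Q 1≤Q [1-x]⁻¹ e′) ⟩
    dilate Q [1-x]⁻¹ (e′ +ℕ Q) ∎

dyadicProduct-telescopes : (φ ψ : ℕ → ℤ) → ψ 0 ≡ 1ℤ →
  (∀ Q → 1 ≤ Q → ∀ e → (dilate Q φ ∗ dilate (2 *ℕ Q) ψ) e ≡ dilate Q ψ e) →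
  ∀ K Q e → 1 ≤ Q → e < Q *ℕ 2 ^ℕ K → dyadicProduct φ K Q e ≡ dilate Q ψ e
dyadicProduct-telescopes φ ψ ψ0≡1 step zero    Q e 1≤Q e<Q =
  sym (trans (dilate-below Q 1≤Q ψ (subst (e <_) (ℕ.*-identityʳ Q) e<Q))
             (trans (cong (δ 0 e *_) ψ0≡1) (ℤ.*-identityʳ (δ 0 e))))
dyadicProduct-telescopes φ ψ ψ0≡1 step (suc K) Q e 1≤Q e< =
  trans (∗-cong-≤ (dilate Q φ) e (λ x x≤e → dyadicProduct-telescopes φ ψ ψ0≡1 step K (2 *ℕ Q) x
                                               (ℕ.≤-trans 1≤Q (P≤2P Q)) (ℕ.≤-<-trans x≤e (subst (e <_) regroup e<))))
        (step Q 1≤Q e)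
  where
  regroup : Q *ℕ 2 ^ℕ suc K ≡ 2 *ℕ Q *ℕ 2 ^ℕ K
  regroup = solve 2 (λ Q x → Q :* (con 2 :* x) := con 2 :* Q :* x) refl Q (2 ^ℕ K)
    where open ℕ-Solver

at-stack≋ΣS-at-part : (F G : ℕ → Series) (φ ψ : ℕ → ℤ) → φ 0 ≡ 1ℤ → ψ 0 ≡ 1ℤ →
  (∀ c → F c ≋ prodSeries c φ) → (∀ c → G c ≋ prodSeries c ψ) →
  (∀ Q → 1 ≤ Q → ∀ e → (dilate Q φ ∗ dilate (2 *ℕ Q) ψ) e ≡ dilate Q ψ e) →
  (d m : ℕ) → 1 ≤ m → G at-stack (d , m) ≋ ΣS (map (λ τ → F at-part (m ·τ τ)) (goodStackPartitions d))
at-stack≋ΣS-at-part F G φ ψ φ0≡1 ψ0≡1 F≋ G≋ step d m 1≤m = begin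
  G at-stack (d , m)
    ≈⟨ subst^-cong m (G≋ d) ⟩
  subst^ m (prodSeries d ψ)
    ≈⟨ subst^-prodSeries m 1≤m d ψ ⟩
  prodSeries (d *ℕ m) (dilate m ψ)
    ≈⟨ prodSeries-local (d *ℕ m) (dilate m ψ) (dyadicProduct φ d (m *ℕ 1)) (λ e e≤dm → sym (telescoped e e≤dm)) ⟩
  prodSeries (d *ℕ m) (dyadicProduct φ d (m *ℕ 1))
    ≈⟨ ≋-sym (DyadicSum.ΣS-dyadicPartitions F φ φ0≡1 F≋ m 1≤m d 1 d (s≤s z≤n)) ⟩
  ΣS (map Φ (dyadicPartitions d 1 d))
    ≈⟨ ≋-sym (GoodAsDyadic.ΣS-goodStackPartitions d Φ (λ τ↭τ′ → at-part-↭ F (↭.map⁺ (λ s → deg s , m *ℕ mult s) τ↭τ′))) ⟩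
  ΣS (map Φ (goodStackPartitions d)) ∎
  where
  open ≋-Reasoning
  Φ : StackPartition → Series
  Φ τ = F at-part (m ·τ τ)
  dm<m·2^d : d *ℕ m < m *ℕ 1 *ℕ 2 ^ℕ d
  dm<m·2^d = subst (d *ℕ m <_) (solve 2 (λ m x → x :* m := m :* con 1 :* x) refl m (2 ^ℕ d))
                   (ℕ.*-monoˡ-< m {{>-nonZero 1≤m}} (n<2^n d))
    where open ℕ-Solver
  telescoped : ∀ e → e ≤ d *ℕ m → dyadicProduct φ d (m *ℕ 1) e ≡ dilate m ψ e
  telescoped e e≤dm =
    trans (dyadicProduct-telescopes φ ψ ψ0≡1 step d (m *ℕ 1) e (subst (1 ≤_) (sym (ℕ.*-identityʳ m)) 1≤m)
                                    (ℕ.≤-<-trans e≤dm dm<m·2^d))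
          (cong (λ Q → dilate Q ψ e) (ℕ.*-identityʳ m))

-- The identity also holds for d = 0.
mainTheorem6 : (d m : ℕ) → 1 ≤ d → 1 ≤ m →
    (E at-stack (d , m) ≋ ΣS (map (λ τ → H⁺ at-part (m ·τ τ)) (goodStackPartitions d)))
    × (H at-stack (d , m) ≋ ΣS (map (λ τ → E⁺ at-part (m ·τ τ)) (goodStackPartitions d)))
mainTheorem6 d m _ 1≤m =
  at-stack≋ΣS-at-part H⁺ E [1+x]⁻¹ [1-x] refl refl H⁺≋prodSeries E≋prodSeries dilate-[1-x]-step d m 1≤m ,
  at-stack≋ΣS-at-part E⁺ H [1+x] [1-x]⁻¹ refl refl E⁺≋prodSeries H≋prodSeries dilate-[1-x]⁻¹-step d m 1≤m
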